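{- Let $q$ be a prime power and let $\Delta:E(H_q)\to\{R,B\}$ be a two-coloring. For $v\in V(H_q)$ let $R_\Delta(v)$ (resp. $B_\Delta(v)$) denote the number of triangles of $\mathscr{T}_q$ containing $v$ in which both edges incident to $v$ are red (resp. blue). Then the number of triangles in $\mathscr{T}_q$ that are monochromatic under $\Delta$ equals $$\frac{1}{2}\left(\sum_{v\in V(H_q)}\big(R_\Delta(v)+B_\Delta(v)\big)-\frac{1}{6}(q^4-q^3+q^2)(q^3-q)(q+1)q\right).$$
   Context: For a prime power $q$, let $PG(2,q^2)$ be the projective plane over $\mathbb{F}_{q^2}$, whose points are the one-dimensional subspaces $\langle X,Y,Z\rangle$ of $\mathbb{F}_{q^2}^3$. The Hermitian unital is $\mathscr{U}_q=\{\langle X,Y,Z\rangle : X^{q+1}+Y^{q+1}+Z^{q+1}=0\}$. Every line of $PG(2,q^2)$ meets $\mathscr{U}_q$ in either exactly $1$ or exactly $q+1$ points; lines of the latter kind are called secants, and $\mathscr{L}_q$ denotes the set of secants. $H_q$ is the graph with vertex set $\{v_\ell : \ell\in\mathscr{L}_q\}$, where $v_{\ell_1}\sim v_{\ell_2}$ iff $\ell_1\neq\ell_2$ and $\ell_1\cap\ell_2\in\mathscr{U}_q$. A triangle $v_{\ell_1}v_{\ell_2}v_{\ell_3}$ of $H_q$ is non-degenerate if the three points $\ell_1\cap\ell_2$, $\ell_2\cap\ell_3$, $\ell_1\cap\ell_3$ are pairwise distinct; $\mathscr{T}_q$ is the set of non-degenerate triangles of $H_q$. -}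

module Defs where

open import Data.Nat as ℕ using (ℕ; zero; suc; _≤_; _^_)
open import Data.Product using (Σ; ∃; ∃₂; _×_; _,_)
open import Data.Product.Properties using (≡-dec)
open import Data.Sum using (_⊎_)
open import Data.List using (List; []; _∷_; map; _++_; concatMap; filter; length)
open import Data.Nat.ListAction using (sum)
open import Data.List.Membership.Propositional using (_∈_)
open import Data.List.Relation.Unary.Unique.Propositional using (Unique)
open import Data.List.Relation.Unary.Any using (Any; any?)
open import Data.Nat.Primality using (Prime)
open import Relation.Nullary using (¬_; Dec; yes; no)
open import Relation.Nullary.Decidable using (_×-dec_; _⊎-dec_; ¬?)
open import Relation.Binary.PropositionalEquality using (_≡_; _≢_; refl)
open import Relation.Binary.Definitions using (DecidableEquality)
open import Algebra.Core using (Op₁; Op₂)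
open import Algebra.Structures using (IsCommutativeRing)

IsPrimePower : ℕ → Set
IsPrimePower q = ∃₂ λ p k → Prime p × 1 ≤ k × q ≡ p ^ k

record FiniteField : Set₁ where
  field
    Carrier  : Set
    _≟_      : DecidableEquality Carrier
    0# 1#    : Carrier
    _+_ _*_  : Op₂ Carrier
    -_       : Op₁ Carrier
    isCommutativeRing : IsCommutativeRing _≡_ _+_ _*_ -_ 0# 1#
    0≢1      : 0# ≢ 1#
    inverse  : ∀ x → x ≢ 0# → ∃ λ y → x * y ≡ 1#
    elements : List Carrier
    elements-complete : ∀ x → x ∈ elements
    elements-unique   : Unique elements

data Color : Set where
  red blue : Color

_≟C_ : DecidableEquality Color
red ≟C red = yes refl
red ≟C blue = no λ ()
blue ≟C red = no λ ()
blue ≟C blue = yes refl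

-- unordered 2- and 3-subsets of a list (by position, i<j<k)
pairs : ∀ {A : Set} → List A → List (A × A)
pairs [] = []
pairs (x ∷ xs) = map (λ y → (x , y)) xs ++ pairs xs

combos3 : ∀ {A : Set} → List A → List (A × A × A)
combos3 [] = []
combos3 (x ∷ xs) = map (λ { (y , z) → (x , y , z) }) (pairs xs) ++ combos3 xs

-- Geometry of PG(2,F) where F is a field (of order q², in the theorem)
module Geometry (F : FiniteField) (q : ℕ) where
  open FiniteField F

  _^F_ : Carrier → ℕ → Carrier
  x ^F zero = 1#
  x ^F suc n = x * (x ^F n)

  Triple : Set
  Triple = Carrier × Carrier × Carrier

  _≟T_ : DecidableEquality Triple
  _≟T_ = ≡-dec _≟_ (≡-dec _≟_ _≟_)

  -- canonical representative of a 1-dim subspace: first nonzero coordinate is 1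
  Normalized : Triple → Set
  Normalized (x , y , z) =
    (x ≡ 1#) ⊎ ((x ≡ 0#) × (y ≡ 1#)) ⊎ ((x ≡ 0#) × (y ≡ 0#) × (z ≡ 1#))

  normalized? : (t : Triple) → Dec (Normalized t)
  normalized? (x , y , z) =
    (x ≟ 1#) ⊎-dec ((x ≟ 0#) ×-dec (y ≟ 1#)) ⊎-dec ((x ≟ 0#) ×-dec (y ≟ 0#) ×-dec (z ≟ 1#))

  allTriples : List Triple
  allTriples = concatMap (λ x → concatMap (λ y → map (λ z → (x , y , z)) elements) elements) elements

  points : List Triple
  points = filter normalized? allTriples

  -- lines of PG(2,F): line ⟨a,b,c⟩ = {⟨X,Y,Z⟩ : aX+bY+cZ = 0}, represented once
  lines : List Triple
  lines = filter normalized? allTriples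

  _I_ : Triple → Triple → Set
  (x , y , z) I (a , b , c) = ((a * x) + (b * y)) + (c * z) ≡ 0#

  _I?_ : (P ℓ : Triple) → Dec (P I ℓ)
  (x , y , z) I? (a , b , c) = (((a * x) + (b * y)) + (c * z)) ≟ 0#

  InU : Triple → Set
  InU (x , y , z) = ((x ^F suc q) + (y ^F suc q)) + (z ^F suc q) ≡ 0#

  inU? : (P : Triple) → Dec (InU P)
  inU? (x , y , z) = (((x ^F suc q) + (y ^F suc q)) + (z ^F suc q)) ≟ 0#

  unital : List Triple
  unital = filter inU? points

  Secant : Triple → Set
  Secant ℓ = length (filter (λ P → P I? ℓ) unital) ≡ suc q

  secants : List Triple
  secants = filter (λ ℓ → length (filter (λ P → P I? ℓ) unital) ℕ.≟ suc q) lines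

  Adjacent : Triple → Triple → Set
  Adjacent ℓ m = (¬ ℓ ≡ m) × Any (λ P → P I ℓ × P I m) unital

  adjacent? : (ℓ m : Triple) → Dec (Adjacent ℓ m)
  adjacent? ℓ m = ¬? (ℓ ≟T m) ×-dec any? (λ P → (P I? ℓ) ×-dec (P I? m)) unital

  DistinctMeets : Triple → Triple → Triple → Triple → Set
  DistinctMeets ℓ₁ ℓ₂ m₁ m₂ = ¬ Any (λ P → (P I ℓ₁ × P I ℓ₂) × (P I m₁ × P I m₂)) points

  distinctMeets? : ∀ ℓ₁ ℓ₂ m₁ m₂ → Dec (DistinctMeets ℓ₁ ℓ₂ m₁ m₂)
  distinctMeets? ℓ₁ ℓ₂ m₁ m₂ =
    ¬? (any? (λ P → ((P I? ℓ₁) ×-dec (P I? ℓ₂)) ×-dec ((P I? m₁) ×-dec (P I? m₂))) points)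

  IsTriangle : Triple × Triple × Triple → Set
  IsTriangle (a , b , c) =
    Adjacent a b × Adjacent b c × Adjacent a c ×
    DistinctMeets a b b c × DistinctMeets b c a c × DistinctMeets a b a c

  isTriangle? : (t : Triple × Triple × Triple) → Dec (IsTriangle t)
  isTriangle? (a , b , c) =
    adjacent? a b ×-dec adjacent? b c ×-dec adjacent? a c ×-dec
    distinctMeets? a b b c ×-dec distinctMeets? b c a c ×-dec distinctMeets? a b a c

  triangles : List (Triple × Triple × Triple)
  triangles = filter isTriangle? (combos3 secants)

  module Colored (Δ : Triple → Triple → Color) where

    Mono : Triple × Triple × Triple → Set
    Mono (a , b , c) = (Δ a b ≡ Δ b c) × (Δ b c ≡ Δ a c)

    mono? : (t : Triple × Triple × Triple) → Dec (Mono t)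
    mono? (a , b , c) = (Δ a b ≟C Δ b c) ×-dec (Δ b c ≟C Δ a c)

    monoCount : ℕ
    monoCount = length (filter mono? triangles)

    BothAt : Color → Triple → Triple × Triple × Triple → Set
    BothAt κ v (a , b , c) =
      ((v ≡ a) × (Δ a b ≡ κ) × (Δ a c ≡ κ)) ⊎
      ((v ≡ b) × (Δ b a ≡ κ) × (Δ b c ≡ κ)) ⊎
      ((v ≡ c) × (Δ c a ≡ κ) × (Δ c b ≡ κ))

    bothAt? : ∀ κ v t → Dec (BothAt κ v t)
    bothAt? κ v (a , b , c) =
      ((v ≟T a) ×-dec (Δ a b ≟C κ) ×-dec (Δ a c ≟C κ)) ⊎-dec
      ((v ≟T b) ×-dec (Δ b a ≟C κ) ×-dec (Δ b c ≟C κ)) ⊎-dec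
      ((v ≟T c) ×-dec (Δ c a ≟C κ) ×-dec (Δ c b ≟C κ))

    R[_] B[_] : Triple → ℕ
    R[ v ] = length (filter (bothAt? red v) triangles)
    B[ v ] = length (filter (bothAt? blue v) triangles)

    sumRB : ℕ
    sumRB = sum (map (λ v → R[ v ] ℕ.+ B[ v ]) secants)

module Submission where

-- A triangle of 𝒯_q has three corners whose two edges share a colour if it is monochromatic,
-- and exactly one otherwise; hence ∑_v (R(v) + B(v)) = |𝒯_q| + 2·#monochromatic, and it remains
-- to show 6 |𝒯_q| = (q³ + 1) q³ (q³ - q).  Sending an ordered non-collinear triple (P, Q, R) of
-- points of 𝒰_q to (PQ, PR, QR) is a bijection onto the ordered triangles, and there are
-- (q³ + 1) q³ (q³ - q) such triples because |𝒰_q| = q³ + 1 and every secant carries q + 1 points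
-- of 𝒰_q.  Both counts rest on the arithmetic of 𝔽_{q²} over 𝔽_q: σ x = x^q is an involutive
-- automorphism whose fixed field has q elements, the trace x + σ x has fibres of size q and the
-- norm x^{q+1} has fibres of size q + 1 over nonzero fixed elements.  On the secant through
-- P, Q ∈ 𝒰_q the point P + tQ lies on 𝒰_q exactly when Tr (t h(Q, P)) = 0, h the Hermitian form.

open import Defs

open import Algebra.Bundles using (CommutativeRing)
open import Algebra.Core using (Op₁; Op₂)
open import Algebra.Solver.Ring.AlmostCommutativeRing
  using (AlmostCommutativeRing; _-Raw-AlmostCommutative⟶_; fromCommutativeRing)
open import Algebra.Structures using (IsCommutativeMonoid; IsCommutativeRing)
open import Data.Empty using (⊥; ⊥-elim)
open import Data.Fin.Base using (Fin; zero; suc; fromℕ)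
open import Data.Fin.Properties using (toℕ-inject₁; toℕ-fromℕ; toℕ<n)
open import Data.Integer.Base as ℤ using (ℤ; -[1+_])
import Data.Integer.Properties as ℤ
open import Data.List.Base using (List; []; _∷_; map; filter; foldr; length; replicate)
open import Data.List.Membership.Propositional using (_∈_; find; lose)
open import Data.List.Membership.Propositional.Properties using (∈-map⁺; ∈-map⁻; ∈-filter⁺; ∈-filter⁻)
open import Data.List.Properties using (length-replicate)
open import Data.List.Relation.Unary.Any using (Any; here; there)
import Data.List.Relation.Unary.Any as Any
open import Data.List.Relation.Unary.Unique.Propositional using (Unique; _∷_)
open import Data.List.Relation.Unary.Unique.Propositional.Properties using (filter⁺; Unique[x∷xs]⇒x∉xs)
open import Data.Maybe.Base using (Maybe; just; nothing)
open import Data.Nat as ℕ using (ℕ; zero; suc; _≤_; _<_; z≤n; s≤s)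
import Data.Nat.Properties as ℕ
open import Data.Nat.Combinatorics using (_C_; nCn≡1; nC1≡n; k>n⇒nCk≡0; nCk+nC[k+1]≡[n+1]C[k+1])
open import Data.Nat.Divisibility using (_∣_; divides; ∣⇒≤)
open import Data.Nat.Primality using (Prime; euclidsLemma)
open import Data.Nat.Tactic.RingSolver using (solve-∀)
open import Data.Product.Base using (∃; ∃₂; _×_; _,_; proj₁; proj₂)
open import Data.Sign.Base as Sign using (Sign)
open import Data.Sum.Base using (inj₁; inj₂)
open import Function.Base using (_∘_)
open import Level using (0ℓ)
open import Relation.Binary.PropositionalEquality
open import Relation.Nullary.Decidable using (Dec; yes; no; ¬?; _×-dec_; _⊎-dec_)
open import Relation.Nullary.Negation using (¬_)
open import Relation.Unary using (Decidable)

module FiniteSums where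

  open import Data.List.Base using (_++_; concatMap)
  open import Data.List.Membership.Propositional.Properties using (∈-++⁻; ∈-concatMap⁺; ∈-concatMap⁻)
  open import Data.List.Membership.Propositional.Properties.WithK using (unique∧set⇒bag)
  open import Data.List.Properties using (length-map)
  open import Data.List.Relation.Binary.BagAndSetEquality using (∼bag⇒↭)
  open import Data.List.Relation.Binary.Permutation.Propositional using (_↭_; ↭⇒↭ₛ)
  open import Data.List.Relation.Binary.Permutation.Propositional.Properties using (↭-length)
  open import Data.List.Relation.Binary.Permutation.Setoid.Properties using (foldr-commMonoid)
  open import Data.List.Relation.Unary.All using (All; []; _∷_)
  open import Data.List.Relation.Unary.Unique.Propositional using ([])
  open import Data.List.Relation.Unary.Unique.Propositional.Properties using (++⁺; map⁺)
  open import Data.Nat.Base using (_+_; _*_)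
  open import Data.Nat.ListAction using (sum)
  open import Data.Nat.Properties
  open import Algebra.Properties.CommutativeSemigroup +-commutativeSemigroup using (interchange)
  open import Function.Bundles using (mk⇔)
  open import Relation.Binary.Definitions using (DecidableEquality)

  variable
    A B : Set

  ∑ : List A → (A → ℕ) → ℕ
  ∑ xs f = sum (map f xs)

  syntax ∑ xs (λ x → e) = ∑[ x ∈ xs ] e

  𝟙 : {P : Set} → Dec P → ℕ
  𝟙 (yes _) = 1
  𝟙 (no _) = 0

  𝟙-yes : {P : Set} (d : Dec P) → P → 𝟙 d ≡ 1
  𝟙-yes (yes _) _ = refl
  𝟙-yes (no ¬p) p = ⊥-elim (¬p p)

  𝟙-no : {P : Set} (d : Dec P) → ¬ P → 𝟙 d ≡ 0
  𝟙-no (yes p) ¬p = ⊥-elim (¬p p)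
  𝟙-no (no _) _ = refl

  𝟙-cong : {P Q : Set} (p : Dec P) (q : Dec Q) → (P → Q) → (Q → P) → 𝟙 p ≡ 𝟙 q
  𝟙-cong (yes _) (yes _) _ _ = refl
  𝟙-cong (yes p) (no ¬q) f _ = ⊥-elim (¬q (f p))
  𝟙-cong (no ¬p) (yes q) _ g = ⊥-elim (¬p (g q))
  𝟙-cong (no _) (no _) _ _ = refl

  𝟙+𝟙¬≡1 : {P : Set} (d : Dec P) → 𝟙 d + 𝟙 (¬? d) ≡ 1
  𝟙+𝟙¬≡1 (yes _) = refl
  𝟙+𝟙¬≡1 (no _) = refl

  𝟙-× : {P Q : Set} (p : Dec P) (q : Dec Q) → 𝟙 (p ×-dec q) ≡ 𝟙 p * 𝟙 q
  𝟙-× (yes _) (yes _) = refl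
  𝟙-× (yes _) (no _) = refl
  𝟙-× (no _) (yes _) = refl
  𝟙-× (no _) (no _) = refl

  𝟙-⊎ : {P Q : Set} (p : Dec P) (q : Dec Q) → ¬ (P × Q) → 𝟙 (p ⊎-dec q) ≡ 𝟙 p + 𝟙 q
  𝟙-⊎ (yes p) (yes q) ¬both = ⊥-elim (¬both (p , q))
  𝟙-⊎ (yes _) (no _) _ = refl
  𝟙-⊎ (no _) (yes _) _ = refl
  𝟙-⊎ (no _) (no _) _ = refl

  ∑-cong : ∀ (xs : List A) {f g : A → ℕ} → (∀ x → x ∈ xs → f x ≡ g x) → ∑ xs f ≡ ∑ xs g
  ∑-cong [] _ = refl
  ∑-cong (x ∷ xs) f≡g = cong₂ _+_ (f≡g x (here refl)) (∑-cong xs (λ y y∈xs → f≡g y (there y∈xs)))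

  ∑-++ : ∀ (xs ys : List A) f → ∑ (xs ++ ys) f ≡ ∑ xs f + ∑ ys f
  ∑-++ [] ys f = refl
  ∑-++ (x ∷ xs) ys f = trans (cong (f x +_) (∑-++ xs ys f)) (sym (+-assoc (f x) _ _))

  ∑-map : ∀ (xs : List A) (g : A → B) f → ∑ (map g xs) f ≡ ∑[ x ∈ xs ] f (g x)
  ∑-map [] g f = refl
  ∑-map (x ∷ xs) g f = cong (f (g x) +_) (∑-map xs g f)

  ∑-concatMap : ∀ (xs : List A) (g : A → List B) f → ∑ (concatMap g xs) f ≡ ∑[ x ∈ xs ] ∑ (g x) f
  ∑-concatMap [] g f = refl
  ∑-concatMap (x ∷ xs) g f = trans (∑-++ (g x) _ f) (cong (∑ (g x) f +_) (∑-concatMap xs g f))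

  ∑-+ : ∀ (xs : List A) f g → ∑[ x ∈ xs ] (f x + g x) ≡ ∑ xs f + ∑ xs g
  ∑-+ [] f g = refl
  ∑-+ (x ∷ xs) f g = trans (cong (f x + g x +_) (∑-+ xs f g)) (interchange (f x) (g x) _ _)

  ∑-*ˡ : ∀ (xs : List A) c f → ∑[ x ∈ xs ] (c * f x) ≡ c * ∑ xs f
  ∑-*ˡ [] c f = sym (*-zeroʳ c)
  ∑-*ˡ (x ∷ xs) c f = trans (cong (c * f x +_) (∑-*ˡ xs c f)) (sym (*-distribˡ-+ c (f x) _))

  ∑-const : ∀ (xs : List A) c → ∑[ _ ∈ xs ] c ≡ length xs * c
  ∑-const [] c = refl
  ∑-const (x ∷ xs) c = cong (c +_) (∑-const xs c)

  ∑-zero : ∀ (xs : List A) f → (∀ x → x ∈ xs → f x ≡ 0) → ∑ xs f ≡ 0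
  ∑-zero xs f f≡0 = trans (∑-cong xs f≡0) (trans (∑-const xs 0) (*-zeroʳ (length xs)))

  ∑-swap : ∀ (xs : List A) (ys : List B) (f : A → B → ℕ) →
    ∑[ x ∈ xs ] ∑ ys (f x) ≡ ∑[ y ∈ ys ] ∑[ x ∈ xs ] f x y
  ∑-swap [] ys f = sym (∑-zero ys _ (λ _ _ → refl))
  ∑-swap (x ∷ xs) ys f = trans (cong (∑ ys (f x) +_) (∑-swap xs ys f)) (sym (∑-+ ys (f x) _))

  ∑-mono-≤ : ∀ (xs : List A) {f g} → (∀ x → x ∈ xs → f x ≤ g x) → ∑ xs f ≤ ∑ xs g
  ∑-mono-≤ [] _ = z≤n
  ∑-mono-≤ (x ∷ xs) f≤g = +-mono-≤ (f≤g x (here refl)) (∑-mono-≤ xs (λ y y∈xs → f≤g y (there y∈xs)))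

  ≤-∑-≡⇒≡ : ∀ (xs : List A) {f g} → (∀ x → x ∈ xs → f x ≤ g x) → ∑ xs f ≡ ∑ xs g →
    ∀ x → x ∈ xs → f x ≡ g x
  ≤-∑-≡⇒≡ (y ∷ xs) {f} {g} f≤g ∑≡ = go
    where
    f≤g′ : ∀ x → x ∈ xs → f x ≤ g x
    f≤g′ x x∈xs = f≤g x (there x∈xs)
    fy≡gy : f y ≡ g y
    fy≡gy = ≤-antisym (f≤g y (here refl)) (+-cancelʳ-≤ (∑ xs g) (g y) (f y)
      (≤-trans (≤-reflexive (sym ∑≡)) (+-monoʳ-≤ (f y) (∑-mono-≤ xs f≤g′))))
    go : ∀ x → x ∈ y ∷ xs → f x ≡ g x
    go x (here refl) = fy≡gy
    go x (there x∈xs) = ≤-∑-≡⇒≡ xs f≤g′ (+-cancelˡ-≡ (f y) _ _ (trans ∑≡ (cong (_+ ∑ xs g) (sym fy≡gy)))) x x∈xs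

  length-filter≡∑𝟙 : ∀ {P : A → Set} (P? : Decidable P) xs → length (filter P? xs) ≡ ∑[ x ∈ xs ] 𝟙 (P? x)
  length-filter≡∑𝟙 P? [] = refl
  length-filter≡∑𝟙 P? (x ∷ xs) with P? x
  ... | yes _ = cong suc (length-filter≡∑𝟙 P? xs)
  ... | no _ = length-filter≡∑𝟙 P? xs

  ∑-filter : ∀ {P : A → Set} (P? : Decidable P) xs f → ∑ (filter P? xs) f ≡ ∑[ x ∈ xs ] (𝟙 (P? x) * f x)
  ∑-filter P? [] f = refl
  ∑-filter P? (x ∷ xs) f with P? x
  ... | yes _ = cong₂ _+_ (sym (+-identityʳ (f x))) (∑-filter P? xs f)
  ... | no _ = ∑-filter P? xs f

  length-filter-cong : ∀ {P Q : A → Set} (P? : Decidable P) (Q? : Decidable Q) xs →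
    (∀ x → x ∈ xs → P x → Q x) → (∀ x → x ∈ xs → Q x → P x) → length (filter P? xs) ≡ length (filter Q? xs)
  length-filter-cong P? Q? xs P⇒Q Q⇒P = trans (length-filter≡∑𝟙 P? xs)
    (trans (∑-cong xs (λ x x∈ → 𝟙-cong (P? x) (Q? x) (P⇒Q x x∈) (Q⇒P x x∈))) (sym (length-filter≡∑𝟙 Q? xs)))

  length-filter-filter : ∀ {P Q : A → Set} (P? : Decidable P) (Q? : Decidable Q) xs → (∀ x → P x → Q x) →
    length (filter P? (filter Q? xs)) ≡ length (filter P? xs)
  length-filter-filter P? Q? [] _ = refl
  length-filter-filter P? Q? (x ∷ xs) P⇒Q with Q? x
  ... | yes _ with P? x
  ...   | yes _ = cong suc (length-filter-filter P? Q? xs P⇒Q)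
  ...   | no _ = length-filter-filter P? Q? xs P⇒Q
  length-filter-filter P? Q? (x ∷ xs) P⇒Q | no ¬q with P? x
  ...   | yes p = ⊥-elim (¬q (P⇒Q x p))
  ...   | no _ = length-filter-filter P? Q? xs P⇒Q

  length-filter+length-filter¬ : ∀ {P : A → Set} (P? : Decidable P) xs →
    length (filter P? xs) + length (filter (λ x → ¬? (P? x)) xs) ≡ length xs
  length-filter+length-filter¬ P? xs = begin
    length (filter P? xs) + length (filter (λ x → ¬? (P? x)) xs)
      ≡⟨ cong₂ _+_ (length-filter≡∑𝟙 P? xs) (length-filter≡∑𝟙 (λ x → ¬? (P? x)) xs) ⟩
    ∑[ x ∈ xs ] 𝟙 (P? x) + ∑[ x ∈ xs ] 𝟙 (¬? (P? x))
      ≡⟨ sym (∑-+ xs _ _) ⟩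
    ∑[ x ∈ xs ] (𝟙 (P? x) + 𝟙 (¬? (P? x)))
      ≡⟨ ∑-cong xs (λ x _ → 𝟙+𝟙¬≡1 (P? x)) ⟩
    ∑[ _ ∈ xs ] 1
      ≡⟨ trans (∑-const xs 1) (*-identityʳ _) ⟩
    length xs ∎
    where open ≡-Reasoning

  module _ (_≟_ : DecidableEquality A) where

    𝟙≟-sym : ∀ a b → 𝟙 (a ≟ b) ≡ 𝟙 (b ≟ a)
    𝟙≟-sym a b = 𝟙-cong (a ≟ b) (b ≟ a) sym sym

    ∑-𝟙≟ : ∀ {a} (ys : List A) (w : A → ℕ) → Unique ys → a ∈ ys → ∑[ c ∈ ys ] (𝟙 (a ≟ c) * w c) ≡ w a
    ∑-𝟙≟ {a} (y ∷ ys) w (y∉ys ∷ uys) a∈ with a ≟ y | a∈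
    ... | yes refl | _ = trans (cong (w a + 0 +_) (∑-zero ys _ absent)) (trans (+-identityʳ _) (+-identityʳ _))
      where
      absent : ∀ c → c ∈ ys → 𝟙 (a ≟ c) * w c ≡ 0
      absent c c∈ys = cong (_* w c) (𝟙-no (a ≟ c) (λ { refl → Unique[x∷xs]⇒x∉xs (y∉ys ∷ uys) c∈ys }))
    ... | no a≢y | here a≡y = ⊥-elim (a≢y a≡y)
    ... | no _ | there a∈ys = ∑-𝟙≟ ys w uys a∈ys

    ∑-twoPoints : ∀ (xs : List A) (f : A → ℕ) {a b} → Unique xs → a ∈ xs → b ∈ xs → a ≢ b →
      (∀ c → c ≢ a → c ≢ b → f c ≡ 0) → ∑ xs f ≡ f a + f b
    ∑-twoPoints xs f {a} {b} uxs a∈xs b∈xs a≢b f≡0 = begin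
      ∑ xs f                                                     ≡⟨ ∑-cong xs (λ c _ → split c) ⟩
      ∑[ c ∈ xs ] (𝟙 (a ≟ c) * f c + 𝟙 (b ≟ c) * f c)          ≡⟨ ∑-+ xs _ _ ⟩
      ∑[ c ∈ xs ] (𝟙 (a ≟ c) * f c) + ∑[ c ∈ xs ] (𝟙 (b ≟ c) * f c)
        ≡⟨ cong₂ _+_ (∑-𝟙≟ xs f uxs a∈xs) (∑-𝟙≟ xs f uxs b∈xs) ⟩
      f a + f b                                                  ∎
      where
      open ≡-Reasoning
      split : ∀ c → f c ≡ 𝟙 (a ≟ c) * f c + 𝟙 (b ≟ c) * f c
      split c with a ≟ c | b ≟ c
      ... | yes refl | yes refl = ⊥-elim (a≢b refl)
      ... | yes refl | no _ = sym (trans (+-identityʳ _) (+-identityʳ _))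
      ... | no _ | yes refl = sym (+-identityʳ _)
      ... | no a≢c | no b≢c = f≡0 c (λ c≡a → a≢c (sym c≡a)) (λ c≡b → b≢c (sym c≡b))

    length-filter-≟ : ∀ {a} (xs : List A) → Unique xs → a ∈ xs → length (filter (_≟ a) xs) ≡ 1
    length-filter-≟ {a} xs uxs a∈xs = begin
      length (filter (_≟ a) xs)         ≡⟨ length-filter≡∑𝟙 (_≟ a) xs ⟩
      ∑[ x ∈ xs ] 𝟙 (x ≟ a)            ≡⟨ ∑-cong xs (λ x _ → trans (𝟙≟-sym x a) (sym (*-identityʳ _))) ⟩
      ∑[ x ∈ xs ] (𝟙 (a ≟ x) * 1)      ≡⟨ ∑-𝟙≟ xs (λ _ → 1) uxs a∈xs ⟩
      1                                 ∎
      where open ≡-Reasoning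

    length-remove : ∀ {a} (xs : List A) → Unique xs → a ∈ xs → suc (length (filter (λ x → ¬? (x ≟ a)) xs)) ≡ length xs
    length-remove {a} xs uxs a∈xs =
      trans (cong (_+ length (filter (λ x → ¬? (x ≟ a)) xs)) (sym (length-filter-≟ xs uxs a∈xs)))
        (length-filter+length-filter¬ (_≟ a) xs)

    ∑-fibres : ∀ (xs : List B) (ys : List A) (f : B → A) (w : B → ℕ) → Unique ys → (∀ x → x ∈ xs → f x ∈ ys) →
      ∑ xs w ≡ ∑[ c ∈ ys ] ∑[ x ∈ xs ] (𝟙 (f x ≟ c) * w x)
    ∑-fibres xs ys f w uys f∈ys = sym (trans (∑-swap ys xs (λ c x → 𝟙 (f x ≟ c) * w x))
      (∑-cong xs (λ x x∈xs → ∑-𝟙≟ ys (λ _ → w x) uys (f∈ys x x∈xs))))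

    length≡∑fibres : ∀ (xs : List B) (ys : List A) (f : B → A) → Unique ys → (∀ x → x ∈ xs → f x ∈ ys) →
      length xs ≡ ∑[ c ∈ ys ] length (filter (λ x → f x ≟ c) xs)
    length≡∑fibres xs ys f uys f∈ys = begin
      length xs                                        ≡⟨ sym (trans (∑-const xs 1) (*-identityʳ _)) ⟩
      ∑[ _ ∈ xs ] 1                                    ≡⟨ ∑-fibres xs ys f (λ _ → 1) uys f∈ys ⟩
      ∑[ c ∈ ys ] ∑[ x ∈ xs ] (𝟙 (f x ≟ c) * 1)        ≡⟨ ∑-cong ys (λ c _ → trans (∑-cong xs (λ x _ → *-identityʳ _))
                                                            (sym (length-filter≡∑𝟙 (λ x → f x ≟ c) xs))) ⟩
      ∑[ c ∈ ys ] length (filter (λ x → f x ≟ c) xs)   ∎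
      where open ≡-Reasoning

    module _ (xs : List B) (ys : List A) (f : B → A) (uys : Unique ys) (f∈ys : ∀ x → x ∈ xs → f x ∈ ys)
      {b : ℕ} (fibre≤b : ∀ c → c ∈ ys → length (filter (λ x → f x ≟ c) xs) ≤ b) where

      length≤|codomain|*fibre : length xs ≤ length ys * b
      length≤|codomain|*fibre = begin
        length xs                                        ≡⟨ length≡∑fibres xs ys f uys f∈ys ⟩
        ∑[ c ∈ ys ] length (filter (λ x → f x ≟ c) xs)   ≤⟨ ∑-mono-≤ ys fibre≤b ⟩
        ∑[ _ ∈ ys ] b                                    ≡⟨ ∑-const ys b ⟩
        length ys * b                                    ∎
        where open ≤-Reasoning

      fibres-full : length xs ≡ length ys * b → ∀ c → c ∈ ys → length (filter (λ x → f x ≟ c) xs) ≡ b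
      fibres-full |xs|≡|ys|*b = ≤-∑-≡⇒≡ ys fibre≤b
        (trans (sym (length≡∑fibres xs ys f uys f∈ys)) (trans |xs|≡|ys|*b (sym (∑-const ys b))))

  map⁺-injectiveOn : ∀ (g : A → B) (xs : List A) → Unique xs →
    (∀ x y → x ∈ xs → y ∈ xs → g x ≡ g y → x ≡ y) → Unique (map g xs)
  map⁺-injectiveOn g [] [] _ = []
  map⁺-injectiveOn g (x ∷ xs) (x∉xs ∷ uxs) inj =
    distinct xs x∉xs (λ y y∈xs → inj x y (here refl) (there y∈xs))
    ∷ map⁺-injectiveOn g xs uxs (λ y z y∈xs z∈xs → inj y z (there y∈xs) (there z∈xs))
    where
    distinct : ∀ zs → All (x ≢_) zs → (∀ z → z ∈ zs → g x ≡ g z → x ≡ z) → All (g x ≢_) (map g zs)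
    distinct [] [] _ = []
    distinct (z ∷ zs) (x≢z ∷ x∉zs) inj′ =
      (λ gx≡gz → x≢z (inj′ z (here refl) gx≡gz)) ∷ distinct zs x∉zs (λ z′ z′∈zs → inj′ z′ (there z′∈zs))

  unique-sameMembers⇒↭ : ∀ {xs ys : List A} → Unique xs → Unique ys →
    (∀ z → z ∈ xs → z ∈ ys) → (∀ z → z ∈ ys → z ∈ xs) → xs ↭ ys
  unique-sameMembers⇒↭ uxs uys xs⊆ys ys⊆xs = ∼bag⇒↭ (unique∧set⇒bag uxs uys (mk⇔ (xs⊆ys _) (ys⊆xs _)))

  length-bijection : ∀ (g : A → B) (xs : List A) (ys : List B) → Unique xs → Unique ys →
    (∀ x → x ∈ xs → g x ∈ ys) → (∀ x y → x ∈ xs → y ∈ xs → g x ≡ g y → x ≡ y) →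
    (∀ y → y ∈ ys → ∃ λ x → x ∈ xs × g x ≡ y) → length xs ≡ length ys
  length-bijection g xs ys uxs uys into inj onto = trans (sym (length-map g xs))
    (↭-length (unique-sameMembers⇒↭ (map⁺-injectiveOn g xs uxs inj) uys image⊆ys ys⊆image))
    where
    image⊆ys : ∀ y → y ∈ map g xs → y ∈ ys
    image⊆ys y y∈ with ∈-map⁻ g y∈
    ... | x , x∈xs , refl = into x x∈xs
    ys⊆image : ∀ y → y ∈ ys → y ∈ map g xs
    ys⊆image y y∈ys with onto y y∈ys
    ... | x , x∈xs , refl = ∈-map⁺ g x∈xs

  foldr-sameMembers : ∀ {_∙_ : A → A → A} {ε : A} → IsCommutativeMonoid _≡_ _∙_ ε →
    ∀ {xs ys} → Unique xs → Unique ys → (∀ z → z ∈ xs → z ∈ ys) → (∀ z → z ∈ ys → z ∈ xs) →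
    foldr _∙_ ε xs ≡ foldr _∙_ ε ys
  foldr-sameMembers {A} isCM uxs uys xs⊆ys ys⊆xs =
    foldr-commMonoid (setoid A) isCM (↭⇒↭ₛ (unique-sameMembers⇒↭ uxs uys xs⊆ys ys⊆xs))

  concatMap⁺-keyed : ∀ (g : A → List B) (key : B → A) (xs : List A) → Unique xs → (∀ x → Unique (g x)) →
    (∀ x y → y ∈ g x → key y ≡ x) → Unique (concatMap g xs)
  concatMap⁺-keyed g key [] [] _ _ = []
  concatMap⁺-keyed g key (x ∷ xs) (x∉xs ∷ uxs) ug keyed =
    ++⁺ (ug x) (concatMap⁺-keyed g key xs uxs ug keyed) disjoint
    where
    disjoint : ∀ {y} → y ∈ g x × y ∈ concatMap g xs → ⊥
    disjoint {y} (y∈gx , y∈rest) with find (∈-concatMap⁻ g {xs = xs} y∈rest)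
    ... | x′ , x′∈xs , y∈gx′ = Unique[x∷xs]⇒x∉xs (x∉xs ∷ uxs)
      (subst (_∈ xs) (trans (sym (keyed x′ y y∈gx′)) (keyed x y y∈gx)) x′∈xs)

  cube : List A → List (A × A × A)
  cube xs = concatMap (λ a → concatMap (λ b → map (λ c → (a , b , c)) xs) xs) xs

  ∈-cube⁺ : ∀ {xs : List A} {a b c} → a ∈ xs → b ∈ xs → c ∈ xs → (a , b , c) ∈ cube xs
  ∈-cube⁺ a∈ b∈ c∈ =
    ∈-concatMap⁺ _ (Any.map (λ { refl → ∈-concatMap⁺ _ (Any.map (λ { refl → ∈-map⁺ _ c∈ }) b∈) }) a∈)

  ∈-cube⁻ : ∀ {xs : List A} {a b c} → (a , b , c) ∈ cube xs → a ∈ xs × b ∈ xs × c ∈ xs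
  ∈-cube⁻ {xs = xs} t∈ with find (∈-concatMap⁻ _ {xs = xs} t∈)
  ... | a , a∈ , t∈′ with find (∈-concatMap⁻ _ {xs = xs} t∈′)
  ... | b , b∈ , t∈″ with ∈-map⁻ _ t∈″
  ... | c , c∈ , refl = a∈ , b∈ , c∈

  cube-unique : ∀ {A : Set} {xs : List A} → Unique xs → Unique (cube xs)
  cube-unique {A} {xs} uxs = concatMap⁺-keyed _ proj₁ xs uxs
    (λ a → concatMap⁺-keyed _ (proj₁ ∘ proj₂) xs uxs (λ b → map⁺ (λ { refl → refl }) uxs) second)
    first
    where
    second : ∀ {a} b (t : A × A × A) → t ∈ map (λ c → (a , b , c)) xs → proj₁ (proj₂ t) ≡ b
    second b t t∈ with ∈-map⁻ _ t∈
    ... | _ , _ , refl = refl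
    first : ∀ a (t : A × A × A) → t ∈ concatMap (λ b → map (λ c → (a , b , c)) xs) xs → proj₁ t ≡ a
    first a t t∈ with find (∈-concatMap⁻ _ {xs = xs} t∈)
    ... | b , _ , t∈′ with ∈-map⁻ _ t∈′
    ... | _ , _ , refl = refl

  ∑-cube : ∀ (xs : List A) f → ∑ (cube xs) f ≡ ∑[ a ∈ xs ] ∑[ b ∈ xs ] ∑[ c ∈ xs ] f (a , b , c)
  ∑-cube xs f = trans (∑-concatMap xs _ f) (∑-cong xs (λ a _ →
    trans (∑-concatMap xs _ f) (∑-cong xs (λ b _ → ∑-map xs _ f))))

  ∑²≡2*∑pairs : ∀ (xs : List A) (g : A × A → ℕ) → (∀ a b → g (a , b) ≡ g (b , a)) → (∀ a → g (a , a) ≡ 0) →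
    ∑[ a ∈ xs ] ∑[ b ∈ xs ] g (a , b) ≡ 2 * ∑ (pairs xs) g
  ∑²≡2*∑pairs [] g _ _ = refl
  ∑²≡2*∑pairs (y ∷ ys) g g-sym g-diag = begin
    (g (y , y) + row) + ∑[ a ∈ ys ] (g (a , y) + ∑[ b ∈ ys ] g (a , b))
      ≡⟨ cong₂ (λ u v → (u + row) + v) (g-diag y) (∑-+ ys _ _) ⟩
    row + (∑[ a ∈ ys ] g (a , y) + ∑[ a ∈ ys ] ∑[ b ∈ ys ] g (a , b))
      ≡⟨ cong₂ (λ u v → row + (u + v)) (∑-cong ys (λ a _ → g-sym a y)) (∑²≡2*∑pairs ys g g-sym g-diag) ⟩
    row + (row + 2 * ∑ (pairs ys) g)
      ≡⟨ double-+ row (∑ (pairs ys) g) ⟩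
    2 * (row + ∑ (pairs ys) g)
      ≡⟨ cong (2 *_) (trans (cong (_+ ∑ (pairs ys) g) (sym (∑-map ys (y ,_) g))) (sym (∑-++ (map (y ,_) ys) (pairs ys) g))) ⟩
    2 * ∑ (pairs (y ∷ ys)) g ∎
    where
    open ≡-Reasoning
    row = ∑[ b ∈ ys ] g (y , b)
    double-+ : ∀ a b → a + (a + 2 * b) ≡ 2 * (a + b)
    double-+ = solve-∀

  module _ (f : A × A × A → ℕ)
    (f-swap₁₂ : ∀ a b c → f (a , b , c) ≡ f (b , a , c))
    (f-swap₂₃ : ∀ a b c → f (a , b , c) ≡ f (a , c , b))
    (f-diag : ∀ a c → f (a , a , c) ≡ 0)
    where

    private
      f-diag₂₃ : ∀ a c → f (a , c , c) ≡ 0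
      f-diag₂₃ a c = trans (f-swap₁₂ a c c) (trans (f-swap₂₃ c a c) (f-diag c a))

      module _ (x : A) (xs : List A) where

        S² S³ : ℕ
        S² = ∑[ b ∈ xs ] ∑[ c ∈ xs ] f (x , b , c)
        S³ = ∑[ a ∈ xs ] ∑[ b ∈ xs ] ∑[ c ∈ xs ] f (a , b , c)

        slice₀ : (f (x , x , x) + ∑[ c ∈ xs ] f (x , x , c)) + ∑[ b ∈ xs ] (f (x , b , x) + ∑[ c ∈ xs ] f (x , b , c)) ≡ S²
        slice₀ = begin
          (f (x , x , x) + ∑[ c ∈ xs ] f (x , x , c)) + ∑[ b ∈ xs ] (f (x , b , x) + ∑[ c ∈ xs ] f (x , b , c))
            ≡⟨ cong₂ (λ u v → (u + v) + ∑[ b ∈ xs ] (f (x , b , x) + ∑[ c ∈ xs ] f (x , b , c)))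
                 (f-diag x x) (∑-zero xs _ (λ c _ → f-diag x c)) ⟩
          ∑[ b ∈ xs ] (f (x , b , x) + ∑[ c ∈ xs ] f (x , b , c))
            ≡⟨ ∑-+ xs _ _ ⟩
          ∑[ b ∈ xs ] f (x , b , x) + S²
            ≡⟨ cong (_+ S²) (∑-zero xs _ (λ b _ → trans (f-swap₂₃ x b x) (f-diag x b))) ⟩
          S² ∎
          where open ≡-Reasoning

        slices : ∑[ a ∈ xs ] ((f (a , x , x) + ∑[ c ∈ xs ] f (a , x , c)) + ∑[ b ∈ xs ] (f (a , b , x) + ∑[ c ∈ xs ] f (a , b , c)))
               ≡ S² + (S² + S³)
        slices = begin
          ∑[ a ∈ xs ] ((f (a , x , x) + ∑[ c ∈ xs ] f (a , x , c)) + ∑[ b ∈ xs ] (f (a , b , x) + ∑[ c ∈ xs ] f (a , b , c)))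
            ≡⟨ ∑-cong xs (λ a _ → cong₂ (λ u v → (u + ∑[ c ∈ xs ] f (a , x , c)) + v) (f-diag₂₃ a x) (∑-+ xs _ _)) ⟩
          ∑[ a ∈ xs ] (∑[ c ∈ xs ] f (a , x , c) + (∑[ b ∈ xs ] f (a , b , x) + ∑[ b ∈ xs ] ∑[ c ∈ xs ] f (a , b , c)))
            ≡⟨ trans (∑-+ xs _ _) (cong (∑[ a ∈ xs ] ∑[ c ∈ xs ] f (a , x , c) +_) (∑-+ xs _ _)) ⟩
          ∑[ a ∈ xs ] ∑[ c ∈ xs ] f (a , x , c) + (∑[ a ∈ xs ] ∑[ b ∈ xs ] f (a , b , x) + S³)
            ≡⟨ cong₂ (λ u v → u + (v + S³))
                 (∑-cong xs (λ a _ → ∑-cong xs (λ c _ → f-swap₁₂ a x c)))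
                 (∑-cong xs (λ a _ → ∑-cong xs (λ b _ → trans (f-swap₂₃ a b x) (f-swap₁₂ a x b)))) ⟩
          S² + (S² + S³) ∎
          where open ≡-Reasoning

        ∑³-cons : ∑[ a ∈ x ∷ xs ] ∑[ b ∈ x ∷ xs ] ∑[ c ∈ x ∷ xs ] f (a , b , c) ≡ 3 * S² + S³
        ∑³-cons = trans (cong₂ _+_ slice₀ slices) (triple S² S³)
          where
          triple : ∀ u v → u + (u + (u + v)) ≡ 3 * u + v
          triple = solve-∀

    ∑³≡6*∑combos3 : ∀ (xs : List A) →
      ∑[ a ∈ xs ] ∑[ b ∈ xs ] ∑[ c ∈ xs ] f (a , b , c) ≡ 6 * ∑ (combos3 xs) f
    ∑³≡6*∑combos3 [] = refl
    ∑³≡6*∑combos3 (x ∷ xs) = begin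
      ∑[ a ∈ x ∷ xs ] ∑[ b ∈ x ∷ xs ] ∑[ c ∈ x ∷ xs ] f (a , b , c)
        ≡⟨ ∑³-cons x xs ⟩
      3 * ∑[ b ∈ xs ] ∑[ c ∈ xs ] f (x , b , c) + ∑[ a ∈ xs ] ∑[ b ∈ xs ] ∑[ c ∈ xs ] f (a , b , c)
        ≡⟨ cong₂ (λ u v → 3 * u + v)
             (∑²≡2*∑pairs xs (λ (b , c) → f (x , b , c)) (λ b c → f-swap₂₃ x b c) (f-diag₂₃ x))
             (∑³≡6*∑combos3 xs) ⟩
      3 * (2 * ∑ (pairs xs) (λ (b , c) → f (x , b , c))) + 6 * ∑ (combos3 xs) f
        ≡⟨ six-+ (∑ (pairs xs) (λ (b , c) → f (x , b , c))) (∑ (combos3 xs) f) ⟩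
      6 * (∑ (pairs xs) (λ (b , c) → f (x , b , c)) + ∑ (combos3 xs) f)
        ≡⟨ cong (6 *_) (trans (cong (_+ ∑ (combos3 xs) f) (sym (∑-map (pairs xs) _ f)))
             (sym (∑-++ (map (λ (y , z) → (x , y , z)) (pairs xs)) (combos3 xs) f))) ⟩
      6 * ∑ (combos3 (x ∷ xs)) f ∎
      where
      open ≡-Reasoning
      six-+ : ∀ u v → 3 * (2 * u) + 6 * v ≡ 6 * (u + v)
      six-+ = solve-∀

  ∈-pairs⁻ : ∀ (xs : List A) {a b} → (a , b) ∈ pairs xs → a ∈ xs × b ∈ xs
  ∈-pairs⁻ (x ∷ xs) p∈ with ∈-++⁻ (map (x ,_) xs) p∈
  ... | inj₁ p∈head with ∈-map⁻ _ p∈head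
  ...   | _ , b∈ , refl = here refl , there b∈
  ∈-pairs⁻ (x ∷ xs) p∈ | inj₂ p∈rest with ∈-pairs⁻ xs p∈rest
  ...   | a∈ , b∈ = there a∈ , there b∈

  ∈-combos3⁻ : ∀ (xs : List A) {a b c} → (a , b , c) ∈ combos3 xs → a ∈ xs × b ∈ xs × c ∈ xs
  ∈-combos3⁻ (x ∷ xs) t∈ with ∈-++⁻ (map (λ (y , z) → (x , y , z)) (pairs xs)) t∈
  ... | inj₁ t∈head with ∈-map⁻ _ t∈head
  ...   | _ , p∈ , refl with ∈-pairs⁻ xs p∈
  ...     | b∈ , c∈ = here refl , there b∈ , there c∈
  ∈-combos3⁻ (x ∷ xs) t∈ | inj₂ t∈rest with ∈-combos3⁻ xs t∈rest
  ...   | a∈ , b∈ , c∈ = there a∈ , there b∈ , there c∈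

open FiniteSums

-- The solver of Algebra.Solver.Ring with coefficients in ℤ, so that integer constants (e.g. 1 - 1) normalise.
module RingSolver
  {A : Set} {add mul : Op₂ A} {neg : Op₁ A} {0A 1A : A}
  (isCommutativeRing : IsCommutativeRing _≡_ add mul neg 0A 1A)
  where

  private
    commutativeRing : CommutativeRing _ _
    commutativeRing = record { isCommutativeRing = isCommutativeRing }

    R : AlmostCommutativeRing _ _
    R = fromCommutativeRing commutativeRing
    open AlmostCommutativeRing R using (_+_; _*_; -_; 0#; 1#; semiring; +-monoid)
    open IsCommutativeRing isCommutativeRing using (+-identityˡ; +-identityʳ; +-assoc; +-comm; -‿inverseʳ)
    open import Algebra.Properties.Semiring.Mult.TCOptimised semiring using (×1-homo-*) renaming (_×_ to infixl 8 _•_)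
    open import Algebra.Properties.Monoid.Mult.TCOptimised +-monoid using (×-homo-+; 1+×)
    open import Algebra.Properties.Ring (CommutativeRing.ring commutativeRing)
      using (-‿involutive; -0#≈0#; -‿distribˡ-*; -‿distribʳ-*; -‿+-comm)

    ⟦_⟧ : ℤ → A
    ⟦ ℤ.+ n ⟧ = n • 1#
    ⟦ -[1+ n ] ⟧ = - (suc n • 1#)

    signed : Sign → A → A
    signed Sign.+ x = x
    signed Sign.- x = - x

    ⟦◃⟧ : ∀ s n → ⟦ s ℤ.◃ n ⟧ ≡ signed s (n • 1#)
    ⟦◃⟧ Sign.+ zero = refl
    ⟦◃⟧ Sign.+ (suc n) = refl
    ⟦◃⟧ Sign.- zero = sym -0#≈0#
    ⟦◃⟧ Sign.- (suc n) = refl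

    ⟦⟧-signAbs : ∀ i → ⟦ i ⟧ ≡ signed (ℤ.sign i) (ℤ.∣ i ∣ • 1#)
    ⟦⟧-signAbs (ℤ.+ n) = refl
    ⟦⟧-signAbs -[1+ n ] = refl

    signed-* : ∀ s t x y → signed (s Sign.* t) (x * y) ≡ signed s x * signed t y
    signed-* Sign.+ Sign.+ x y = refl
    signed-* Sign.+ Sign.- x y = -‿distribʳ-* x y
    signed-* Sign.- Sign.+ x y = -‿distribˡ-* x y
    signed-* Sign.- Sign.- x y = trans (sym (-‿involutive (x * y)))
      (trans (cong -_ (-‿distribʳ-* x y)) (-‿distribˡ-* x (- y)))

    *-homo : ∀ i j → ⟦ i ℤ.* j ⟧ ≡ ⟦ i ⟧ * ⟦ j ⟧
    *-homo i j = trans (⟦◃⟧ (ℤ.sign i Sign.* ℤ.sign j) (ℤ.∣ i ∣ ℕ.* ℤ.∣ j ∣))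
      (trans (cong (signed (ℤ.sign i Sign.* ℤ.sign j)) (×1-homo-* ℤ.∣ i ∣ ℤ.∣ j ∣))
      (trans (signed-* (ℤ.sign i) (ℤ.sign j) _ _) (sym (cong₂ _*_ (⟦⟧-signAbs i) (⟦⟧-signAbs j)))))

    ⟦⊖⟧ : ∀ m n → ⟦ m ℤ.⊖ n ⟧ ≡ m • 1# + - (n • 1#)
    ⟦⊖⟧ zero zero = sym (-‿inverseʳ 0#)
    ⟦⊖⟧ (suc m) zero = trans (sym (+-identityʳ _)) (cong (suc m • 1# +_) (sym -0#≈0#))
    ⟦⊖⟧ zero (suc n) = sym (+-identityˡ _)
    ⟦⊖⟧ (suc m) (suc n) = begin
      ⟦ suc m ℤ.⊖ suc n ⟧                         ≡⟨ cong ⟦_⟧ (ℤ.[1+m]⊖[1+n]≡m⊖n m n) ⟩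
      ⟦ m ℤ.⊖ n ⟧                                 ≡⟨ ⟦⊖⟧ m n ⟩
      m • 1# + - (n • 1#)                          ≡⟨ shift (m • 1#) (n • 1#) ⟩
      (1# + m • 1#) + - (1# + n • 1#)              ≡⟨ sym (cong₂ (λ a b → a + - b) (1+× m 1#) (1+× n 1#)) ⟩
      suc m • 1# + - (suc n • 1#)                  ∎
      where
      open ≡-Reasoning
      shift : ∀ a b → a + - b ≡ (1# + a) + - (1# + b)
      shift a b = begin
        a + - b                       ≡⟨ cong (_+ - b) (sym (trans (cong (_+ a) (-‿inverseʳ 1#)) (+-identityˡ a))) ⟩
        ((1# + - 1#) + a) + - b       ≡⟨ cong (_+ - b) (trans (+-assoc 1# (- 1#) a) (cong (1# +_) (+-comm (- 1#) a))) ⟩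
        (1# + (a + - 1#)) + - b       ≡⟨ cong (_+ - b) (sym (+-assoc 1# a (- 1#))) ⟩
        ((1# + a) + - 1#) + - b       ≡⟨ +-assoc (1# + a) (- 1#) (- b) ⟩
        (1# + a) + (- 1# + - b)       ≡⟨ cong ((1# + a) +_) (-‿+-comm 1# b) ⟩
        (1# + a) + - (1# + b)         ∎

    +-homo : ∀ i j → ⟦ i ℤ.+ j ⟧ ≡ ⟦ i ⟧ + ⟦ j ⟧
    +-homo (ℤ.+ m) (ℤ.+ n) = ×-homo-+ 1# m n
    +-homo (ℤ.+ m) -[1+ n ] = ⟦⊖⟧ m (suc n)
    +-homo -[1+ m ] (ℤ.+ n) = trans (⟦⊖⟧ n (suc m)) (+-comm _ _)
    +-homo -[1+ m ] -[1+ n ] =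
      trans (cong (λ k → - (k • 1#)) (sym (ℕ.+-suc (suc m) n)))
        (trans (cong -_ (×-homo-+ 1# (suc m) (suc n))) (sym (-‿+-comm _ _)))

    -‿homo : ∀ i → ⟦ ℤ.- i ⟧ ≡ - ⟦ i ⟧
    -‿homo (ℤ.+ zero) = sym -0#≈0#
    -‿homo (ℤ.+ suc n) = refl
    -‿homo -[1+ n ] = sym (-‿involutive _)

    ℤ→A : ℤ.+-*-rawRing -Raw-AlmostCommutative⟶ R
    ℤ→A = record
      { ⟦_⟧ = ⟦_⟧ ; +-homo = +-homo ; *-homo = *-homo ; -‿homo = -‿homo
      ; 0-homo = refl ; 1-homo = refl }

    _≟ℤ_ : ∀ i j → Maybe (⟦ i ⟧ ≡ ⟦ j ⟧)
    i ≟ℤ j with i ℤ.≟ j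
    ... | yes i≡j = just (cong ⟦_⟧ i≡j)
    ... | no _ = nothing

  open import Algebra.Solver.Ring ℤ.+-*-rawRing R ℤ→A _≟ℤ_ public

  :0 :1 : ∀ {n} → Polynomial n
  :0 = con (ℤ.+ 0)
  :1 = con (ℤ.+ 1)

[1+k]*[1+n]C[1+k]≡[1+n]*nCk : ∀ n k → suc k ℕ.* (suc n C suc k) ≡ suc n ℕ.* (n C k)
[1+k]*[1+n]C[1+k]≡[1+n]*nCk zero zero = refl
[1+k]*[1+n]C[1+k]≡[1+n]*nCk zero (suc k) =
  trans (cong (suc (suc k) ℕ.*_) (k>n⇒nCk≡0 {1} {suc (suc k)} (s≤s (s≤s z≤n)))) (ℕ.*-zeroʳ (suc (suc k)))
[1+k]*[1+n]C[1+k]≡[1+n]*nCk (suc n) zero = trans (ℕ.*-identityˡ _) (trans (nC1≡n (suc (suc n))) (sym (ℕ.*-identityʳ _)))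
[1+k]*[1+n]C[1+k]≡[1+n]*nCk (suc n) (suc k) = begin
  suc (suc k) ℕ.* (suc (suc n) C suc (suc k))
    ≡⟨ cong (suc (suc k) ℕ.*_) (sym (nCk+nC[k+1]≡[n+1]C[k+1] (suc n) (suc k))) ⟩
  suc (suc k) ℕ.* (a ℕ.+ b)
    ≡⟨ trans (ℕ.*-distribˡ-+ (suc (suc k)) a b) (ℕ.+-assoc a (suc k ℕ.* a) _) ⟩
  a ℕ.+ (suc k ℕ.* a ℕ.+ suc (suc k) ℕ.* b)
    ≡⟨ cong₂ (λ u v → a ℕ.+ (u ℕ.+ v)) ([1+k]*[1+n]C[1+k]≡[1+n]*nCk n k) ([1+k]*[1+n]C[1+k]≡[1+n]*nCk n (suc k)) ⟩
  a ℕ.+ (suc n ℕ.* (n C k) ℕ.+ suc n ℕ.* (n C suc k))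
    ≡⟨ cong (a ℕ.+_) (sym (ℕ.*-distribˡ-+ (suc n) (n C k) (n C suc k))) ⟩
  a ℕ.+ suc n ℕ.* (n C k ℕ.+ n C suc k)
    ≡⟨ cong (λ c → a ℕ.+ suc n ℕ.* c) (nCk+nC[k+1]≡[n+1]C[k+1] n k) ⟩
  suc (suc n) ℕ.* (suc n C suc k) ∎
  where
  open ≡-Reasoning
  a = suc n C suc k
  b = suc n C suc (suc k)

p∣pCk : ∀ {p k} → Prime p → 0 < k → k < p → p ∣ p C k
p∣pCk {suc n} {suc k} p-prime _ k<p
  with euclidsLemma (suc k) (suc n C suc k) p-prime
         (divides (n C k) (trans ([1+k]*[1+n]C[1+k]≡[1+n]*nCk n k) (ℕ.*-comm (suc n) (n C k))))
... | inj₂ p∣pCk = p∣pCk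
... | inj₁ p∣1+k = ⊥-elim (ℕ.<⇒≱ k<p (∣⇒≤ p∣1+k))

module FieldProperties (F : FiniteField) where

  open FiniteField F public
    using (Carrier; 0≢1; elements; elements-complete; elements-unique; isCommutativeRing)
    renaming (_≟_ to infix 4 _≟_)

  commutativeRing : CommutativeRing 0ℓ 0ℓ
  commutativeRing = record { isCommutativeRing = isCommutativeRing }

  open CommutativeRing commutativeRing public
    using ( _+_; _*_; -_; 0#; 1#; +-comm; +-identityˡ; +-identityʳ; -‿inverseˡ; -‿inverseʳ
          ; *-assoc; *-comm; *-identityˡ; *-identityʳ; zeroˡ; zeroʳ
          ; +-isCommutativeMonoid; *-isCommutativeMonoid; ring; semiring; commutativeSemiring )
  open RingSolver isCommutativeRing public using (Polynomial; solve; _:=_; _:+_; _:*_; _:-_; :-_; :0; :1)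
  open import Algebra.Properties.Ring ring public using (-‿involutive; -0#≈0#)
  open import Algebra.Properties.CommutativeSemiring.Exp commutativeSemiring public
    using (_^_; ^-assocʳ; ^-distrib-*)
  open import Algebra.Properties.Semiring.Mult semiring public
    using (×1-homo-*; ×-assoc-*; ×-assocˡ)
    renaming (_×_ to infixr 8 _•_)

  infixl 6 _-_
  _-_ : Carrier → Carrier → Carrier
  x - y = x + - y

  1≢0 : 1# ≢ 0#
  1≢0 1≡0 = 0≢1 (sym 1≡0)

  x-y≡0⇒x≡y : ∀ {x y} → x - y ≡ 0# → x ≡ y
  x-y≡0⇒x≡y {x} {y} x-y≡0 = trans (sym (solve 2 (λ x y → (x :- y) :+ y := x) refl x y))
    (trans (cong (_+ y) x-y≡0) (+-identityˡ y))

  x≡y⇒x-y≡0 : ∀ {x y} → x ≡ y → x - y ≡ 0#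
  x≡y⇒x-y≡0 {x} refl = -‿inverseʳ x

  +-cancelʳ : ∀ {x y} z → x + z ≡ y + z → x ≡ y
  +-cancelʳ {x} {y} z x+z≡y+z = x-y≡0⇒x≡y (begin
    x - y                 ≡⟨ solve 3 (λ x y z → x :- y := (x :+ z) :- (y :+ z)) refl x y z ⟩
    (x + z) - (y + z)     ≡⟨ x≡y⇒x-y≡0 x+z≡y+z ⟩
    0#                    ∎)
    where open ≡-Reasoning

  -≢0 : ∀ {x} → x ≢ 0# → - x ≢ 0#
  -≢0 {x} x≢0 -x≡0 = x≢0 (trans (sym (-‿involutive x)) (trans (cong -_ -x≡0) -0#≈0#))

  -- 0# ⁻¹ is the junk value 0#.
  _⁻¹ : Carrier → Carrier
  x ⁻¹ with x ≟ 0#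
  ... | yes _ = 0#
  ... | no x≢0 = proj₁ (FiniteField.inverse F x x≢0)

  ⁻¹-inverseʳ : ∀ {x} → x ≢ 0# → x * x ⁻¹ ≡ 1#
  ⁻¹-inverseʳ {x} x≢0 with x ≟ 0#
  ... | yes x≡0 = ⊥-elim (x≢0 x≡0)
  ... | no x≢0′ = proj₂ (FiniteField.inverse F x x≢0′)

  ⁻¹-inverseˡ : ∀ {x} → x ≢ 0# → x ⁻¹ * x ≡ 1#
  ⁻¹-inverseˡ x≢0 = trans (*-comm _ _) (⁻¹-inverseʳ x≢0)

  ⁻¹≢0 : ∀ {x} → x ≢ 0# → x ⁻¹ ≢ 0#
  ⁻¹≢0 {x} x≢0 x⁻¹≡0 = 1≢0 (trans (sym (⁻¹-inverseʳ x≢0)) (trans (cong (x *_) x⁻¹≡0) (zeroʳ x)))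

  *-cancelˡ : ∀ {a x y} → a ≢ 0# → a * x ≡ a * y → x ≡ y
  *-cancelˡ {a} {x} {y} a≢0 ax≡ay = begin
    x                 ≡⟨ sym (*-identityˡ x) ⟩
    1# * x            ≡⟨ cong (_* x) (sym (⁻¹-inverseˡ a≢0)) ⟩
    a ⁻¹ * a * x      ≡⟨ *-assoc _ a x ⟩
    a ⁻¹ * (a * x)    ≡⟨ cong (a ⁻¹ *_) ax≡ay ⟩
    a ⁻¹ * (a * y)    ≡⟨ sym (*-assoc _ a y) ⟩
    a ⁻¹ * a * y      ≡⟨ cong (_* y) (⁻¹-inverseˡ a≢0) ⟩
    1# * y            ≡⟨ *-identityˡ y ⟩
    y                 ∎
    where open ≡-Reasoning

  *-cancelʳ : ∀ {a x y} → a ≢ 0# → x * a ≡ y * a → x ≡ y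
  *-cancelʳ {a} {x} {y} a≢0 xa≡ya = *-cancelˡ a≢0 (trans (*-comm a x) (trans xa≡ya (*-comm y a)))

  *-eliminateˡ : ∀ {a x} → a ≢ 0# → a * x ≡ 0# → x ≡ 0#
  *-eliminateˡ {a} a≢0 ax≡0 = *-cancelˡ a≢0 (trans ax≡0 (sym (zeroʳ a)))

  *≢0 : ∀ {x y} → x ≢ 0# → y ≢ 0# → x * y ≢ 0#
  *≢0 {x} {y} x≢0 y≢0 xy≡0 = y≢0 (*-eliminateˡ x≢0 xy≡0)

  1^n≡1 : ∀ n → 1# ^ n ≡ 1#
  1^n≡1 zero = refl
  1^n≡1 (suc n) = trans (*-identityˡ _) (1^n≡1 n)

  0^n≡0 : ∀ {n} → 1 ≤ n → 0# ^ n ≡ 0#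
  0^n≡0 {suc n} _ = zeroˡ _

  ^≢0 : ∀ {x} n → x ≢ 0# → x ^ n ≢ 0#
  ^≢0 zero _ = 1≢0
  ^≢0 (suc n) x≢0 = *≢0 x≢0 (^≢0 n x≢0)

  ^≡0⇒≡0 : ∀ {x} n → x ^ n ≡ 0# → x ≡ 0#
  ^≡0⇒≡0 {x} n xⁿ≡0 with x ≟ 0#
  ... | yes x≡0 = x≡0
  ... | no x≢0 = ⊥-elim (^≢0 n x≢0 xⁿ≡0)

  •1-^ : ∀ m n → (m ℕ.^ n) • 1# ≡ (m • 1#) ^ n
  •1-^ m zero = +-identityʳ 1#
  •1-^ m (suc n) = trans (×1-homo-* m (m ℕ.^ n)) (cong ((m • 1#) *_) (•1-^ m n))

  nonzero : List Carrier
  nonzero = filter (λ x → ¬? (x ≟ 0#)) elements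

  ∈-nonzero⁺ : ∀ {x} → x ≢ 0# → x ∈ nonzero
  ∈-nonzero⁺ {x} = ∈-filter⁺ (λ x → ¬? (x ≟ 0#)) (elements-complete x)

  ∈-nonzero⁻ : ∀ {x} → x ∈ nonzero → x ≢ 0#
  ∈-nonzero⁻ x∈ = proj₂ (∈-filter⁻ (λ x → ¬? (x ≟ 0#)) {xs = elements} x∈)

  nonzero-unique : Unique nonzero
  nonzero-unique = filter⁺ (λ x → ¬? (x ≟ 0#)) elements-unique

  1+|nonzero|≡|F| : suc (length nonzero) ≡ length elements
  1+|nonzero|≡|F| = length-remove _≟_ elements elements-unique (elements-complete 0#)

  ∑F : List Carrier → Carrier
  ∑F = foldr _+_ 0#

  ∏F : List Carrier → Carrier
  ∏F = foldr _*_ 1#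

  -- x ↦ 1 + x permutes F, so ∑F elements ≡ |F| • 1 + ∑F elements.
  |F|•1≡0 : length elements • 1# ≡ 0#
  |F|•1≡0 = +-cancelʳ (∑F elements) (begin
    length elements • 1# + ∑F elements     ≡⟨ sym (∑F-shift elements) ⟩
    ∑F (map (1# +_) elements)               ≡⟨ foldr-sameMembers +-isCommutativeMonoid
                                                 (map⁺-injectiveOn _ elements elements-unique (λ x y _ _ → shift-injective))
                                                 elements-unique (λ z _ → elements-complete z) (λ z _ → shifted z) ⟩
    ∑F elements                             ≡⟨ sym (+-identityˡ _) ⟩
    0# + ∑F elements                        ∎)
    where
    open ≡-Reasoning
    ∑F-shift : ∀ xs → ∑F (map (1# +_) xs) ≡ length xs • 1# + ∑F xs
    ∑F-shift [] = sym (+-identityˡ 0#)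
    ∑F-shift (x ∷ xs) = trans (cong ((1# + x) +_) (∑F-shift xs))
      (solve 3 (λ x n s → (:1 :+ x) :+ (n :+ s) := (:1 :+ n) :+ (x :+ s)) refl x (length xs • 1#) (∑F xs))
    shift-injective : ∀ {x y} → 1# + x ≡ 1# + y → x ≡ y
    shift-injective {x} {y} e = +-cancelʳ 1# (trans (+-comm x 1#) (trans e (+-comm 1# y)))
    shifted : ∀ z → z ∈ map (1# +_) elements
    shifted z = subst (_∈ map (1# +_) elements) (solve 1 (λ z → :1 :+ (z :- :1) := z) refl z)
      (∈-map⁺ (1# +_) (elements-complete (z - 1#)))

  characteristic : ∀ {p n} → Prime p → length elements ≡ p ℕ.^ n → p • 1# ≡ 0#
  characteristic {p} {n} _ |F|≡pⁿ = ^≡0⇒≡0 n (begin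
    (p • 1#) ^ n              ≡⟨ sym (•1-^ p n) ⟩
    (p ℕ.^ n) • 1#            ≡⟨ cong (_• 1#) (sym |F|≡pⁿ) ⟩
    length elements • 1#      ≡⟨ |F|•1≡0 ⟩
    0#                        ∎)
    where open ≡-Reasoning

  -- For x ≢ 0, y ↦ x * y permutes the nonzero elements.
  x^|nonzero|≡1 : ∀ {x} → x ≢ 0# → x ^ length nonzero ≡ 1#
  x^|nonzero|≡1 {x} x≢0 = *-cancelʳ (∏≢0 nonzero (λ _ → ∈-nonzero⁻)) (begin
    x ^ length nonzero * ∏F nonzero      ≡⟨ sym (∏F-scale nonzero) ⟩
    ∏F (map (x *_) nonzero)              ≡⟨ foldr-sameMembers *-isCommutativeMonoid
                                              (map⁺-injectiveOn _ nonzero nonzero-unique (λ _ _ _ _ → *-cancelˡ x≢0))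
                                              nonzero-unique scaled⊆ ⊆scaled ⟩
    ∏F nonzero                           ≡⟨ sym (*-identityˡ _) ⟩
    1# * ∏F nonzero                      ∎)
    where
    open ≡-Reasoning
    ∏F-scale : ∀ ys → ∏F (map (x *_) ys) ≡ x ^ length ys * ∏F ys
    ∏F-scale [] = sym (*-identityˡ 1#)
    ∏F-scale (y ∷ ys) = trans (cong ((x * y) *_) (∏F-scale ys))
      (solve 4 (λ x y a b → (x :* y) :* (a :* b) := (x :* a) :* (y :* b)) refl x y _ _)
    ∏≢0 : ∀ ys → (∀ y → y ∈ ys → y ≢ 0#) → ∏F ys ≢ 0#
    ∏≢0 [] _ = 1≢0
    ∏≢0 (y ∷ ys) ys≢0 = *≢0 (ys≢0 y (here refl)) (∏≢0 ys (λ z z∈ → ys≢0 z (there z∈)))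
    scaled⊆ : ∀ z → z ∈ map (x *_) nonzero → z ∈ nonzero
    scaled⊆ z z∈ with ∈-map⁻ (x *_) z∈
    ... | y , y∈ , refl = ∈-nonzero⁺ (*≢0 x≢0 (∈-nonzero⁻ y∈))
    ⊆scaled : ∀ z → z ∈ nonzero → z ∈ map (x *_) nonzero
    ⊆scaled z z∈ = subst (_∈ map (x *_) nonzero) x*x⁻¹z≡z
      (∈-map⁺ (x *_) (∈-nonzero⁺ (*≢0 (⁻¹≢0 x≢0) (∈-nonzero⁻ z∈))))
      where
      x*x⁻¹z≡z : x * (x ⁻¹ * z) ≡ z
      x*x⁻¹z≡z = trans (sym (*-assoc _ _ _)) (trans (cong (_* z) (⁻¹-inverseʳ x≢0)) (*-identityˡ z))

  fermat : ∀ x → x ^ length elements ≡ x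
  fermat x with x ≟ 0#
  ... | yes refl = subst (λ n → 0# ^ n ≡ 0#) 1+|nonzero|≡|F| (zeroˡ _)
  ... | no x≢0 = subst (λ n → x ^ n ≡ x) 1+|nonzero|≡|F| (trans (cong (x *_) (x^|nonzero|≡1 x≢0)) (*-identityʳ x))

  p∣n⇒n•x≡0 : ∀ {p n} z → p • 1# ≡ 0# → p ∣ n → n • z ≡ 0#
  p∣n⇒n•x≡0 {p} {n} z p•1≡0 (divides d n≡d*p) = begin
    n • z                 ≡⟨ cong (_• z) (trans n≡d*p (ℕ.*-comm d p)) ⟩
    (p ℕ.* d) • z         ≡⟨ sym (×-assocˡ z p d) ⟩
    p • (d • z)           ≡⟨ cong (p •_) (sym (*-identityˡ _)) ⟩
    p • (1# * (d • z))    ≡⟨ sym (×-assoc-* p 1# (d • z)) ⟩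
    (p • 1#) * (d • z)    ≡⟨ cong (_* (d • z)) p•1≡0 ⟩
    0# * (d • z)          ≡⟨ zeroˡ _ ⟩
    0#                    ∎
    where open ≡-Reasoning

  frobenius : ∀ {p} → Prime p → p • 1# ≡ 0# → ∀ x y → (x + y) ^ p ≡ x ^ p + y ^ p
  frobenius {suc m} p-prime p•1≡0 x y = begin
    (x + y) ^ suc m                       ≡⟨ theorem (suc m) x y ⟩
    t zero + sum (tail t)                  ≡⟨ cong (t zero +_) (sum-init-last (tail t)) ⟩
    t zero + (sum (init (tail t)) + t (fromℕ (suc m)))
      ≡⟨ cong₂ (λ u v → t zero + (u + v)) (trans (sum-cong-≗ middle) (sum-replicate-zero m)) last-term ⟩
    t zero + (0# + x ^ suc m)             ≡⟨ cong₂ _+_ first-term (+-identityˡ _) ⟩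
    y ^ suc m + x ^ suc m                 ≡⟨ +-comm _ _ ⟩
    x ^ suc m + y ^ suc m                 ∎
    where
    open ≡-Reasoning
    open import Algebra.Properties.CommutativeSemiring.Binomial commutativeSemiring
      using (theorem; binomialTerm)
    open import Algebra.Properties.Monoid.Sum (CommutativeRing.+-monoid commutativeRing)
      using (sum; sum-init-last; sum-cong-≗; sum-replicate-zero)
    open import Data.Vec.Functional as Vector using (init; tail)
    t : Fin (suc (suc m)) → Carrier
    t = binomialTerm x y (suc m)
    first-term : t zero ≡ y ^ suc m
    first-term = trans (+-identityʳ _) (*-identityˡ _)
    last-term : t (fromℕ (suc m)) ≡ x ^ suc m
    last-term = top-term _ (toℕ-fromℕ (suc m))
      where
      top-term : ∀ k → k ≡ suc m → (suc m C k) • (x ^ k * y ^ (suc m ℕ.∸ k)) ≡ x ^ suc m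
      top-term _ refl rewrite nCn≡1 (suc m) | ℕ.n∸n≡0 m = trans (+-identityʳ _) (*-identityʳ _)
    middle : ∀ i → init (tail t) i ≡ Vector.replicate m 0# i
    middle i = p∣n⇒n•x≡0 _ p•1≡0 (subst (λ k → suc m ∣ suc m C suc k) (sym (toℕ-inject₁ i))
      (p∣pCk p-prime (s≤s z≤n) (s≤s (toℕ<n i))))

  -- evalMonic (c₀ ∷ … ∷ cₙ₋₁ ∷ []) x = c₀ + c₁ x + ⋯ + cₙ₋₁ xⁿ⁻¹ + xⁿ
  evalMonic : List Carrier → Carrier → Carrier
  evalMonic [] x = 1#
  evalMonic (c ∷ cs) x = c + x * evalMonic cs x

  divideByLinear : Carrier → Carrier → List Carrier → List Carrier × Carrier
  divideByLinear a c [] = [] , c + a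
  divideByLinear a c (c′ ∷ cs) with divideByLinear a c′ cs
  ... | q , r = r ∷ q , c + a * r

  divideByLinear-correct : ∀ a c cs x → let (q , r) = divideByLinear a c cs in
    evalMonic (c ∷ cs) x ≡ (x - a) * evalMonic q x + r
  divideByLinear-correct a c [] x = solve 3 (λ a c x → c :+ x :* :1 := (x :- a) :* :1 :+ (c :+ a)) refl a c x
  divideByLinear-correct a c (c′ ∷ cs) x with divideByLinear a c′ cs | divideByLinear-correct a c′ cs x
  ... | q , r | eq = trans (cong (λ z → c + x * z) eq)
    (solve 5 (λ a c x g r → c :+ x :* ((x :- a) :* g :+ r) := (x :- a) :* (r :+ x :* g) :+ (c :+ a :* r))
      refl a c x (evalMonic q x) r)

  divideByLinear-degree : ∀ a c cs → length (proj₁ (divideByLinear a c cs)) ≡ length cs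
  divideByLinear-degree a c [] = refl
  divideByLinear-degree a c (c′ ∷ cs) = cong suc (divideByLinear-degree a c′ cs)

  roots≤degree : ∀ cs rs → Unique rs → (∀ r → r ∈ rs → evalMonic cs r ≡ 0#) → length rs ≤ length cs
  roots≤degree cs [] _ _ = z≤n
  roots≤degree [] (r ∷ rs) _ roots = ⊥-elim (1≢0 (roots r (here refl)))
  roots≤degree (c ∷ cs) (r ∷ rs) (r∉rs ∷ urs) roots = subst (λ n → suc (length rs) ≤ suc n)
    (divideByLinear-degree r c cs) (s≤s (roots≤degree q rs urs q-roots))
    where
    q = proj₁ (divideByLinear r c cs)
    rem = proj₂ (divideByLinear r c cs)
    rem≡0 : rem ≡ 0#
    rem≡0 = begin
      rem                                 ≡⟨ sym (+-identityˡ rem) ⟩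
      0# + rem                            ≡⟨ cong (_+ rem) (sym (trans (cong (_* evalMonic q r) (-‿inverseʳ r)) (zeroˡ _))) ⟩
      (r - r) * evalMonic q r + rem       ≡⟨ sym (divideByLinear-correct r c cs r) ⟩
      evalMonic (c ∷ cs) r                ≡⟨ roots r (here refl) ⟩
      0#                                  ∎
      where open ≡-Reasoning
    q-roots : ∀ r′ → r′ ∈ rs → evalMonic q r′ ≡ 0#
    q-roots r′ r′∈rs = *-eliminateˡ r′-r≢0 (begin
      (r′ - r) * evalMonic q r′           ≡⟨ sym (+-identityʳ _) ⟩
      (r′ - r) * evalMonic q r′ + 0#      ≡⟨ cong ((r′ - r) * evalMonic q r′ +_) (sym rem≡0) ⟩
      (r′ - r) * evalMonic q r′ + rem     ≡⟨ sym (divideByLinear-correct r c cs r′) ⟩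
      evalMonic (c ∷ cs) r′               ≡⟨ roots r′ (there r′∈rs) ⟩
      0#                                  ∎)
      where
      open ≡-Reasoning
      r′-r≢0 : r′ - r ≢ 0#
      r′-r≢0 r′-r≡0 = Unique[x∷xs]⇒x∉xs (r∉rs ∷ urs) (subst (_∈ rs) (x-y≡0⇒x≡y r′-r≡0) r′∈rs)

  |roots|≤degree : ∀ cs {xs} → Unique xs → {P : Carrier → Set} (P? : Decidable P) →
    (∀ x → P x → evalMonic cs x ≡ 0#) → length (filter P? xs) ≤ length cs
  |roots|≤degree cs {xs} uxs P? roots = roots≤degree cs (filter P? xs) (filter⁺ P? uxs)
    (λ r r∈ → roots r (proj₂ (∈-filter⁻ P? {xs = xs} r∈)))

  evalMonic-zeros : ∀ n x → evalMonic (replicate n 0#) x ≡ x ^ n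
  evalMonic-zeros zero x = refl
  evalMonic-zeros (suc n) x = trans (+-identityˡ _) (cong (x *_) (evalMonic-zeros n x))

module QuadraticExtension (F : FiniteField) {q p k : ℕ} (p-prime : Prime p) (1≤k : 1 ≤ k)
  (q≡pᵏ : q ≡ p ℕ.^ k) (|F|≡q² : length (FiniteField.elements F) ≡ q ℕ.^ 2) where

  open FieldProperties F

  |F|≡q*q : length elements ≡ q ℕ.* q
  |F|≡q*q = trans |F|≡q² (cong (q ℕ.*_) (ℕ.*-identityʳ q))

  2≤q : 2 ≤ q
  2≤q = subst (2 ≤_) (sym q≡pᵏ) (2≤pᵏ p-prime 1≤k)
    where
    2≤pᵏ : ∀ {p k} → Prime p → 1 ≤ k → 2 ≤ p ℕ.^ k
    2≤pᵏ {suc (suc p)} {suc k} _ _ =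
      ℕ.≤-trans (s≤s (s≤s z≤n)) (ℕ.m≤m*n (suc (suc p)) _ {{ℕ.m^n≢0 (suc (suc p)) k}})

  σ : Carrier → Carrier
  σ x = x ^ q

  σ-+ : ∀ x y → σ (x + y) ≡ σ x + σ y
  σ-+ x y = subst (λ n → (x + y) ^ n ≡ x ^ n + y ^ n) (sym q≡pᵏ) (frobeniusⁿ k x y)
    where
    p•1≡0 : p • 1# ≡ 0#
    p•1≡0 = characteristic {n = k ℕ.* 2} p-prime (trans |F|≡q² (trans (cong (ℕ._^ 2) q≡pᵏ) (ℕ.^-*-assoc p k 2)))
    frobeniusⁿ : ∀ n x y → (x + y) ^ (p ℕ.^ n) ≡ x ^ (p ℕ.^ n) + y ^ (p ℕ.^ n)
    frobeniusⁿ zero x y = trans (*-identityʳ _) (sym (cong₂ _+_ (*-identityʳ x) (*-identityʳ y)))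
    frobeniusⁿ (suc n) x y = begin
      (x + y) ^ (p ℕ.* p ℕ.^ n)               ≡⟨ sym (^-assocʳ (x + y) p (p ℕ.^ n)) ⟩
      ((x + y) ^ p) ^ (p ℕ.^ n)               ≡⟨ cong (_^ (p ℕ.^ n)) (frobenius p-prime p•1≡0 x y) ⟩
      (x ^ p + y ^ p) ^ (p ℕ.^ n)             ≡⟨ frobeniusⁿ n (x ^ p) (y ^ p) ⟩
      (x ^ p) ^ (p ℕ.^ n) + (y ^ p) ^ (p ℕ.^ n) ≡⟨ cong₂ _+_ (^-assocʳ x p (p ℕ.^ n)) (^-assocʳ y p (p ℕ.^ n)) ⟩
      x ^ (p ℕ.* p ℕ.^ n) + y ^ (p ℕ.* p ℕ.^ n) ∎
      where open ≡-Reasoning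

  σ-* : ∀ x y → σ (x * y) ≡ σ x * σ y
  σ-* x y = ^-distrib-* x y q

  σ-0 : σ 0# ≡ 0#
  σ-0 = 0^n≡0 (ℕ.≤-trans (s≤s z≤n) 2≤q)

  σ-1 : σ 1# ≡ 1#
  σ-1 = 1^n≡1 q

  σ-neg : ∀ x → σ (- x) ≡ - σ x
  σ-neg x = +-cancelʳ (σ x) (begin
    σ (- x) + σ x     ≡⟨ sym (σ-+ (- x) x) ⟩
    σ (- x + x)       ≡⟨ cong σ (-‿inverseˡ x) ⟩
    σ 0#              ≡⟨ σ-0 ⟩
    0#                ≡⟨ sym (-‿inverseˡ (σ x)) ⟩
    - σ x + σ x       ∎)
    where open ≡-Reasoning

  σ-involutive : ∀ x → σ (σ x) ≡ x
  σ-involutive x = begin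
    (x ^ q) ^ q           ≡⟨ ^-assocʳ x q q ⟩
    x ^ (q ℕ.* q)         ≡⟨ cong (x ^_) (sym |F|≡q*q) ⟩
    x ^ length elements   ≡⟨ fermat x ⟩
    x                     ∎
    where open ≡-Reasoning

  σ≡0⇒≡0 : ∀ {x} → σ x ≡ 0# → x ≡ 0#
  σ≡0⇒≡0 {x} σx≡0 = trans (sym (σ-involutive x)) (trans (cong σ σx≡0) σ-0)

  fixed : List Carrier
  fixed = filter (λ x → σ x ≟ x) elements

  ∈-fixed⁺ : ∀ {x} → σ x ≡ x → x ∈ fixed
  ∈-fixed⁺ {x} = ∈-filter⁺ (λ x → σ x ≟ x) (elements-complete x)

  fixed-unique : Unique fixed
  fixed-unique = filter⁺ (λ x → σ x ≟ x) elements-unique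

  private
    2+[q-2]≡q : 2 ℕ.+ (q ℕ.∸ 2) ≡ q
    2+[q-2]≡q = ℕ.m+[n∸m]≡n 2≤q

    degree≡q : ∀ a b → length (a ∷ b ∷ replicate (q ℕ.∸ 2) 0#) ≡ q
    degree≡q a b = trans (cong (2 ℕ.+_) (length-replicate (q ℕ.∸ 2))) 2+[q-2]≡q

    x^[2+[q-2]]≡σx : ∀ x → x * (x * x ^ (q ℕ.∸ 2)) ≡ σ x
    x^[2+[q-2]]≡σx x = cong (x ^_) 2+[q-2]≡q

  |fixed|≤q : length fixed ≤ q
  |fixed|≤q = subst (length fixed ≤_) (degree≡q 0# (- 1#))
    (|roots|≤degree (0# ∷ - 1# ∷ replicate (q ℕ.∸ 2) 0#) elements-unique (λ x → σ x ≟ x) root)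
    where
    root : ∀ x → σ x ≡ x → evalMonic (0# ∷ - 1# ∷ replicate (q ℕ.∸ 2) 0#) x ≡ 0#
    root x σx≡x = begin
      0# + x * (- 1# + x * evalMonic (replicate (q ℕ.∸ 2) 0#) x)
        ≡⟨ cong (λ z → 0# + x * (- 1# + x * z)) (evalMonic-zeros (q ℕ.∸ 2) x) ⟩
      0# + x * (- 1# + x * x ^ (q ℕ.∸ 2))
        ≡⟨ solve 2 (λ x y → :0 :+ x :* (:- :1 :+ x :* y) := x :* (x :* y) :- x) refl x _ ⟩
      x * (x * x ^ (q ℕ.∸ 2)) - x
        ≡⟨ x≡y⇒x-y≡0 (trans (x^[2+[q-2]]≡σx x) σx≡x) ⟩
      0# ∎
      where open ≡-Reasoning

  Tr : Carrier → Carrier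
  Tr x = x + σ x

  σ-Tr : ∀ x → σ (Tr x) ≡ Tr x
  σ-Tr x = trans (σ-+ x (σ x)) (trans (cong (σ x +_) (σ-involutive x)) (+-comm _ _))

  |Tr⁻¹|≤q : ∀ c → length (filter (λ x → Tr x ≟ c) elements) ≤ q
  |Tr⁻¹|≤q c = subst (length (filter (λ x → Tr x ≟ c) elements) ≤_) (degree≡q (- c) 1#)
    (|roots|≤degree (- c ∷ 1# ∷ replicate (q ℕ.∸ 2) 0#) elements-unique (λ x → Tr x ≟ c) root)
    where
    root : ∀ x → Tr x ≡ c → evalMonic (- c ∷ 1# ∷ replicate (q ℕ.∸ 2) 0#) x ≡ 0#
    root x Trx≡c = begin
      - c + x * (1# + x * evalMonic (replicate (q ℕ.∸ 2) 0#) x)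
        ≡⟨ cong (λ z → - c + x * (1# + x * z)) (evalMonic-zeros (q ℕ.∸ 2) x) ⟩
      - c + x * (1# + x * x ^ (q ℕ.∸ 2))
        ≡⟨ solve 3 (λ c x y → :- c :+ x :* (:1 :+ x :* y) := (x :+ x :* (x :* y)) :- c) refl c x _ ⟩
      (x + x * (x * x ^ (q ℕ.∸ 2))) - c
        ≡⟨ x≡y⇒x-y≡0 (trans (cong (x +_) (x^[2+[q-2]]≡σx x)) Trx≡c) ⟩
      0# ∎
      where open ≡-Reasoning

  private
    Tr∈fixed : ∀ x → x ∈ elements → Tr x ∈ fixed
    Tr∈fixed x _ = ∈-fixed⁺ (σ-Tr x)

  -- Tr maps F into fixed with fibres of size at most q, so q * q ≤ length fixed * q.
  |fixed|≡q : length fixed ≡ q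
  |fixed|≡q = ℕ.≤-antisym |fixed|≤q (ℕ.*-cancelʳ-≤ q (length fixed) q {{ℕ.>-nonZero (ℕ.≤-trans (s≤s z≤n) 2≤q)}}
    (subst (ℕ._≤ length fixed ℕ.* q) |F|≡q*q
      (length≤|codomain|*fibre _≟_ elements fixed Tr fixed-unique Tr∈fixed (λ c _ → |Tr⁻¹|≤q c))))

  |Tr⁻¹0|≡q : length (filter (λ x → Tr x ≟ 0#) elements) ≡ q
  |Tr⁻¹0|≡q = fibres-full _≟_ elements fixed Tr fixed-unique Tr∈fixed (λ c _ → |Tr⁻¹|≤q c)
    (trans |F|≡q*q (cong (ℕ._* q) (sym |fixed|≡q))) 0# (∈-fixed⁺ σ-0)

  N : Carrier → Carrier
  N x = x ^ suc q

  σ-N : ∀ x → σ (N x) ≡ N x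
  σ-N x = trans (σ-* x (σ x)) (trans (cong (σ x *_) (σ-involutive x)) (*-comm _ _))

  N≢0 : ∀ {x} → x ≢ 0# → N x ≢ 0#
  N≢0 = ^≢0 (suc q)

  fixed* : List Carrier
  fixed* = filter (λ x → ¬? (x ≟ 0#)) fixed

  1+|fixed*|≡q : suc (length fixed*) ≡ q
  1+|fixed*|≡q = trans (length-remove _≟_ fixed fixed-unique (∈-fixed⁺ σ-0)) |fixed|≡q

  |N⁻¹|≤q+1 : ∀ c → length (filter (λ x → N x ≟ c) nonzero) ≤ suc q
  |N⁻¹|≤q+1 c = subst (length (filter (λ x → N x ≟ c) nonzero) ≤_) (cong suc (length-replicate q))
    (|roots|≤degree (- c ∷ replicate q 0#) nonzero-unique (λ x → N x ≟ c) root)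
    where
    root : ∀ x → N x ≡ c → evalMonic (- c ∷ replicate q 0#) x ≡ 0#
    root x Nx≡c = trans (cong (λ z → - c + x * z) (evalMonic-zeros q x))
      (trans (+-comm _ _) (x≡y⇒x-y≡0 Nx≡c))

  private
    N∈fixed* : ∀ x → x ∈ nonzero → N x ∈ fixed*
    N∈fixed* x x∈ = ∈-filter⁺ (λ x → ¬? (x ≟ 0#)) (∈-fixed⁺ (σ-N x)) (N≢0 (∈-nonzero⁻ x∈))

    |nonzero|≡|fixed*|*[q+1] : length nonzero ≡ length fixed* ℕ.* suc q
    |nonzero|≡|fixed*|*[q+1] = ℕ.suc-injective (begin
      suc (length nonzero)                   ≡⟨ 1+|nonzero|≡|F| ⟩
      length elements                        ≡⟨ |F|≡q*q ⟩
      q ℕ.* q                                ≡⟨ cong (λ n → n ℕ.* n) (sym 1+|fixed*|≡q) ⟩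
      suc (length fixed*) ℕ.* suc (length fixed*)        ≡⟨ square (length fixed*) ⟩
      suc (length fixed* ℕ.* suc (suc (length fixed*)))  ≡⟨ cong (λ n → suc (length fixed* ℕ.* suc n)) 1+|fixed*|≡q ⟩
      suc (length fixed* ℕ.* suc q)          ∎)
      where
      open ≡-Reasoning
      square : ∀ a → suc a ℕ.* suc a ≡ suc (a ℕ.* suc (suc a))
      square = solve-∀

  -- N maps nonzero into fixed* with fibres of size at most q + 1, and q * q - 1 = length fixed* * (q + 1).
  |N⁻¹|≡q+1 : ∀ c → σ c ≡ c → c ≢ 0# → length (filter (λ x → N x ≟ c) elements) ≡ suc q
  |N⁻¹|≡q+1 c σc≡c c≢0 = begin
    length (filter (λ x → N x ≟ c) elements)    ≡⟨ sym (length-filter-filter (λ x → N x ≟ c) (λ x → ¬? (x ≟ 0#)) elements Nx≡c⇒x≢0) ⟩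
    length (filter (λ x → N x ≟ c) nonzero)     ≡⟨ fibres-full _≟_ nonzero fixed* N
                                                     (filter⁺ (λ x → ¬? (x ≟ 0#)) fixed-unique) N∈fixed* (λ c _ → |N⁻¹|≤q+1 c)
                                                     |nonzero|≡|fixed*|*[q+1] c (∈-filter⁺ (λ x → ¬? (x ≟ 0#)) (∈-fixed⁺ σc≡c) c≢0) ⟩
    suc q                                       ∎
    where
    open ≡-Reasoning
    Nx≡c⇒x≢0 : ∀ x → N x ≡ c → x ≢ 0#
    Nx≡c⇒x≢0 x Nx≡c refl = c≢0 (trans (sym Nx≡c) (zeroˡ _))

  |N⁻¹0|≡1 : length (filter (λ x → N x ≟ 0#) elements) ≡ 1
  |N⁻¹0|≡1 = trans (length-filter-cong (λ x → N x ≟ 0#) (_≟ 0#) elements (λ x _ → ^≡0⇒≡0 (suc q)) (λ { x _ refl → zeroˡ _ }))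
    (length-filter-≟ _≟_ elements elements-unique (elements-complete 0#))

-- Geometry is indexed by q only for the sake of the unital; nothing here depends on q.
module PlaneGeometry (F : FiniteField) (q : ℕ) where

  open FieldProperties F
  open Geometry F q using (Triple; Normalized; normalized?; allTriples; points; unital; secants; _I_; _I?_)

  infixl 6 _⊕_
  infixr 7 _⊙_
  infixl 8 _⨯_
  infix 7 _·_
  infix 4 _∼_

  𝟎 : Triple
  𝟎 = 0# , 0# , 0#

  _⊕_ : Triple → Triple → Triple
  (x₁ , x₂ , x₃) ⊕ (y₁ , y₂ , y₃) = x₁ + y₁ , x₂ + y₂ , x₃ + y₃

  _⊙_ : Carrier → Triple → Triple
  c ⊙ (x₁ , x₂ , x₃) = c * x₁ , c * x₂ , c * x₃

  _⨯_ : Triple → Triple → Triple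
  (a₁ , a₂ , a₃) ⨯ (b₁ , b₂ , b₃) = a₂ * b₃ - a₃ * b₂ , a₃ * b₁ - a₁ * b₃ , a₁ * b₂ - a₂ * b₁

  -- Chosen so that P I ℓ is definitionally P · ℓ ≡ 0#.
  _·_ : Triple → Triple → Carrier
  (x , y , z) · (a , b , c) = a * x + b * y + c * z

  det : Triple → Triple → Triple → Carrier
  det P Q R = R · (P ⨯ Q)

  ≡-triple : ∀ {x₁ x₂ x₃ y₁ y₂ y₃ : Carrier} → x₁ ≡ y₁ → x₂ ≡ y₂ → x₃ ≡ y₃ →
    (x₁ , x₂ , x₃) ≡ (y₁ , y₂ , y₃)
  ≡-triple refl refl refl = refl

  triple-≡ : ∀ {x₁ x₂ x₃ y₁ y₂ y₃ : Carrier} → (x₁ , x₂ , x₃) ≡ (y₁ , y₂ , y₃) →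
    x₁ ≡ y₁ × x₂ ≡ y₂ × x₃ ≡ y₃
  triple-≡ refl = refl , refl , refl

  ·-comm : ∀ u v → u · v ≡ v · u
  ·-comm (x , y , z) (a , b , c) = solve 6 (λ x y z a b c → a :* x :+ b :* y :+ c :* z := x :* a :+ y :* b :+ z :* c) refl x y z a b c

  ·-⊙ˡ : ∀ c u v → (c ⊙ u) · v ≡ c * (u · v)
  ·-⊙ˡ c (x , y , z) (a , b , d) = solve 7 (λ c x y z a b d →
    a :* (c :* x) :+ b :* (c :* y) :+ d :* (c :* z) := c :* (a :* x :+ b :* y :+ d :* z)) refl c x y z a b d

  ·-⊙ʳ : ∀ c u v → u · (c ⊙ v) ≡ c * (u · v)
  ·-⊙ʳ c u v = trans (·-comm u (c ⊙ v)) (trans (·-⊙ˡ c v u) (cong (c *_) (·-comm v u)))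

  ⊙-identityˡ : ∀ v → 1# ⊙ v ≡ v
  ⊙-identityˡ (x , y , z) = ≡-triple (*-identityˡ x) (*-identityˡ y) (*-identityˡ z)

  ⊙-zeroˡ : ∀ v → 0# ⊙ v ≡ 𝟎
  ⊙-zeroˡ (x , y , z) = ≡-triple (zeroˡ x) (zeroˡ y) (zeroˡ z)

  ⊙-assoc : ∀ c d v → c ⊙ d ⊙ v ≡ (c * d) ⊙ v
  ⊙-assoc c d (x , y , z) = ≡-triple (sym (*-assoc c d x)) (sym (*-assoc c d y)) (sym (*-assoc c d z))

  ⊙≡𝟎 : ∀ {c v} → c ⊙ v ≡ 𝟎 → v ≢ 𝟎 → c ≡ 0#
  ⊙≡𝟎 {c} {x , y , z} c⊙v≡𝟎 v≢𝟎 with c ≟ 0# | triple-≡ c⊙v≡𝟎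
  ... | yes c≡0 | _ = c≡0
  ... | no c≢0 | cx≡0 , cy≡0 , cz≡0 =
    ⊥-elim (v≢𝟎 (≡-triple (*-eliminateˡ c≢0 cx≡0) (*-eliminateˡ c≢0 cy≡0) (*-eliminateˡ c≢0 cz≡0)))

  triple-product-expansion : ∀ X A B → X ⨯ (A ⨯ B) ≡ (X · B) ⊙ A ⊕ (- (X · A)) ⊙ B
  triple-product-expansion (x₁ , x₂ , x₃) (a₁ , a₂ , a₃) (b₁ , b₂ , b₃) = ≡-triple
    (solve 9 (λ x₁ x₂ x₃ a₁ a₂ a₃ b₁ b₂ b₃ →
       x₂ :* (a₁ :* b₂ :- a₂ :* b₁) :- x₃ :* (a₃ :* b₁ :- a₁ :* b₃)
       := (b₁ :* x₁ :+ b₂ :* x₂ :+ b₃ :* x₃) :* a₁ :+ (:- (a₁ :* x₁ :+ a₂ :* x₂ :+ a₃ :* x₃)) :* b₁)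
       refl x₁ x₂ x₃ a₁ a₂ a₃ b₁ b₂ b₃)
    (solve 9 (λ x₁ x₂ x₃ a₁ a₂ a₃ b₁ b₂ b₃ →
       x₃ :* (a₂ :* b₃ :- a₃ :* b₂) :- x₁ :* (a₁ :* b₂ :- a₂ :* b₁)
       := (b₁ :* x₁ :+ b₂ :* x₂ :+ b₃ :* x₃) :* a₂ :+ (:- (a₁ :* x₁ :+ a₂ :* x₂ :+ a₃ :* x₃)) :* b₂)
       refl x₁ x₂ x₃ a₁ a₂ a₃ b₁ b₂ b₃)
    (solve 9 (λ x₁ x₂ x₃ a₁ a₂ a₃ b₁ b₂ b₃ →
       x₁ :* (a₃ :* b₁ :- a₁ :* b₃) :- x₂ :* (a₂ :* b₃ :- a₃ :* b₂)
       := (b₁ :* x₁ :+ b₂ :* x₂ :+ b₃ :* x₃) :* a₃ :+ (:- (a₁ :* x₁ :+ a₂ :* x₂ :+ a₃ :* x₃)) :* b₃)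
       refl x₁ x₂ x₃ a₁ a₂ a₃ b₁ b₂ b₃)

  ⊥⊥⇒⨯≡𝟎 : ∀ X A B → X · A ≡ 0# → X · B ≡ 0# → X ⨯ (A ⨯ B) ≡ 𝟎
  ⊥⊥⇒⨯≡𝟎 X A B X·A≡0 X·B≡0 = begin
    X ⨯ (A ⨯ B)                          ≡⟨ triple-product-expansion X A B ⟩
    (X · B) ⊙ A ⊕ (- (X · A)) ⊙ B        ≡⟨ cong₂ (λ u v → u ⊙ A ⊕ (- v) ⊙ B) X·B≡0 X·A≡0 ⟩
    0# ⊙ A ⊕ (- 0#) ⊙ B                  ≡⟨ cong₂ _⊕_ (⊙-zeroˡ A) (trans (cong (_⊙ B) -0#≈0#) (⊙-zeroˡ B)) ⟩
    𝟎 ⊕ 𝟎                                ≡⟨ ≡-triple (+-identityˡ 0#) (+-identityˡ 0#) (+-identityˡ 0#) ⟩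
    𝟎                                    ∎
    where open ≡-Reasoning

  _∼_ : Triple → Triple → Set
  u ∼ v = ∃ λ c → c ≢ 0# × u ≡ c ⊙ v

  ∼-refl : ∀ {v} → v ∼ v
  ∼-refl {v} = 1# , 1≢0 , sym (⊙-identityˡ v)

  ∼-sym : ∀ {u v} → u ∼ v → v ∼ u
  ∼-sym {u} {v} (c , c≢0 , refl) = c ⁻¹ , ⁻¹≢0 c≢0 , (begin
    v                  ≡⟨ sym (⊙-identityˡ v) ⟩
    1# ⊙ v             ≡⟨ cong (_⊙ v) (sym (⁻¹-inverseˡ c≢0)) ⟩
    (c ⁻¹ * c) ⊙ v     ≡⟨ sym (⊙-assoc (c ⁻¹) c v) ⟩
    c ⁻¹ ⊙ c ⊙ v       ∎)
    where open ≡-Reasoning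

  ∼-trans : ∀ {u v w} → u ∼ v → v ∼ w → u ∼ w
  ∼-trans {w = w} (c , c≢0 , refl) (d , d≢0 , refl) = c * d , *≢0 c≢0 d≢0 , ⊙-assoc c d w

  ∼-byScalar : ∀ {u v} c → u ≢ 𝟎 → u ≡ c ⊙ v → u ∼ v
  ∼-byScalar {u} {v} c u≢𝟎 u≡cv with c ≟ 0#
  ... | yes refl = ⊥-elim (u≢𝟎 (trans u≡cv (⊙-zeroˡ v)))
  ... | no c≢0 = c , c≢0 , u≡cv

  ·≡0-resp-∼ˡ : ∀ {u v} w → u ∼ v → v · w ≡ 0# → u · w ≡ 0#
  ·≡0-resp-∼ˡ {v = v} w (c , _ , refl) v·w≡0 = trans (·-⊙ˡ c v w) (trans (cong (c *_) v·w≡0) (zeroʳ c))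

  ·≡0-resp-∼ʳ : ∀ {u v} w → u ∼ v → w · v ≡ 0# → w · u ≡ 0#
  ·≡0-resp-∼ʳ {v = v} w (c , _ , refl) w·v≡0 = trans (·-⊙ʳ c w v) (trans (cong (c *_) w·v≡0) (zeroʳ c))

  ∼⇒⨯≡𝟎 : ∀ {u v} → u ∼ v → u ⨯ v ≡ 𝟎
  ∼⇒⨯≡𝟎 {v = x , y , z} (c , _ , refl) = ≡-triple (vanish c y z) (vanish c z x) (vanish c x y)
    where
    vanish : ∀ c a b → c * a * b - c * b * a ≡ 0#
    vanish = solve 3 (λ c a b → c :* a :* b :- c :* b :* a := :0) refl

  ⨯≡𝟎⇒∼ : ∀ {u v} → u ⨯ v ≡ 𝟎 → u ≢ 𝟎 → v ≢ 𝟎 → u ∼ v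
  ⨯≡𝟎⇒∼ {a₁ , a₂ , a₃} {b₁ , b₂ , b₃} u⨯v≡𝟎 u≢𝟎 v≢𝟎 with triple-≡ u⨯v≡𝟎
  ... | e₁ , e₂ , e₃ = pivot (b₁ ≟ 0#) (b₂ ≟ 0#) (b₃ ≟ 0#)
    where
    a₂b₃≡a₃b₂ = x-y≡0⇒x≡y e₁
    a₃b₁≡a₁b₃ = x-y≡0⇒x≡y e₂
    a₁b₂≡a₂b₁ = x-y≡0⇒x≡y e₃
    ratio : ∀ {aᵢ bᵢ aⱼ bⱼ} → bᵢ ≢ 0# → aⱼ * bᵢ ≡ aᵢ * bⱼ → aⱼ ≡ aᵢ * bᵢ ⁻¹ * bⱼ
    ratio {aᵢ} {bᵢ} {aⱼ} {bⱼ} bᵢ≢0 aⱼbᵢ≡aᵢbⱼ = begin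
      aⱼ                     ≡⟨ sym (*-identityʳ aⱼ) ⟩
      aⱼ * 1#                ≡⟨ cong (aⱼ *_) (sym (⁻¹-inverseʳ bᵢ≢0)) ⟩
      aⱼ * (bᵢ * bᵢ ⁻¹)      ≡⟨ sym (*-assoc aⱼ bᵢ _) ⟩
      aⱼ * bᵢ * bᵢ ⁻¹        ≡⟨ cong (_* bᵢ ⁻¹) aⱼbᵢ≡aᵢbⱼ ⟩
      aᵢ * bⱼ * bᵢ ⁻¹        ≡⟨ solve 3 (λ a b i → a :* b :* i := a :* i :* b) refl aᵢ bⱼ (bᵢ ⁻¹) ⟩
      aᵢ * bᵢ ⁻¹ * bⱼ        ∎
      where open ≡-Reasoning
    pivot : Dec (b₁ ≡ 0#) → Dec (b₂ ≡ 0#) → Dec (b₃ ≡ 0#) → (a₁ , a₂ , a₃) ∼ (b₁ , b₂ , b₃)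
    pivot (no b₁≢0) _ _ = ∼-byScalar (a₁ * b₁ ⁻¹) u≢𝟎
      (≡-triple (ratio b₁≢0 refl) (ratio b₁≢0 (sym a₁b₂≡a₂b₁)) (ratio b₁≢0 a₃b₁≡a₁b₃))
    pivot (yes _) (no b₂≢0) _ = ∼-byScalar (a₂ * b₂ ⁻¹) u≢𝟎
      (≡-triple (ratio b₂≢0 a₁b₂≡a₂b₁) (ratio b₂≢0 refl) (ratio b₂≢0 (sym a₂b₃≡a₃b₂)))
    pivot (yes _) (yes _) (no b₃≢0) = ∼-byScalar (a₃ * b₃ ⁻¹) u≢𝟎
      (≡-triple (ratio b₃≢0 (sym a₃b₁≡a₁b₃)) (ratio b₃≢0 a₂b₃≡a₃b₂) (ratio b₃≢0 refl))
    pivot (yes refl) (yes refl) (yes refl) = ⊥-elim (v≢𝟎 refl)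

  Normalized⇒≢𝟎 : ∀ {v} → Normalized v → v ≢ 𝟎
  Normalized⇒≢𝟎 (inj₁ 0≡1) refl = 0≢1 0≡1
  Normalized⇒≢𝟎 (inj₂ (inj₁ (_ , 0≡1))) refl = 0≢1 0≡1
  Normalized⇒≢𝟎 (inj₂ (inj₂ (_ , _ , 0≡1))) refl = 0≢1 0≡1

  normalized-∼⇒≡ : ∀ {u v} → Normalized u → Normalized v → u ∼ v → u ≡ v
  normalized-∼⇒≡ {u₁ , u₂ , u₃} {v₁ , v₂ , v₃} nu nv (c , c≢0 , u≡cv) with triple-≡ u≡cv
  ... | e₁ , e₂ , e₃ = by-leading nu nv
    where
    c≡1 : ∀ {uᵢ vᵢ} → uᵢ ≡ c * vᵢ → uᵢ ≡ 1# → vᵢ ≡ 1# → c ≡ 1#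
    c≡1 uᵢ≡cvᵢ uᵢ≡1 vᵢ≡1 = trans (sym (*-identityʳ c)) (trans (cong (c *_) (sym vᵢ≡1)) (trans (sym uᵢ≡cvᵢ) uᵢ≡1))
    zero-pattern : ∀ {uᵢ vᵢ} → uᵢ ≡ c * vᵢ → (uᵢ ≡ 0# → vᵢ ≡ 0#) × (vᵢ ≡ 0# → uᵢ ≡ 0#)
    zero-pattern uᵢ≡cvᵢ = (λ uᵢ≡0 → *-eliminateˡ c≢0 (trans (sym uᵢ≡cvᵢ) uᵢ≡0))
                         , (λ { refl → trans uᵢ≡cvᵢ (zeroʳ c) })
    0≢1′ : ∀ {x} → x ≡ 0# → x ≡ 1# → ∀ {A : Set} → A
    0≢1′ x≡0 x≡1 = ⊥-elim (0≢1 (trans (sym x≡0) x≡1))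
    equal : c ≡ 1# → (u₁ , u₂ , u₃) ≡ (v₁ , v₂ , v₃)
    equal refl = trans u≡cv (⊙-identityˡ _)
    by-leading : Normalized (u₁ , u₂ , u₃) → Normalized (v₁ , v₂ , v₃) → (u₁ , u₂ , u₃) ≡ (v₁ , v₂ , v₃)
    by-leading (inj₁ u₁≡1) (inj₁ v₁≡1) = equal (c≡1 e₁ u₁≡1 v₁≡1)
    by-leading (inj₁ u₁≡1) (inj₂ (inj₁ (v₁≡0 , _))) = 0≢1′ (proj₂ (zero-pattern e₁) v₁≡0) u₁≡1
    by-leading (inj₁ u₁≡1) (inj₂ (inj₂ (v₁≡0 , _))) = 0≢1′ (proj₂ (zero-pattern e₁) v₁≡0) u₁≡1
    by-leading (inj₂ (inj₁ (u₁≡0 , _))) (inj₁ v₁≡1) = 0≢1′ (proj₁ (zero-pattern e₁) u₁≡0) v₁≡1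
    by-leading (inj₂ (inj₁ (_ , u₂≡1))) (inj₂ (inj₁ (_ , v₂≡1))) = equal (c≡1 e₂ u₂≡1 v₂≡1)
    by-leading (inj₂ (inj₁ (_ , u₂≡1))) (inj₂ (inj₂ (_ , v₂≡0 , _))) = 0≢1′ (proj₂ (zero-pattern e₂) v₂≡0) u₂≡1
    by-leading (inj₂ (inj₂ (u₁≡0 , _))) (inj₁ v₁≡1) = 0≢1′ (proj₁ (zero-pattern e₁) u₁≡0) v₁≡1
    by-leading (inj₂ (inj₂ (_ , u₂≡0 , _))) (inj₂ (inj₁ (_ , v₂≡1))) = 0≢1′ (proj₁ (zero-pattern e₂) u₂≡0) v₂≡1
    by-leading (inj₂ (inj₂ (_ , _ , u₃≡1))) (inj₂ (inj₂ (_ , _ , v₃≡1))) = equal (c≡1 e₃ u₃≡1 v₃≡1)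

  normalize : Triple → Triple
  normalize (x , y , z) with x ≟ 0# | y ≟ 0# | z ≟ 0#
  ... | no _ | _ | _ = x ⁻¹ ⊙ (x , y , z)
  ... | yes _ | no _ | _ = y ⁻¹ ⊙ (x , y , z)
  ... | yes _ | yes _ | no _ = z ⁻¹ ⊙ (x , y , z)
  ... | yes _ | yes _ | yes _ = (x , y , z)

  normalize-correct : ∀ v → v ≢ 𝟎 → Normalized (normalize v) × normalize v ∼ v
  normalize-correct (x , y , z) v≢𝟎 with x ≟ 0# | y ≟ 0# | z ≟ 0#
  ... | no x≢0 | _ | _ = inj₁ (⁻¹-inverseˡ x≢0) , x ⁻¹ , ⁻¹≢0 x≢0 , refl
  ... | yes refl | no y≢0 | _ = inj₂ (inj₁ (zeroʳ _ , ⁻¹-inverseˡ y≢0)) , y ⁻¹ , ⁻¹≢0 y≢0 , refl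
  ... | yes refl | yes refl | no z≢0 = inj₂ (inj₂ (zeroʳ _ , zeroʳ _ , ⁻¹-inverseˡ z≢0)) , z ⁻¹ , ⁻¹≢0 z≢0 , refl
  ... | yes refl | yes refl | yes refl = ⊥-elim (v≢𝟎 refl)

  normalize-normalized : ∀ {v} → v ≢ 𝟎 → Normalized (normalize v)
  normalize-normalized v≢𝟎 = proj₁ (normalize-correct _ v≢𝟎)

  normalize-∼ : ∀ {v} → v ≢ 𝟎 → normalize v ∼ v
  normalize-∼ v≢𝟎 = proj₂ (normalize-correct _ v≢𝟎)

  distinct⇒⨯≢𝟎 : ∀ {P Q} → Normalized P → Normalized Q → P ≢ Q → P ⨯ Q ≢ 𝟎
  distinct⇒⨯≢𝟎 nP nQ P≢Q P⨯Q≡𝟎 =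
    P≢Q (normalized-∼⇒≡ nP nQ (⨯≡𝟎⇒∼ P⨯Q≡𝟎 (Normalized⇒≢𝟎 nP) (Normalized⇒≢𝟎 nQ)))

  meet-unique : ∀ {X Y a b} → Normalized X → Normalized Y → Normalized a → Normalized b → a ≢ b →
    X I a → X I b → Y I a → Y I b → X ≡ Y
  meet-unique {X} {Y} {a} {b} nX nY na nb a≢b Xa Xb Ya Yb =
    normalized-∼⇒≡ nX nY (∼-trans (on-both nX Xa Xb) (∼-sym (on-both nY Ya Yb)))
    where
    on-both : ∀ {Z} → Normalized Z → Z I a → Z I b → Z ∼ a ⨯ b
    on-both {Z} nZ Za Zb = ⨯≡𝟎⇒∼ (⊥⊥⇒⨯≡𝟎 Z a b Za Zb) (Normalized⇒≢𝟎 nZ) (distinct⇒⨯≢𝟎 na nb a≢b)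

  join-unique : ∀ {P Q a b} → Normalized P → Normalized Q → Normalized a → Normalized b → P ≢ Q →
    P I a → Q I a → P I b → Q I b → a ≡ b
  join-unique {P} {Q} {a} {b} nP nQ na nb P≢Q Pa Qa Pb Qb = meet-unique na nb nP nQ P≢Q
    (trans (·-comm a P) Pa) (trans (·-comm a Q) Qa) (trans (·-comm b P) Pb) (trans (·-comm b Q) Qb)

  det-cyclic : ∀ P Q R → det P Q R ≡ det Q R P
  det-cyclic (p₁ , p₂ , p₃) (q₁ , q₂ , q₃) (r₁ , r₂ , r₃) = solve 9 (λ p₁ p₂ p₃ q₁ q₂ q₃ r₁ r₂ r₃ →
    (p₂ :* q₃ :- p₃ :* q₂) :* r₁ :+ (p₃ :* q₁ :- p₁ :* q₃) :* r₂ :+ (p₁ :* q₂ :- p₂ :* q₁) :* r₃ :=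
    (q₂ :* r₃ :- q₃ :* r₂) :* p₁ :+ (q₃ :* r₁ :- q₁ :* r₃) :* p₂ :+ (q₁ :* r₂ :- q₂ :* r₁) :* p₃)
    refl p₁ p₂ p₃ q₁ q₂ q₃ r₁ r₂ r₃

  det-alternating : ∀ P Q → det P Q P ≡ 0#
  det-alternating (p₁ , p₂ , p₃) (q₁ , q₂ , q₃) = solve 6 (λ p₁ p₂ p₃ q₁ q₂ q₃ →
    (p₂ :* q₃ :- p₃ :* q₂) :* p₁ :+ (p₃ :* q₁ :- p₁ :* q₃) :* p₂ :+ (p₁ :* q₂ :- p₂ :* q₁) :* p₃ := :0)
    refl p₁ p₂ p₃ q₁ q₂ q₃

  det-alternating₂₃ : ∀ P Q → det P Q Q ≡ 0#
  det-alternating₂₃ P Q = trans (det-cyclic P Q Q) (trans (det-cyclic Q Q P) (det-alternating Q P))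

  det-alternating₁₂ : ∀ P R → det P P R ≡ 0#
  det-alternating₁₂ P R = trans (det-cyclic P P R) (det-alternating P R)

  cramer-identity : ∀ P Q X W → det P Q W ⊙ X ≡ det X Q W ⊙ P ⊕ det P X W ⊙ Q ⊕ det P Q X ⊙ W
  cramer-identity (p₁ , p₂ , p₃) (q₁ , q₂ , q₃) (x₁ , x₂ , x₃) (w₁ , w₂ , w₃) = ≡-triple
    (solve 12 (λ p₁ p₂ p₃ q₁ q₂ q₃ x₁ x₂ x₃ w₁ w₂ w₃ →
      D p₁ p₂ p₃ q₁ q₂ q₃ w₁ w₂ w₃ :* x₁ := D x₁ x₂ x₃ q₁ q₂ q₃ w₁ w₂ w₃ :* p₁
        :+ D p₁ p₂ p₃ x₁ x₂ x₃ w₁ w₂ w₃ :* q₁ :+ D p₁ p₂ p₃ q₁ q₂ q₃ x₁ x₂ x₃ :* w₁)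
      refl p₁ p₂ p₃ q₁ q₂ q₃ x₁ x₂ x₃ w₁ w₂ w₃)
    (solve 12 (λ p₁ p₂ p₃ q₁ q₂ q₃ x₁ x₂ x₃ w₁ w₂ w₃ →
      D p₁ p₂ p₃ q₁ q₂ q₃ w₁ w₂ w₃ :* x₂ := D x₁ x₂ x₃ q₁ q₂ q₃ w₁ w₂ w₃ :* p₂
        :+ D p₁ p₂ p₃ x₁ x₂ x₃ w₁ w₂ w₃ :* q₂ :+ D p₁ p₂ p₃ q₁ q₂ q₃ x₁ x₂ x₃ :* w₂)
      refl p₁ p₂ p₃ q₁ q₂ q₃ x₁ x₂ x₃ w₁ w₂ w₃)
    (solve 12 (λ p₁ p₂ p₃ q₁ q₂ q₃ x₁ x₂ x₃ w₁ w₂ w₃ →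
      D p₁ p₂ p₃ q₁ q₂ q₃ w₁ w₂ w₃ :* x₃ := D x₁ x₂ x₃ q₁ q₂ q₃ w₁ w₂ w₃ :* p₃
        :+ D p₁ p₂ p₃ x₁ x₂ x₃ w₁ w₂ w₃ :* q₃ :+ D p₁ p₂ p₃ q₁ q₂ q₃ x₁ x₂ x₃ :* w₃)
      refl p₁ p₂ p₃ q₁ q₂ q₃ x₁ x₂ x₃ w₁ w₂ w₃)
    where
    D : ∀ {n} → _ → _ → _ → _ → _ → _ → _ → _ → _ → Polynomial n
    D a₁ a₂ a₃ b₁ b₂ b₃ c₁ c₂ c₃ =
      (a₂ :* b₃ :- a₃ :* b₂) :* c₁ :+ (a₃ :* b₁ :- a₁ :* b₃) :* c₂ :+ (a₁ :* b₂ :- a₂ :* b₁) :* c₃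

  ·-nondegenerate : ∀ n → n ≢ 𝟎 → ∃ λ W → W · n ≢ 0#
  ·-nondegenerate (n₁ , n₂ , n₃) n≢𝟎 with n₁ ≟ 0# | n₂ ≟ 0# | n₃ ≟ 0#
  ... | no n₁≢0 | _ | _ = (1# , 0# , 0#) , λ e →
    n₁≢0 (trans (solve 3 (λ a b c → a := a :* :1 :+ b :* :0 :+ c :* :0) refl n₁ n₂ n₃) e)
  ... | yes _ | no n₂≢0 | _ = (0# , 1# , 0#) , λ e →
    n₂≢0 (trans (solve 3 (λ a b c → b := a :* :0 :+ b :* :1 :+ c :* :0) refl n₁ n₂ n₃) e)
  ... | yes _ | yes _ | no n₃≢0 = (0# , 0# , 1#) , λ e →
    n₃≢0 (trans (solve 3 (λ a b c → c := a :* :0 :+ b :* :0 :+ c :* :1) refl n₁ n₂ n₃) e)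
  ... | yes refl | yes refl | yes refl = ⊥-elim (n≢𝟎 refl)

  cramer : ∀ P Q X → det P Q X ≡ 0# → P ⨯ Q ≢ 𝟎 → ∃₂ λ α β → X ≡ α ⊙ P ⊕ β ⊙ Q
  cramer P Q X det≡0 P⨯Q≢𝟎 with ·-nondegenerate (P ⨯ Q) P⨯Q≢𝟎
  ... | W , d≢0 = d ⁻¹ * det X Q W , d ⁻¹ * det P X W , (begin
    X                                                    ≡⟨ sym (⊙-identityˡ X) ⟩
    1# ⊙ X                                               ≡⟨ cong (_⊙ X) (sym (⁻¹-inverseˡ d≢0)) ⟩
    (d ⁻¹ * d) ⊙ X                                       ≡⟨ sym (⊙-assoc (d ⁻¹) d X) ⟩
    d ⁻¹ ⊙ d ⊙ X                                         ≡⟨ cong (d ⁻¹ ⊙_) (cramer-identity P Q X W) ⟩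
    d ⁻¹ ⊙ (det X Q W ⊙ P ⊕ det P X W ⊙ Q ⊕ det P Q X ⊙ W)
      ≡⟨ cong (λ c → d ⁻¹ ⊙ (det X Q W ⊙ P ⊕ det P X W ⊙ Q ⊕ c ⊙ W)) det≡0 ⟩
    d ⁻¹ ⊙ (det X Q W ⊙ P ⊕ det P X W ⊙ Q ⊕ 0# ⊙ W)      ≡⟨ rescale (d ⁻¹) (det X Q W) (det P X W) P Q W ⟩
    (d ⁻¹ * det X Q W) ⊙ P ⊕ (d ⁻¹ * det P X W) ⊙ Q      ∎)
    where
    open ≡-Reasoning
    d = det P Q W
    rescale : ∀ i a b P Q W → i ⊙ (a ⊙ P ⊕ b ⊙ Q ⊕ 0# ⊙ W) ≡ (i * a) ⊙ P ⊕ (i * b) ⊙ Q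
    rescale i a b (p₁ , p₂ , p₃) (q₁ , q₂ , q₃) (w₁ , w₂ , w₃) =
      ≡-triple (coordinate p₁ q₁ w₁) (coordinate p₂ q₂ w₂) (coordinate p₃ q₃ w₃)
      where
      coordinate : ∀ p q w → i * (a * p + b * q + 0# * w) ≡ i * a * p + i * b * q
      coordinate = solve 6 (λ i a b p q w → i :* (a :* p :+ b :* q :+ :0 :* w) := i :* a :* p :+ i :* b :* q) refl i a b

  allTriples-complete : ∀ t → t ∈ allTriples
  allTriples-complete (x , y , z) = ∈-cube⁺ (elements-complete x) (elements-complete y) (elements-complete z)

  points-complete : ∀ {v} → Normalized v → v ∈ points
  points-complete {v} = ∈-filter⁺ normalized? (allTriples-complete v)

  ∈points⇒Normalized : ∀ {v} → v ∈ points → Normalized v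
  ∈points⇒Normalized v∈ = proj₂ (∈-filter⁻ normalized? {xs = allTriples} v∈)

  points-unique : Unique points
  points-unique = filter⁺ normalized? (cube-unique elements-unique)

  secants-unique : Unique secants
  secants-unique = filter⁺ (λ ℓ → length (filter (λ X → X I? ℓ) unital) ℕ.≟ suc q) points-unique

  ∈secants⇒Normalized : ∀ {ℓ} → ℓ ∈ secants → Normalized ℓ
  ∈secants⇒Normalized ℓ∈ = ∈points⇒Normalized
    (proj₁ (∈-filter⁻ (λ ℓ → length (filter (λ X → X I? ℓ) unital) ℕ.≟ suc q) {xs = points} ℓ∈))

  lineThrough : Triple → Triple → Triple
  lineThrough P Q = normalize (P ⨯ Q)

  module _ {P Q : Triple} (nP : Normalized P) (nQ : Normalized Q) (P≢Q : P ≢ Q) where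

    lineThrough-normalized : Normalized (lineThrough P Q)
    lineThrough-normalized = normalize-normalized (distinct⇒⨯≢𝟎 nP nQ P≢Q)

    I-lineThrough⁺ : ∀ R → det P Q R ≡ 0# → R I lineThrough P Q
    I-lineThrough⁺ R = ·≡0-resp-∼ʳ R (normalize-∼ (distinct⇒⨯≢𝟎 nP nQ P≢Q))

    I-lineThrough⁻ : ∀ R → R I lineThrough P Q → det P Q R ≡ 0#
    I-lineThrough⁻ R = ·≡0-resp-∼ʳ R (∼-sym (normalize-∼ (distinct⇒⨯≢𝟎 nP nQ P≢Q)))

    I-lineThroughˡ : P I lineThrough P Q
    I-lineThroughˡ = I-lineThrough⁺ P (det-alternating P Q)

    I-lineThroughʳ : Q I lineThrough P Q
    I-lineThroughʳ = I-lineThrough⁺ Q (det-alternating₂₃ P Q)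

  ⨯-shear : ∀ P Q t → (P ⊕ t ⊙ Q) ⨯ Q ≡ P ⨯ Q
  ⨯-shear (p₁ , p₂ , p₃) (q₁ , q₂ , q₃) t =
    ≡-triple (coordinate p₂ p₃ q₂ q₃) (coordinate p₃ p₁ q₃ q₁) (coordinate p₁ p₂ q₁ q₂)
    where
    coordinate : ∀ a b c d → (a + t * c) * d - (b + t * d) * c ≡ a * d - b * c
    coordinate a b c d = solve 5 (λ a b c d t → (a :+ t :* c) :* d :- (b :+ t :* d) :* c := a :* d :- b :* c) refl a b c d t

  ⨯-pencil : ∀ P Q t t′ → (P ⊕ t ⊙ Q) ⨯ (P ⊕ t′ ⊙ Q) ≡ (t′ - t) ⊙ (P ⨯ Q)
  ⨯-pencil (p₁ , p₂ , p₃) (q₁ , q₂ , q₃) t t′ =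
    ≡-triple (coordinate p₂ p₃ q₂ q₃) (coordinate p₃ p₁ q₃ q₁) (coordinate p₁ p₂ q₁ q₂)
    where
    coordinate : ∀ a b c d → (a + t * c) * (b + t′ * d) - (b + t * d) * (a + t′ * c) ≡ (t′ - t) * (a * d - b * c)
    coordinate a b c d = solve 6 (λ a b c d t t′ →
      (a :+ t :* c) :* (b :+ t′ :* d) :- (b :+ t :* d) :* (a :+ t′ :* c) := (t′ :- t) :* (a :* d :- b :* c))
      refl a b c d t t′

  det-pencil : ∀ P Q t → det P Q (P ⊕ t ⊙ Q) ≡ 0#
  det-pencil (p₁ , p₂ , p₃) (q₁ , q₂ , q₃) t = solve 7 (λ p₁ p₂ p₃ q₁ q₂ q₃ t →
    (p₂ :* q₃ :- p₃ :* q₂) :* (p₁ :+ t :* q₁) :+ (p₃ :* q₁ :- p₁ :* q₃) :* (p₂ :+ t :* q₂)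
      :+ (p₁ :* q₂ :- p₂ :* q₁) :* (p₃ :+ t :* q₃) := :0)
    refl p₁ p₂ p₃ q₁ q₂ q₃ t

  ⊕-identityˡ : ∀ v → 𝟎 ⊕ v ≡ v
  ⊕-identityˡ (x , y , z) = ≡-triple (+-identityˡ x) (+-identityˡ y) (+-identityˡ z)

  ⊙⊕⊙-factor : ∀ {α} β P Q → α ≢ 0# → α ⊙ P ⊕ β ⊙ Q ≡ α ⊙ (P ⊕ (α ⁻¹ * β) ⊙ Q)
  ⊙⊕⊙-factor {α} β (p₁ , p₂ , p₃) (q₁ , q₂ , q₃) α≢0 =
    ≡-triple (coordinate p₁ q₁) (coordinate p₂ q₂) (coordinate p₃ q₃)
    where
    α*α⁻¹β≡β : α * (α ⁻¹ * β) ≡ β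
    α*α⁻¹β≡β = trans (sym (*-assoc α _ β)) (trans (cong (_* β) (⁻¹-inverseʳ α≢0)) (*-identityˡ β))
    coordinate : ∀ p q → α * p + β * q ≡ α * (p + α ⁻¹ * β * q)
    coordinate p q = begin
      α * p + β * q                        ≡⟨ cong (λ b → α * p + b * q) (sym α*α⁻¹β≡β) ⟩
      α * p + α * (α ⁻¹ * β) * q           ≡⟨ solve 4 (λ a p c q → a :* p :+ a :* c :* q := a :* (p :+ c :* q)) refl α p (α ⁻¹ * β) q ⟩
      α * (p + α ⁻¹ * β * q)               ∎
      where open ≡-Reasoning

  module _ {P Q : Triple} (P⨯Q≢𝟎 : P ⨯ Q ≢ 𝟎) where

    pencil≢𝟎 : ∀ t → P ⊕ t ⊙ Q ≢ 𝟎
    pencil≢𝟎 t P+tQ≡𝟎 = P⨯Q≢𝟎 (begin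
      P ⨯ Q                ≡⟨ sym (⨯-shear P Q t) ⟩
      (P ⊕ t ⊙ Q) ⨯ Q      ≡⟨ cong (_⨯ Q) P+tQ≡𝟎 ⟩
      𝟎 ⨯ Q                ≡⟨ 𝟎⨯ Q ⟩
      𝟎                    ∎)
      where
      open ≡-Reasoning
      𝟎⨯ : ∀ Q → 𝟎 ⨯ Q ≡ 𝟎
      𝟎⨯ (a , b , c) = ≡-triple (vanish b c) (vanish c a) (vanish a b)
        where
        vanish : ∀ x y → 0# * y - 0# * x ≡ 0#
        vanish = solve 2 (λ x y → :0 :* y :- :0 :* x := :0) refl

    pencil≁end : ∀ t → P ⊕ t ⊙ Q ∼ Q → ⊥
    pencil≁end t P+tQ∼Q = P⨯Q≢𝟎 (trans (sym (⨯-shear P Q t)) (∼⇒⨯≡𝟎 P+tQ∼Q))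

    pencil-injective : ∀ {t t′} → P ⊕ t ⊙ Q ∼ P ⊕ t′ ⊙ Q → t ≡ t′
    pencil-injective {t} {t′} ∼′ = sym (x-y≡0⇒x≡y (⊙≡𝟎 (trans (sym (⨯-pencil P Q t t′)) (∼⇒⨯≡𝟎 ∼′)) P⨯Q≢𝟎))

    combination⇒pencil : ∀ {R α β} → R ≢ 𝟎 → ¬ R ∼ Q → R ≡ α ⊙ P ⊕ β ⊙ Q → ∃ λ t → R ∼ P ⊕ t ⊙ Q
    combination⇒pencil {R} {α} {β} R≢𝟎 R≁Q R≡αP+βQ with α ≟ 0#
    ... | no α≢0 = α ⁻¹ * β , α , α≢0 , trans R≡αP+βQ (⊙⊕⊙-factor β P Q α≢0)
    ... | yes refl = ⊥-elim (R≁Q (∼-byScalar β R≢𝟎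
      (trans R≡αP+βQ (trans (cong (_⊕ β ⊙ Q) (⊙-zeroˡ P)) (⊕-identityˡ (β ⊙ Q))))))


    pencil-complete : ∀ {R} → det P Q R ≡ 0# → R ≢ 𝟎 → ¬ R ∼ Q → ∃ λ t → R ∼ P ⊕ t ⊙ Q
    pencil-complete {R} det≡0 R≢𝟎 R≁Q = combination⇒pencil R≢𝟎 R≁Q (proj₂ (proj₂ (cramer P Q R det≡0 P⨯Q≢𝟎)))

module HermitianUnital (F : FiniteField) {q p k : ℕ} (p-prime : Prime p) (1≤k : 1 ≤ k)
  (q≡pᵏ : q ≡ p ℕ.^ k) (|F|≡q² : length (FiniteField.elements F) ≡ q ℕ.^ 2) where

  open FieldProperties F
  open QuadraticExtension F p-prime 1≤k q≡pᵏ |F|≡q²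
  open PlaneGeometry F q
  open Geometry F q
    using ( Triple; _≟T_; Normalized; normalized?; _^F_; InU; inU?; unital; points; allTriples; secants
          ; _I_; _I?_; Adjacent; IsTriangle; isTriangle?; triangles )

  H : Triple → Carrier
  H (x , y , z) = N x + N y + N z

  InU≡[H≡0] : ∀ v → InU v ≡ (H v ≡ 0#)
  InU≡[H≡0] (x , y , z) = cong (_≡ 0#) (cong₂ _+_ (cong₂ _+_ (^F≗^ x (suc q)) (^F≗^ y (suc q))) (^F≗^ z (suc q)))
    where
    ^F≗^ : ∀ x n → x ^F n ≡ x ^ n
    ^F≗^ x zero = refl
    ^F≗^ x (suc n) = cong (x *_) (^F≗^ x n)

  unital-complete : ∀ {v} → Normalized v → H v ≡ 0# → v ∈ unital
  unital-complete {v} nv Hv≡0 = ∈-filter⁺ inU? (points-complete nv) (subst (λ A → A) (sym (InU≡[H≡0] v)) Hv≡0)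

  ∈unital⇒ : ∀ {v} → v ∈ unital → Normalized v × H v ≡ 0#
  ∈unital⇒ {v} v∈ with ∈-filter⁻ inU? {xs = points} v∈
  ... | v∈points , inU = ∈points⇒Normalized v∈points , subst (λ A → A) (InU≡[H≡0] v) inU

  unital⊆points : ∀ {v} → v ∈ unital → v ∈ points
  unital⊆points v∈ = proj₁ (∈-filter⁻ inU? {xs = points} v∈)

  unital-unique : Unique unital
  unital-unique = filter⁺ inU? points-unique

  private
    w : Triple → ℕ
    w t = 𝟙 (normalized? t) ℕ.* 𝟙 (inU? t)

    N-fibre : Carrier → ℕ
    N-fibre c = length (filter (λ z → N z ≟ c) elements)

    ∑z-inU : ∀ x y → ∑[ z ∈ elements ] 𝟙 (inU? (x , y , z)) ≡ N-fibre (- (N x + N y))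
    ∑z-inU x y = trans (∑-cong elements (λ z _ → 𝟙-cong (inU? (x , y , z)) (N z ≟ - (N x + N y)) to from))
      (sym (length-filter≡∑𝟙 (λ z → N z ≟ - (N x + N y)) elements))
      where
      to : ∀ {z} → InU (x , y , z) → N z ≡ - (N x + N y)
      to {z} inU = begin
        N z                           ≡⟨ solve 2 (λ a b → b := :- a :+ (a :+ b)) refl (N x + N y) (N z) ⟩
        - (N x + N y) + H (x , y , z) ≡⟨ cong (- (N x + N y) +_) (subst (λ A → A) (InU≡[H≡0] (x , y , z)) inU) ⟩
        - (N x + N y) + 0#            ≡⟨ +-identityʳ _ ⟩
        - (N x + N y)                 ∎
        where open ≡-Reasoning
      from : ∀ {z} → N z ≡ - (N x + N y) → InU (x , y , z)
      from {z} Nz≡ = subst (λ A → A) (sym (InU≡[H≡0] (x , y , z)))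
        (trans (cong (N x + N y +_) Nz≡) (-‿inverseʳ (N x + N y)))

    σ-fixes-−[N+N] : ∀ x y → σ (- (N x + N y)) ≡ - (N x + N y)
    σ-fixes-−[N+N] x y = trans (σ-neg _) (cong -_ (trans (σ-+ (N x) (N y)) (cong₂ _+_ (σ-N x) (σ-N y))))

    N1≡1 : N 1# ≡ 1#
    N1≡1 = 1^n≡1 (suc q)

    N0≡0 : N 0# ≡ 0#
    N0≡0 = zeroˡ _

    affine-row : ∀ y → N-fibre (- (N 1# + N y)) ℕ.+ q ℕ.* 𝟙 (N y ≟ - 1#) ≡ suc q
    affine-row y with N y ≟ - 1#
    ... | yes Ny≡-1 = trans (cong₂ ℕ._+_ (trans (cong N-fibre c≡0) |N⁻¹0|≡1) (ℕ.*-identityʳ q)) refl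
      where
      c≡0 : - (N 1# + N y) ≡ 0#
      c≡0 = trans (cong (λ a → - (a + N y)) N1≡1) (trans (cong (λ a → - (1# + a)) Ny≡-1)
        (trans (cong -_ (-‿inverseʳ 1#)) -0#≈0#))
    ... | no Ny≢-1 = trans (cong₂ ℕ._+_ (|N⁻¹|≡q+1 _ (σ-fixes-−[N+N] 1# y) c≢0) (ℕ.*-zeroʳ q)) (ℕ.+-identityʳ _)
      where
      c≢0 : - (N 1# + N y) ≢ 0#
      c≢0 c≡0 = Ny≢-1 (begin
        N y                   ≡⟨ solve 2 (λ a b → b := :- a :+ :- (:- (a :+ b))) refl (N 1#) (N y) ⟩
        - N 1# + - (- (N 1# + N y)) ≡⟨ cong₂ (λ a b → - a + - b) N1≡1 c≡0 ⟩
        - 1# + - 0#           ≡⟨ cong (- 1# +_) -0#≈0# ⟩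
        - 1# + 0#             ≡⟨ +-identityʳ _ ⟩
        - 1#                  ∎)
        where open ≡-Reasoning

    |N⁻¹[-1]|≡q+1 : N-fibre (- 1#) ≡ suc q
    |N⁻¹[-1]|≡q+1 = |N⁻¹|≡q+1 (- 1#) (trans (σ-neg 1#) (cong -_ σ-1)) (-≢0 1≢0)

    w-leading1 : ∀ {t} → Normalized t → w t ≡ 𝟙 (inU? t)
    w-leading1 {t} n = trans (cong (ℕ._* 𝟙 (inU? t)) (𝟙-yes (normalized? t) n)) (ℕ.+-identityʳ _)

    w-unnormalized : ∀ {t} → ¬ Normalized t → w t ≡ 0
    w-unnormalized {t} ¬n = cong (ℕ._* 𝟙 (inU? t)) (𝟙-no (normalized? t) ¬n)

    affine-part : ∑[ y ∈ elements ] ∑[ z ∈ elements ] w (1# , y , z) ℕ.+ q ℕ.* suc q ≡ length elements ℕ.* suc q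
    affine-part = begin
      ∑[ y ∈ elements ] ∑[ z ∈ elements ] w (1# , y , z) ℕ.+ q ℕ.* suc q
        ≡⟨ cong₂ ℕ._+_ (∑-cong elements (λ y _ → trans (∑-cong elements (λ z _ → w-leading1 (inj₁ refl))) (∑z-inU 1# y)))
                        (cong (q ℕ.*_) (trans (sym |N⁻¹[-1]|≡q+1) (length-filter≡∑𝟙 (λ y → N y ≟ - 1#) elements))) ⟩
      ∑[ y ∈ elements ] N-fibre (- (N 1# + N y)) ℕ.+ q ℕ.* ∑[ y ∈ elements ] 𝟙 (N y ≟ - 1#)
        ≡⟨ cong (∑[ y ∈ elements ] N-fibre (- (N 1# + N y)) ℕ.+_) (sym (∑-*ˡ elements q _)) ⟩
      ∑[ y ∈ elements ] N-fibre (- (N 1# + N y)) ℕ.+ ∑[ y ∈ elements ] (q ℕ.* 𝟙 (N y ≟ - 1#))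
        ≡⟨ sym (∑-+ elements _ _) ⟩
      ∑[ y ∈ elements ] (N-fibre (- (N 1# + N y)) ℕ.+ q ℕ.* 𝟙 (N y ≟ - 1#))
        ≡⟨ ∑-cong elements (λ y _ → affine-row y) ⟩
      ∑[ y ∈ elements ] suc q
        ≡⟨ ∑-const elements (suc q) ⟩
      length elements ℕ.* suc q ∎
      where open ≡-Reasoning

    infinite-part : ∑[ y ∈ elements ] ∑[ z ∈ elements ] w (0# , y , z) ≡ suc q
    infinite-part = begin
      ∑[ y ∈ elements ] ∑[ z ∈ elements ] w (0# , y , z)
        ≡⟨ ∑-twoPoints _≟_ elements _ elements-unique (elements-complete 1#) (elements-complete 0#) 1≢0 off-axis ⟩
      ∑[ z ∈ elements ] w (0# , 1# , z) ℕ.+ ∑[ z ∈ elements ] w (0# , 0# , z)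
        ≡⟨ cong₂ ℕ._+_ (∑-cong elements (λ z _ → w-leading1 (inj₂ (inj₁ (refl , refl)))))
                        (∑-zero elements _ (λ z _ → w-00z z (z ≟ 1#))) ⟩
      ∑[ z ∈ elements ] 𝟙 (inU? (0# , 1# , z)) ℕ.+ 0
        ≡⟨ trans (ℕ.+-identityʳ _) (∑z-inU 0# 1#) ⟩
      N-fibre (- (N 0# + N 1#))
        ≡⟨ cong (λ a → N-fibre (- a)) (trans (cong₂ _+_ N0≡0 N1≡1) (+-identityˡ 1#)) ⟩
      N-fibre (- 1#)
        ≡⟨ |N⁻¹[-1]|≡q+1 ⟩
      suc q ∎
      where
      open ≡-Reasoning
      off-axis : ∀ y → y ≢ 1# → y ≢ 0# → ∑[ z ∈ elements ] w (0# , y , z) ≡ 0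
      off-axis y y≢1 y≢0 = ∑-zero elements _ (λ z _ → w-unnormalized
        λ { (inj₁ 0≡1) → 0≢1 0≡1 ; (inj₂ (inj₁ (_ , y≡1))) → y≢1 y≡1 ; (inj₂ (inj₂ (_ , y≡0 , _))) → y≢0 y≡0 })
      w-00z : ∀ z → Dec (z ≡ 1#) → w (0# , 0# , z) ≡ 0
      w-00z z (yes refl) = trans (w-leading1 (inj₂ (inj₂ (refl , refl , refl))))
        (𝟙-no (inU? _) (λ inU → 1≢0 (trans (sym H001≡1) (subst (λ A → A) (InU≡[H≡0] _) inU))))
        where
        H001≡1 : H (0# , 0# , 1#) ≡ 1#
        H001≡1 = trans (cong₂ _+_ (trans (cong₂ _+_ N0≡0 N0≡0) (+-identityˡ 0#)) N1≡1) (+-identityˡ 1#)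
      w-00z z (no z≢1) = w-unnormalized
        λ { (inj₁ 0≡1) → 0≢1 0≡1 ; (inj₂ (inj₁ (_ , 0≡1))) → 0≢1 0≡1 ; (inj₂ (inj₂ (_ , _ , z≡1))) → z≢1 z≡1 }

  |unital|≡q³+1 : length unital ≡ suc (q ℕ.* (q ℕ.* q))
  |unital|≡q³+1 = ℕ.+-cancelʳ-≡ (q ℕ.* suc q) _ _ (begin
    length unital ℕ.+ q ℕ.* suc q
      ≡⟨ cong (ℕ._+ q ℕ.* suc q) |unital|≡A₁+A₀ ⟩
    A₁ ℕ.+ A₀ ℕ.+ q ℕ.* suc q
      ≡⟨ swap-+ A₁ A₀ (q ℕ.* suc q) ⟩
    (A₁ ℕ.+ q ℕ.* suc q) ℕ.+ A₀
      ≡⟨ cong₂ ℕ._+_ (trans affine-part (cong (ℕ._* suc q) |F|≡q*q)) infinite-part ⟩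
    q ℕ.* q ℕ.* suc q ℕ.+ suc q
      ≡⟨ cube+1 q ⟩
    suc (q ℕ.* (q ℕ.* q)) ℕ.+ q ℕ.* suc q ∎)
    where
    open ≡-Reasoning
    A₁ = ∑[ y ∈ elements ] ∑[ z ∈ elements ] w (1# , y , z)
    A₀ = ∑[ y ∈ elements ] ∑[ z ∈ elements ] w (0# , y , z)
    swap-+ : ∀ a b c → a ℕ.+ b ℕ.+ c ≡ (a ℕ.+ c) ℕ.+ b
    swap-+ = solve-∀
    cube+1 : ∀ q → q ℕ.* q ℕ.* suc q ℕ.+ suc q ≡ suc (q ℕ.* (q ℕ.* q)) ℕ.+ q ℕ.* suc q
    cube+1 = solve-∀
    |unital|≡A₁+A₀ : length unital ≡ A₁ ℕ.+ A₀
    |unital|≡A₁+A₀ = begin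
      length (filter inU? (filter normalized? allTriples))
        ≡⟨ length-filter≡∑𝟙 inU? (filter normalized? allTriples) ⟩
      ∑[ t ∈ filter normalized? allTriples ] 𝟙 (inU? t)
        ≡⟨ ∑-filter normalized? allTriples _ ⟩
      ∑ allTriples w
        ≡⟨ ∑-cube elements w ⟩
      ∑[ x ∈ elements ] ∑[ y ∈ elements ] ∑[ z ∈ elements ] w (x , y , z)
        ≡⟨ ∑-twoPoints _≟_ elements _ elements-unique (elements-complete 1#) (elements-complete 0#) 1≢0 off-plane ⟩
      A₁ ℕ.+ A₀ ∎
      where
      off-plane : ∀ x → x ≢ 1# → x ≢ 0# → ∑[ y ∈ elements ] ∑[ z ∈ elements ] w (x , y , z) ≡ 0
      off-plane x x≢1 x≢0 = ∑-zero elements _ (λ y _ → ∑-zero elements _ (λ z _ → w-unnormalized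
        λ { (inj₁ x≡1) → x≢1 x≡1 ; (inj₂ (inj₁ (x≡0 , _))) → x≢0 x≡0 ; (inj₂ (inj₂ (x≡0 , _))) → x≢0 x≡0 }))

  conj : Triple → Triple
  conj (x , y , z) = σ x , σ y , σ z

  conj-involutive : ∀ v → conj (conj v) ≡ v
  conj-involutive (x , y , z) = ≡-triple (σ-involutive x) (σ-involutive y) (σ-involutive z)

  conj-⊕ : ∀ u v → conj (u ⊕ v) ≡ conj u ⊕ conj v
  conj-⊕ (x₁ , x₂ , x₃) (y₁ , y₂ , y₃) = ≡-triple (σ-+ x₁ y₁) (σ-+ x₂ y₂) (σ-+ x₃ y₃)

  conj-⊙ : ∀ c v → conj (c ⊙ v) ≡ σ c ⊙ conj v
  conj-⊙ c (x , y , z) = ≡-triple (σ-* c x) (σ-* c y) (σ-* c z)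

  conj≢𝟎 : ∀ {v} → v ≢ 𝟎 → conj v ≢ 𝟎
  conj≢𝟎 {x , y , z} v≢𝟎 conj≡𝟎 with triple-≡ conj≡𝟎
  ... | σx≡0 , σy≡0 , σz≡0 = v≢𝟎 (≡-triple (σ≡0⇒≡0 σx≡0) (σ≡0⇒≡0 σy≡0) (σ≡0⇒≡0 σz≡0))

  conj-∼ : ∀ {u v} → u ∼ v → conj u ∼ conj v
  conj-∼ {v = v} (c , c≢0 , refl) = σ c , (λ σc≡0 → c≢0 (σ≡0⇒≡0 σc≡0)) , conj-⊙ c v

  σ-· : ∀ u v → σ (u · v) ≡ conj u · conj v
  σ-· (x , y , z) (a , b , c) = begin
    σ (a * x + b * y + c * z)                    ≡⟨ σ-+ _ _ ⟩
    σ (a * x + b * y) + σ (c * z)                ≡⟨ cong₂ _+_ (σ-+ _ _) (σ-* c z) ⟩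
    σ (a * x) + σ (b * y) + σ c * σ z            ≡⟨ cong₂ (λ u v → u + v + σ c * σ z) (σ-* a x) (σ-* b y) ⟩
    σ a * σ x + σ b * σ y + σ c * σ z            ∎
    where open ≡-Reasoning

  ·-⊕ˡ : ∀ u v w → (u ⊕ v) · w ≡ u · w + v · w
  ·-⊕ˡ (u₁ , u₂ , u₃) (v₁ , v₂ , v₃) (w₁ , w₂ , w₃) = solve 9 (λ u₁ u₂ u₃ v₁ v₂ v₃ w₁ w₂ w₃ →
    w₁ :* (u₁ :+ v₁) :+ w₂ :* (u₂ :+ v₂) :+ w₃ :* (u₃ :+ v₃)
      := (w₁ :* u₁ :+ w₂ :* u₂ :+ w₃ :* u₃) :+ (w₁ :* v₁ :+ w₂ :* v₂ :+ w₃ :* v₃))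
    refl u₁ u₂ u₃ v₁ v₂ v₃ w₁ w₂ w₃

  ·-⊕ʳ : ∀ u v w → u · (v ⊕ w) ≡ u · v + u · w
  ·-⊕ʳ u v w = trans (·-comm u (v ⊕ w)) (trans (·-⊕ˡ v w u) (cong₂ _+_ (·-comm v u) (·-comm w u)))

  h : Triple → Triple → Carrier
  h u v = u · conj v

  h-diag : ∀ v → h v v ≡ H v
  h-diag (x , y , z) = solve 6 (λ x y z a b c → a :* x :+ b :* y :+ c :* z := x :* a :+ y :* b :+ z :* c)
    refl x y z (σ x) (σ y) (σ z)

  h-conj : ∀ u v → h u v ≡ σ (h v u)
  h-conj u v = sym (begin
    σ (v · conj u)               ≡⟨ σ-· v (conj u) ⟩
    conj v · conj (conj u)       ≡⟨ cong (conj v ·_) (conj-involutive u) ⟩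
    conj v · u                   ≡⟨ ·-comm (conj v) u ⟩
    u · conj v                   ∎)
    where open ≡-Reasoning

  H-⊙ : ∀ c v → H (c ⊙ v) ≡ N c * H v
  H-⊙ c v = begin
    H (c ⊙ v)                    ≡⟨ sym (h-diag (c ⊙ v)) ⟩
    (c ⊙ v) · conj (c ⊙ v)       ≡⟨ cong ((c ⊙ v) ·_) (conj-⊙ c v) ⟩
    (c ⊙ v) · (σ c ⊙ conj v)     ≡⟨ trans (·-⊙ˡ c v _) (cong (c *_) (·-⊙ʳ (σ c) v (conj v))) ⟩
    c * (σ c * h v v)            ≡⟨ sym (*-assoc c (σ c) _) ⟩
    N c * h v v                  ≡⟨ cong (N c *_) (h-diag v) ⟩
    N c * H v                    ∎
    where open ≡-Reasoning

  H-pencil : ∀ P Q t → H (P ⊕ t ⊙ Q) ≡ H P + (t * h Q P + σ t * h P Q) + N t * H Q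
  H-pencil P Q t = begin
    H (P ⊕ t ⊙ Q)
      ≡⟨ sym (h-diag (P ⊕ t ⊙ Q)) ⟩
    (P ⊕ t ⊙ Q) · conj (P ⊕ t ⊙ Q)
      ≡⟨ cong ((P ⊕ t ⊙ Q) ·_) (trans (conj-⊕ P (t ⊙ Q)) (cong (conj P ⊕_) (conj-⊙ t Q))) ⟩
    (P ⊕ t ⊙ Q) · (conj P ⊕ σ t ⊙ conj Q)
      ≡⟨ trans (·-⊕ˡ P (t ⊙ Q) _) (cong₂ _+_ (·-⊕ʳ P (conj P) _) (·-⊕ʳ (t ⊙ Q) (conj P) _)) ⟩
    (h P P + P · (σ t ⊙ conj Q)) + ((t ⊙ Q) · conj P + (t ⊙ Q) · (σ t ⊙ conj Q))
      ≡⟨ cong₂ (λ u v → (h P P + u) + (v + (t ⊙ Q) · (σ t ⊙ conj Q))) (·-⊙ʳ (σ t) P (conj Q)) (·-⊙ˡ t Q (conj P)) ⟩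
    (h P P + σ t * h P Q) + (t * h Q P + (t ⊙ Q) · (σ t ⊙ conj Q))
      ≡⟨ cong (λ u → (h P P + σ t * h P Q) + (t * h Q P + u)) (trans (·-⊙ˡ t Q _) (cong (t *_) (·-⊙ʳ (σ t) Q (conj Q)))) ⟩
    (h P P + σ t * h P Q) + (t * h Q P + t * (σ t * h Q Q))
      ≡⟨ solve 6 (λ a b c d t s → (a :+ s :* b) :+ (t :* c :+ t :* (s :* d)) := a :+ (t :* c :+ s :* b) :+ (t :* s) :* d)
           refl (h P P) (h P Q) (h Q P) (h Q Q) t (σ t) ⟩
    h P P + (t * h Q P + σ t * h P Q) + N t * h Q Q
      ≡⟨ cong₂ (λ u v → u + (t * h Q P + σ t * h P Q) + N t * v) (h-diag P) (h-diag Q) ⟩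
    H P + (t * h Q P + σ t * h P Q) + N t * H Q ∎
    where open ≡-Reasoning

  H-normalize : ∀ {v} → v ≢ 𝟎 → H v ≡ 0# → H (normalize v) ≡ 0#
  H-normalize {v} v≢𝟎 Hv≡0 with normalize-∼ v≢𝟎
  ... | c , _ , nv≡cv = trans (cong H nv≡cv) (trans (H-⊙ c v) (trans (cong (N c *_) Hv≡0) (zeroʳ _)))

  module _ {P Q : Triple} (P∈U : P ∈ unital) (Q∈U : Q ∈ unital) (P≢Q : P ≢ Q) where

    private
      nP : Normalized P
      nP = proj₁ (∈unital⇒ P∈U)
      nQ : Normalized Q
      nQ = proj₁ (∈unital⇒ Q∈U)
      HP≡0 : H P ≡ 0#
      HP≡0 = proj₂ (∈unital⇒ P∈U)
      HQ≡0 : H Q ≡ 0#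
      HQ≡0 = proj₂ (∈unital⇒ Q∈U)
      P⨯Q≢𝟎 : P ⨯ Q ≢ 𝟎
      P⨯Q≢𝟎 = distinct⇒⨯≢𝟎 nP nQ P≢Q

    -- Otherwise conj P and conj Q would both be orthogonal to P and Q, hence both proportional to P ⨯ Q.
    h≢0 : h Q P ≢ 0#
    h≢0 hQP≡0 = P≢Q (normalized-∼⇒≡ nP nQ (unconj (∼-trans (conj-∼-⨯ P nP P·conjP≡0 Q·conjP≡0)
                                                          (∼-sym (conj-∼-⨯ Q nQ P·conjQ≡0 Q·conjQ≡0)))))
      where
      P·conjP≡0 = trans (h-diag P) HP≡0
      Q·conjQ≡0 = trans (h-diag Q) HQ≡0
      Q·conjP≡0 = hQP≡0
      P·conjQ≡0 = trans (h-conj P Q) (trans (cong σ hQP≡0) σ-0)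
      conj-∼-⨯ : ∀ X → Normalized X → P · conj X ≡ 0# → Q · conj X ≡ 0# → conj X ∼ P ⨯ Q
      conj-∼-⨯ X nX P⊥ Q⊥ = ⨯≡𝟎⇒∼ (⊥⊥⇒⨯≡𝟎 (conj X) P Q (trans (·-comm (conj X) P) P⊥) (trans (·-comm (conj X) Q) Q⊥))
        (conj≢𝟎 (Normalized⇒≢𝟎 nX)) P⨯Q≢𝟎
      unconj : ∀ {u v} → conj u ∼ conj v → u ∼ v
      unconj {u} {v} c∼ = subst₂ _∼_ (conj-involutive u) (conj-involutive v) (conj-∼ c∼)

    H-pencil≡Tr : ∀ t → H (P ⊕ t ⊙ Q) ≡ Tr (t * h Q P)
    H-pencil≡Tr t = begin
      H (P ⊕ t ⊙ Q)                                         ≡⟨ H-pencil P Q t ⟩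
      H P + (t * h Q P + σ t * h P Q) + N t * H Q           ≡⟨ cong₂ (λ a b → a + (t * h Q P + σ t * h P Q) + N t * b) HP≡0 HQ≡0 ⟩
      0# + (t * h Q P + σ t * h P Q) + N t * 0#             ≡⟨ solve 3 (λ a b n → :0 :+ (a :+ b) :+ n :* :0 := a :+ b) refl _ _ (N t) ⟩
      t * h Q P + σ t * h P Q                               ≡⟨ cong (λ z → t * h Q P + σ t * z) (h-conj P Q) ⟩
      t * h Q P + σ t * σ (h Q P)                           ≡⟨ cong (t * h Q P +_) (sym (σ-* t (h Q P))) ⟩
      Tr (t * h Q P)                                        ∎
      where open ≡-Reasoning

    private
      b : Carrier
      b = h Q P

      params : List Carrier
      params = filter (λ t → Tr (t * b) ≟ 0#) elements

      |params|≡q : length params ≡ q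
      |params|≡q = trans (length-bijection (_* b) params (filter (λ x → Tr x ≟ 0#) elements)
        (filter⁺ (λ t → Tr (t * b) ≟ 0#) elements-unique) (filter⁺ (λ x → Tr x ≟ 0#) elements-unique)
        (λ t t∈ → ∈-filter⁺ (λ x → Tr x ≟ 0#) (elements-complete _) (proj₂ (∈-filter⁻ (λ t → Tr (t * b) ≟ 0#) {xs = elements} t∈)))
        (λ t t′ _ _ → *-cancelʳ h≢0)
        (λ s s∈ → s * b ⁻¹ , ∈-filter⁺ (λ t → Tr (t * b) ≟ 0#) (elements-complete _)
                              (subst (λ z → Tr z ≡ 0#) (sym (s*b⁻¹*b≡s s)) (proj₂ (∈-filter⁻ (λ x → Tr x ≟ 0#) {xs = elements} s∈)))
                         , s*b⁻¹*b≡s s))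
        |Tr⁻¹0|≡q
        where
        s*b⁻¹*b≡s : ∀ s → s * b ⁻¹ * b ≡ s
        s*b⁻¹*b≡s s = trans (*-assoc s _ b) (trans (cong (s *_) (⁻¹-inverseˡ h≢0)) (*-identityʳ s))

      onLine : List Triple
      onLine = filter (λ R → det P Q R ≟ 0#) unital

      onLine∖Q : List Triple
      onLine∖Q = filter (λ R → ¬? (R ≟T Q)) onLine

      point : Carrier → Triple
      point t = normalize (P ⊕ t ⊙ Q)

      point∼ : ∀ t → point t ∼ P ⊕ t ⊙ Q
      point∼ t = normalize-∼ (pencil≢𝟎 P⨯Q≢𝟎 t)

      point∈ : ∀ t → t ∈ params → point t ∈ onLine∖Q
      point∈ t t∈ = ∈-filter⁺ (λ R → ¬? (R ≟T Q))
        (∈-filter⁺ (λ R → det P Q R ≟ 0#)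
          (unital-complete (normalize-normalized (pencil≢𝟎 P⨯Q≢𝟎 t))
            (H-normalize (pencil≢𝟎 P⨯Q≢𝟎 t) (trans (H-pencil≡Tr t) (proj₂ (∈-filter⁻ (λ t → Tr (t * b) ≟ 0#) {xs = elements} t∈)))))
          (·≡0-resp-∼ˡ (P ⨯ Q) (point∼ t) (det-pencil P Q t)))
        (λ point≡Q → pencil≁end P⨯Q≢𝟎 t (∼-trans (∼-sym (point∼ t)) (subst (_∼ Q) (sym point≡Q) ∼-refl)))

      point-injective : ∀ t t′ → t ∈ params → t′ ∈ params → point t ≡ point t′ → t ≡ t′
      point-injective t t′ _ _ eq =
        pencil-injective P⨯Q≢𝟎 (∼-trans (∼-sym (point∼ t)) (subst (_∼ P ⊕ t′ ⊙ Q) (sym eq) (point∼ t′)))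

      point-onto : ∀ R → R ∈ onLine∖Q → ∃ λ t → t ∈ params × point t ≡ R
      point-onto R R∈ = t , t∈params ,
        sym (normalized-∼⇒≡ nR (normalize-normalized (pencil≢𝟎 P⨯Q≢𝟎 t)) (∼-trans R∼ (∼-sym (point∼ t))))
        where
        R∈onLine : R ∈ onLine
        R∈onLine = proj₁ (∈-filter⁻ (λ R → ¬? (R ≟T Q)) {xs = onLine} R∈)
        R≢Q : R ≢ Q
        R≢Q = proj₂ (∈-filter⁻ (λ R → ¬? (R ≟T Q)) {xs = onLine} R∈)
        R∈U : R ∈ unital
        R∈U = proj₁ (∈-filter⁻ (λ R → det P Q R ≟ 0#) {xs = unital} R∈onLine)
        detR≡0 : det P Q R ≡ 0#
        detR≡0 = proj₂ (∈-filter⁻ (λ R → det P Q R ≟ 0#) {xs = unital} R∈onLine)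
        nR : Normalized R
        nR = proj₁ (∈unital⇒ R∈U)
        R≁Q : ¬ R ∼ Q
        R≁Q R∼Q = R≢Q (normalized-∼⇒≡ nR nQ R∼Q)
        pencil : ∃ λ t → R ∼ P ⊕ t ⊙ Q
        pencil = pencil-complete P⨯Q≢𝟎 detR≡0 (Normalized⇒≢𝟎 nR) R≁Q
        t : Carrier
        t = proj₁ pencil
        R∼ : R ∼ P ⊕ t ⊙ Q
        R∼ = proj₂ pencil
        t∈params : t ∈ params
        t∈params = ∈-filter⁺ (λ t → Tr (t * b) ≟ 0#) (elements-complete t) (begin
          Tr (t * b)           ≡⟨ sym (H-pencil≡Tr t) ⟩
          H (P ⊕ t ⊙ Q)        ≡⟨ *-eliminateˡ (N≢0 (proj₁ (proj₂ R∼)))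
                                    (trans (sym (H-⊙ (proj₁ R∼) _)) (trans (cong H (sym (proj₂ (proj₂ R∼)))) (proj₂ (∈unital⇒ R∈U)))) ⟩
          0#                   ∎)
          where open ≡-Reasoning

    -- The points of the unital on PQ are Q and the normalisations of P + t Q with Tr (t * h Q P) ≡ 0#.
    secant-size : length (filter (λ R → det P Q R ≟ 0#) unital) ≡ suc q
    secant-size = begin
      length onLine               ≡⟨ sym (length-remove _≟T_ onLine (filter⁺ (λ R → det P Q R ≟ 0#) unital-unique) Q∈onLine) ⟩
      suc (length onLine∖Q)       ≡⟨ cong suc (sym (length-bijection point params onLine∖Q
                                       (filter⁺ (λ t → Tr (t * b) ≟ 0#) elements-unique)
                                       (filter⁺ (λ R → ¬? (R ≟T Q)) (filter⁺ (λ R → det P Q R ≟ 0#) unital-unique))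
                                       point∈ point-injective point-onto)) ⟩
      suc (length params)         ≡⟨ cong suc |params|≡q ⟩
      suc q                       ∎
      where
      open ≡-Reasoning
      Q∈onLine : Q ∈ onLine
      Q∈onLine = ∈-filter⁺ (λ R → det P Q R ≟ 0#) Q∈U (det-alternating₂₃ P Q)

  lineThrough∈secants : ∀ {P Q} → P ∈ unital → Q ∈ unital → P ≢ Q → lineThrough P Q ∈ secants
  lineThrough∈secants {P} {Q} P∈U Q∈U P≢Q =
    ∈-filter⁺ (λ ℓ → length (filter (λ X → X I? ℓ) unital) ℕ.≟ suc q)
      (points-complete (lineThrough-normalized nP nQ P≢Q))
      (trans (length-filter-cong (λ X → X I? lineThrough P Q) (λ R → det P Q R ≟ 0#) unital
               (λ R _ → I-lineThrough⁻ nP nQ P≢Q R) (λ R _ → I-lineThrough⁺ nP nQ P≢Q R))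
             (secant-size P∈U Q∈U P≢Q))
    where
    nP = proj₁ (∈unital⇒ P∈U)
    nQ = proj₁ (∈unital⇒ Q∈U)

  NoCommonPoint : Triple → Triple → Triple → Set
  NoCommonPoint a b c = ∀ X → X ∈ points → X I a → X I b → X I c → ⊥

  Adjacent-sym : ∀ {a b} → Adjacent a b → Adjacent b a
  Adjacent-sym (a≢b , common) = (λ b≡a → a≢b (sym b≡a)) , Any.map (λ (Xa , Xb) → Xb , Xa) common

  Triangle′ : Triple × Triple × Triple → Set
  Triangle′ (a , b , c) = Adjacent a b × Adjacent b c × Adjacent a c × NoCommonPoint a b c

  Triangle′⇒IsTriangle : ∀ {a b c} → Triangle′ (a , b , c) → IsTriangle (a , b , c)
  Triangle′⇒IsTriangle {a} {b} {c} (ab , bc , ac , noCommon) =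
    ab , bc , ac ,
    none (λ (Xa , Xb) (_ , Xc) → Xa , Xb , Xc) ,
    none (λ (Xb , Xc) (Xa , _) → Xa , Xb , Xc) ,
    none (λ (Xa , Xb) (_ , Xc) → Xa , Xb , Xc)
    where
    none : ∀ {A B : Triple → Set} → (∀ {X} → A X → B X → X I a × X I b × X I c) → ¬ Any (λ X → A X × B X) points
    none three any with find any
    ... | X , X∈ , (AX , BX) = let (Xa , Xb , Xc) = three AX BX in noCommon X X∈ Xa Xb Xc

  IsTriangle⇒Triangle′ : ∀ {a b c} → IsTriangle (a , b , c) → Triangle′ (a , b , c)
  IsTriangle⇒Triangle′ (ab , bc , ac , _ , _ , distinct) =
    ab , bc , ac , λ X X∈ Xa Xb Xc → distinct (lose X∈ ((Xa , Xb) , (Xa , Xc)))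

  Triangle′-swap₁₂ : ∀ {a b c} → Triangle′ (a , b , c) → Triangle′ (b , a , c)
  Triangle′-swap₁₂ (ab , bc , ac , noCommon) = Adjacent-sym ab , ac , bc , λ X X∈ Xb Xa Xc → noCommon X X∈ Xa Xb Xc

  Triangle′-swap₂₃ : ∀ {a b c} → Triangle′ (a , b , c) → Triangle′ (a , c , b)
  Triangle′-swap₂₃ (ab , bc , ac , noCommon) = ac , Adjacent-sym bc , ab , λ X X∈ Xa Xc Xb → noCommon X X∈ Xa Xb Xc

  IsTriangle-swap₁₂ : ∀ {a b c} → IsTriangle (a , b , c) → IsTriangle (b , a , c)
  IsTriangle-swap₁₂ = Triangle′⇒IsTriangle ∘ Triangle′-swap₁₂ ∘ IsTriangle⇒Triangle′

  IsTriangle-swap₂₃ : ∀ {a b c} → IsTriangle (a , b , c) → IsTriangle (a , c , b)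
  IsTriangle-swap₂₃ = Triangle′⇒IsTriangle ∘ Triangle′-swap₂₃ ∘ IsTriangle⇒Triangle′

  module _ {P Q R : Triple} (P∈U : P ∈ unital) (Q∈U : Q ∈ unital) (R∈U : R ∈ unital)
    (det≢0 : det P Q R ≢ 0#) where

    private
      nP : Normalized P
      nP = proj₁ (∈unital⇒ P∈U)
      nQ : Normalized Q
      nQ = proj₁ (∈unital⇒ Q∈U)
      nR : Normalized R
      nR = proj₁ (∈unital⇒ R∈U)

    distinct₁₂ : P ≢ Q
    distinct₁₂ refl = det≢0 (det-alternating₁₂ P R)

    distinct₁₃ : P ≢ R
    distinct₁₃ refl = det≢0 (det-alternating P Q)

    distinct₂₃ : Q ≢ R
    distinct₂₃ refl = det≢0 (det-alternating₂₃ P Q)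

    P-on-PQ : P I lineThrough P Q
    P-on-PQ = I-lineThroughˡ nP nQ distinct₁₂

    Q-on-PQ : Q I lineThrough P Q
    Q-on-PQ = I-lineThroughʳ nP nQ distinct₁₂

    P-on-PR : P I lineThrough P R
    P-on-PR = I-lineThroughˡ nP nR distinct₁₃

    R-on-PR : R I lineThrough P R
    R-on-PR = I-lineThroughʳ nP nR distinct₁₃

    Q-on-QR : Q I lineThrough Q R
    Q-on-QR = I-lineThroughˡ nQ nR distinct₂₃

    R-on-QR : R I lineThrough Q R
    R-on-QR = I-lineThroughʳ nQ nR distinct₂₃

    private
      nPQ : Normalized (lineThrough P Q)
      nPQ = lineThrough-normalized nP nQ distinct₁₂
      nPR : Normalized (lineThrough P R)
      nPR = lineThrough-normalized nP nR distinct₁₃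
      nQR : Normalized (lineThrough Q R)
      nQR = lineThrough-normalized nQ nR distinct₂₃
      R∉PQ : ¬ R I lineThrough P Q
      R∉PQ R∈PQ = det≢0 (I-lineThrough⁻ nP nQ distinct₁₂ R R∈PQ)
      P∉QR : ¬ P I lineThrough Q R
      P∉QR P∈QR = det≢0 (trans (det-cyclic P Q R) (I-lineThrough⁻ nQ nR distinct₂₃ P P∈QR))

    PQ≢PR : lineThrough P Q ≢ lineThrough P R
    PQ≢PR PQ≡PR = R∉PQ (subst (R I_) (sym PQ≡PR) R-on-PR)

    PQ≢QR : lineThrough P Q ≢ lineThrough Q R
    PQ≢QR PQ≡QR = P∉QR (subst (P I_) PQ≡QR P-on-PQ)

    PR≢QR : lineThrough P R ≢ lineThrough Q R
    PR≢QR PR≡QR = P∉QR (subst (P I_) PR≡QR P-on-PR)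

    vertexP : ∀ {X} → Normalized X → X I lineThrough P Q → X I lineThrough P R → X ≡ P
    vertexP nX X∈PQ X∈PR = meet-unique nX nP nPQ nPR PQ≢PR X∈PQ X∈PR P-on-PQ P-on-PR

    vertexQ : ∀ {X} → Normalized X → X I lineThrough P Q → X I lineThrough Q R → X ≡ Q
    vertexQ nX X∈PQ X∈QR = meet-unique nX nQ nPQ nQR PQ≢QR X∈PQ X∈QR Q-on-PQ Q-on-QR

    vertexR : ∀ {X} → Normalized X → X I lineThrough P R → X I lineThrough Q R → X ≡ R
    vertexR nX X∈PR X∈QR = meet-unique nX nR nPR nQR PR≢QR X∈PR X∈QR R-on-PR R-on-QR

    sides-noCommonPoint : NoCommonPoint (lineThrough P Q) (lineThrough P R) (lineThrough Q R)
    sides-noCommonPoint X X∈ X∈PQ X∈PR X∈QR = P∉QR (subst (_I lineThrough Q R) (vertexP (∈points⇒Normalized X∈) X∈PQ X∈PR) X∈QR)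

    sides-triangle : IsTriangle (lineThrough P Q , lineThrough P R , lineThrough Q R)
    sides-triangle = Triangle′⇒IsTriangle
      ((PQ≢PR , lose P∈U (P-on-PQ , P-on-PR)) , (PR≢QR , lose R∈U (R-on-PR , R-on-QR)) , (PQ≢QR , lose Q∈U (Q-on-PQ , Q-on-QR)) ,
       sides-noCommonPoint)

  Det : Triple × Triple × Triple → Carrier
  Det (P , Q , R) = det P Q R

  noncollinear : List (Triple × Triple × Triple)
  noncollinear = filter (λ t → ¬? (Det t ≟ 0#)) (cube unital)

  orderedTriangles : List (Triple × Triple × Triple)
  orderedTriangles = filter isTriangle? (cube secants)

  sides : Triple × Triple × Triple → Triple × Triple × Triple
  sides (P , Q , R) = lineThrough P Q , lineThrough P R , lineThrough Q R

  private
    ∈noncollinear⇒ : ∀ {P Q R} → (P , Q , R) ∈ noncollinear → (P ∈ unital × Q ∈ unital × R ∈ unital) × det P Q R ≢ 0#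
    ∈noncollinear⇒ t∈ = ∈-cube⁻ (proj₁ (∈-filter⁻ (λ t → ¬? (Det t ≟ 0#)) {xs = cube unital} t∈))
                      , proj₂ (∈-filter⁻ (λ t → ¬? (Det t ≟ 0#)) {xs = cube unital} t∈)

  sides∈orderedTriangles : ∀ t → t ∈ noncollinear → sides t ∈ orderedTriangles
  sides∈orderedTriangles (P , Q , R) t∈ = ∈-filter⁺ isTriangle?
    (∈-cube⁺ (lineThrough∈secants P∈U Q∈U (distinct₁₂ P∈U Q∈U R∈U det≢0))
             (lineThrough∈secants P∈U R∈U (distinct₁₃ P∈U Q∈U R∈U det≢0))
             (lineThrough∈secants Q∈U R∈U (distinct₂₃ P∈U Q∈U R∈U det≢0)))
    (sides-triangle P∈U Q∈U R∈U det≢0)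
    where
    P∈U = proj₁ (proj₁ (∈noncollinear⇒ t∈))
    Q∈U = proj₁ (proj₂ (proj₁ (∈noncollinear⇒ t∈)))
    R∈U = proj₂ (proj₂ (proj₁ (∈noncollinear⇒ t∈)))
    det≢0 = proj₂ (∈noncollinear⇒ t∈)

  private
    same-sides : ∀ {P Q R P′ Q′ R′} →
      (P ∈ unital × Q ∈ unital × R ∈ unital) × det P Q R ≢ 0# →
      (P′ ∈ unital × Q′ ∈ unital × R′ ∈ unital) × det P′ Q′ R′ ≢ 0# →
      lineThrough P Q ≡ lineThrough P′ Q′ → lineThrough P R ≡ lineThrough P′ R′ → lineThrough Q R ≡ lineThrough Q′ R′ →
      (P , Q , R) ≡ (P′ , Q′ , R′)
    same-sides {P} {Q} {R} {P′} {Q′} {R′} ((P∈U , Q∈U , R∈U) , det≢0) ((P′∈U , Q′∈U , R′∈U) , det′≢0) a≡ b≡ c≡ =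
      ≡-vertices (vertexP P∈U Q∈U R∈U det≢0 (normalized P′∈U) (moved a≡ (P-on-PQ P′∈U Q′∈U R′∈U det′≢0))
                                                                (moved b≡ (P-on-PR P′∈U Q′∈U R′∈U det′≢0)))
                 (vertexQ P∈U Q∈U R∈U det≢0 (normalized Q′∈U) (moved a≡ (Q-on-PQ P′∈U Q′∈U R′∈U det′≢0))
                                                                (moved c≡ (Q-on-QR P′∈U Q′∈U R′∈U det′≢0)))
                 (vertexR P∈U Q∈U R∈U det≢0 (normalized R′∈U) (moved b≡ (R-on-PR P′∈U Q′∈U R′∈U det′≢0))
                                                                (moved c≡ (R-on-QR P′∈U Q′∈U R′∈U det′≢0)))
      where
      normalized : ∀ {X} → X ∈ unital → Normalized X
      normalized X∈U = proj₁ (∈unital⇒ X∈U)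
      moved : ∀ {X ℓ ℓ′} → ℓ ≡ ℓ′ → X I ℓ′ → X I ℓ
      moved ℓ≡ℓ′ = subst (_ I_) (sym ℓ≡ℓ′)
      ≡-vertices : P′ ≡ P → Q′ ≡ Q → R′ ≡ R → (P , Q , R) ≡ (P′ , Q′ , R′)
      ≡-vertices refl refl refl = refl

  sides-injective : ∀ t t′ → t ∈ noncollinear → t′ ∈ noncollinear → sides t ≡ sides t′ → t ≡ t′
  sides-injective _ _ t∈ t′∈ sides≡ = same-sides (∈noncollinear⇒ t∈) (∈noncollinear⇒ t′∈)
    (cong proj₁ sides≡) (cong (proj₁ ∘ proj₂) sides≡) (cong (proj₂ ∘ proj₂) sides≡)

  module _ {a b c : Triple} (s∈ : (a , b , c) ∈ orderedTriangles) where

    private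
      abc∈ : a ∈ secants × b ∈ secants × c ∈ secants
      abc∈ = ∈-cube⁻ (proj₁ (∈-filter⁻ isTriangle? {xs = cube secants} s∈))
      triangle : IsTriangle (a , b , c)
      triangle = proj₂ (∈-filter⁻ isTriangle? {xs = cube secants} s∈)
      na : Normalized a
      na = ∈secants⇒Normalized (proj₁ abc∈)
      nb : Normalized b
      nb = ∈secants⇒Normalized (proj₁ (proj₂ abc∈))
      nc : Normalized c
      nc = ∈secants⇒Normalized (proj₂ (proj₂ abc∈))
      Pab : ∃ λ X → X ∈ unital × X I a × X I b
      Pab = find (proj₂ (proj₁ triangle))
      Rbc : ∃ λ X → X ∈ unital × X I b × X I c
      Rbc = find (proj₂ (proj₁ (proj₂ triangle)))
      Qac : ∃ λ X → X ∈ unital × X I a × X I c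
      Qac = find (proj₂ (proj₁ (proj₂ (proj₂ triangle))))
      P Q R : Triple
      P = proj₁ Pab
      Q = proj₁ Qac
      R = proj₁ Rbc
      P∈U : P ∈ unital
      P∈U = proj₁ (proj₂ Pab)
      Q∈U : Q ∈ unital
      Q∈U = proj₁ (proj₂ Qac)
      R∈U : R ∈ unital
      R∈U = proj₁ (proj₂ Rbc)
      Pa : P I a
      Pa = proj₁ (proj₂ (proj₂ Pab))
      Pb : P I b
      Pb = proj₂ (proj₂ (proj₂ Pab))
      Qa : Q I a
      Qa = proj₁ (proj₂ (proj₂ Qac))
      Qc : Q I c
      Qc = proj₂ (proj₂ (proj₂ Qac))
      Rb : R I b
      Rb = proj₁ (proj₂ (proj₂ Rbc))
      Rc : R I c
      Rc = proj₂ (proj₂ (proj₂ Rbc))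
      nP : Normalized P
      nP = proj₁ (∈unital⇒ P∈U)
      nQ : Normalized Q
      nQ = proj₁ (∈unital⇒ Q∈U)
      nR : Normalized R
      nR = proj₁ (∈unital⇒ R∈U)

      noCommon : ∀ X → X ∈ unital → X I a → X I b → X I c → ⊥
      noCommon X X∈ Xa Xb Xc = proj₂ (proj₂ (proj₂ (proj₂ (proj₂ triangle)))) (lose (unital⊆points X∈) ((Xa , Xb) , (Xa , Xc)))

      P≢Q : P ≢ Q
      P≢Q P≡Q = noCommon P P∈U Pa Pb (subst (_I c) (sym P≡Q) Qc)

      P≢R : P ≢ R
      P≢R P≡R = noCommon P P∈U Pa Pb (subst (_I c) (sym P≡R) Rc)

      Q≢R : Q ≢ R
      Q≢R Q≡R = noCommon Q Q∈U Qa (subst (_I b) (sym Q≡R) Rb) Qc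

      side : ∀ {X Y ℓ} (nX : Normalized X) (nY : Normalized Y) (X≢Y : X ≢ Y) → Normalized ℓ → X I ℓ → Y I ℓ →
        lineThrough X Y ≡ ℓ
      side nX nY X≢Y nℓ Xℓ Yℓ = join-unique nX nY (lineThrough-normalized nX nY X≢Y) nℓ X≢Y
        (I-lineThroughˡ nX nY X≢Y) (I-lineThroughʳ nX nY X≢Y) Xℓ Yℓ

    corners : Triple × Triple × Triple
    corners = P , Q , R

    corners∈noncollinear : corners ∈ noncollinear
    corners∈noncollinear = ∈-filter⁺ (λ t → ¬? (Det t ≟ 0#)) (∈-cube⁺ P∈U Q∈U R∈U)
      (λ det≡0 → noCommon R R∈U (subst (R I_) (side nP nQ P≢Q na Pa Qa) (I-lineThrough⁺ nP nQ P≢Q R det≡0)) Rb Rc)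

    sides-corners : sides corners ≡ (a , b , c)
    sides-corners = cong₂ _,_ (side nP nQ P≢Q na Pa Qa) (cong₂ _,_ (side nP nR P≢R nb Pb Rb) (side nQ nR Q≢R nc Qc Rc))

  sides-onto : ∀ s → s ∈ orderedTriangles → ∃ λ t → t ∈ noncollinear × sides t ≡ s
  sides-onto _ s∈ = corners s∈ , corners∈noncollinear s∈ , sides-corners s∈

  |noncollinear|≡|orderedTriangles| : length noncollinear ≡ length orderedTriangles
  |noncollinear|≡|orderedTriangles| = length-bijection sides noncollinear orderedTriangles
    (filter⁺ (λ t → ¬? (Det t ≟ 0#)) (cube-unique unital-unique))
    (filter⁺ isTriangle? (cube-unique secants-unique))
    sides∈orderedTriangles sides-injective sides-onto

  private
    q³ : ℕ
    q³ = q ℕ.* (q ℕ.* q)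

  noncollinear-thirds : ∀ {P Q} → P ∈ unital → Q ∈ unital →
    ∑[ R ∈ unital ] 𝟙 (¬? (det P Q R ≟ 0#)) ≡ (q³ ℕ.∸ q) ℕ.* 𝟙 (¬? (Q ≟T P))
  noncollinear-thirds {P} {Q} P∈U Q∈U =
    trans (sym (length-filter≡∑𝟙 (λ R → ¬? (det P Q R ≟ 0#)) unital)) (by-cases (Q ≟T P))
    where
    noncollinear-R = length (filter (λ R → ¬? (det P Q R ≟ 0#)) unital)
    split : length (filter (λ R → det P Q R ≟ 0#) unital) ℕ.+ noncollinear-R ≡ length unital
    split = length-filter+length-filter¬ (λ R → det P Q R ≟ 0#) unital
    by-cases : (d : Dec (Q ≡ P)) → noncollinear-R ≡ (q³ ℕ.∸ q) ℕ.* 𝟙 (¬? d)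
    by-cases (yes refl) = trans (ℕ.+-cancelˡ-≡ (length unital) _ 0 (begin
      length unital ℕ.+ noncollinear-R                                 ≡⟨ cong (ℕ._+ noncollinear-R) (sym all-collinear) ⟩
      length (filter (λ R → det P P R ≟ 0#) unital) ℕ.+ noncollinear-R ≡⟨ split ⟩
      length unital                                                    ≡⟨ sym (ℕ.+-identityʳ _) ⟩
      length unital ℕ.+ 0                                              ∎))
      (sym (ℕ.*-zeroʳ (q³ ℕ.∸ q)))
      where
      open ≡-Reasoning
      all-collinear : length (filter (λ R → det P P R ≟ 0#) unital) ≡ length unital
      all-collinear = trans (length-filter≡∑𝟙 (λ R → det P P R ≟ 0#) unital)
        (trans (∑-cong unital (λ R _ → 𝟙-yes (det P P R ≟ 0#) (det-alternating₁₂ P R)))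
          (trans (∑-const unital 1) (ℕ.*-identityʳ _)))
    by-cases (no Q≢P) = begin
      noncollinear-R                                          ≡⟨ sym (ℕ.m+n∸m≡n (suc q) noncollinear-R) ⟩
      suc q ℕ.+ noncollinear-R ℕ.∸ suc q                      ≡⟨ cong (λ n → n ℕ.+ noncollinear-R ℕ.∸ suc q) (sym secant) ⟩
      length (filter (λ R → det P Q R ≟ 0#) unital) ℕ.+ noncollinear-R ℕ.∸ suc q
                                                              ≡⟨ cong (ℕ._∸ suc q) (trans split |unital|≡q³+1) ⟩
      q³ ℕ.∸ q                                                ≡⟨ sym (ℕ.*-identityʳ _) ⟩
      (q³ ℕ.∸ q) ℕ.* 1                                        ∎
      where
      open ≡-Reasoning
      secant = secant-size P∈U Q∈U (λ P≡Q → Q≢P (sym P≡Q))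

  noncollinear-count : length noncollinear ≡ suc q³ ℕ.* ((q³ ℕ.∸ q) ℕ.* q³)
  noncollinear-count = begin
    length noncollinear
      ≡⟨ trans (length-filter≡∑𝟙 (λ t → ¬? (Det t ≟ 0#)) (cube unital)) (∑-cube unital _) ⟩
    ∑[ P ∈ unital ] ∑[ Q ∈ unital ] ∑[ R ∈ unital ] 𝟙 (¬? (det P Q R ≟ 0#))
      ≡⟨ ∑-cong unital (λ P P∈U → trans (∑-cong unital (λ Q Q∈U → noncollinear-thirds P∈U Q∈U))
           (trans (∑-*ˡ unital (q³ ℕ.∸ q) (λ Q → 𝟙 (¬? (Q ≟T P)))) (cong ((q³ ℕ.∸ q) ℕ.*_) (others P∈U)))) ⟩
    ∑[ _ ∈ unital ] ((q³ ℕ.∸ q) ℕ.* q³)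
      ≡⟨ trans (∑-const unital ((q³ ℕ.∸ q) ℕ.* q³)) (cong (ℕ._* ((q³ ℕ.∸ q) ℕ.* q³)) |unital|≡q³+1) ⟩
    suc q³ ℕ.* ((q³ ℕ.∸ q) ℕ.* q³) ∎
    where
    open ≡-Reasoning
    others : ∀ {P} → P ∈ unital → ∑[ Q ∈ unital ] 𝟙 (¬? (Q ≟T P)) ≡ q³
    others {P} P∈U = ℕ.suc-injective (trans (cong suc (sym (length-filter≡∑𝟙 (λ Q → ¬? (Q ≟T P)) unital)))
      (trans (length-remove _≟T_ unital unital-unique P∈U) |unital|≡q³+1))


  |orderedTriangles|≡6*|triangles| : length orderedTriangles ≡ 6 ℕ.* length triangles
  |orderedTriangles|≡6*|triangles| = begin
    length orderedTriangles
      ≡⟨ trans (length-filter≡∑𝟙 isTriangle? (cube secants)) (∑-cube secants _) ⟩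
    ∑[ a ∈ secants ] ∑[ b ∈ secants ] ∑[ c ∈ secants ] 𝟙 (isTriangle? (a , b , c))
      ≡⟨ ∑³≡6*∑combos3 (λ t → 𝟙 (isTriangle? t)) swap₁₂ swap₂₃ degenerate secants ⟩
    6 ℕ.* ∑[ t ∈ combos3 secants ] 𝟙 (isTriangle? t)
      ≡⟨ cong (6 ℕ.*_) (sym (length-filter≡∑𝟙 isTriangle? (combos3 secants))) ⟩
    6 ℕ.* length triangles ∎
    where
    open ≡-Reasoning
    swap₁₂ : ∀ a b c → 𝟙 (isTriangle? (a , b , c)) ≡ 𝟙 (isTriangle? (b , a , c))
    swap₁₂ a b c = 𝟙-cong (isTriangle? _) (isTriangle? _) IsTriangle-swap₁₂ IsTriangle-swap₁₂
    swap₂₃ : ∀ a b c → 𝟙 (isTriangle? (a , b , c)) ≡ 𝟙 (isTriangle? (a , c , b))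
    swap₂₃ a b c = 𝟙-cong (isTriangle? _) (isTriangle? _) IsTriangle-swap₂₃ IsTriangle-swap₂₃
    degenerate : ∀ a c → 𝟙 (isTriangle? (a , a , c)) ≡ 0
    degenerate a c = 𝟙-no (isTriangle? _) (λ ((a≢a , _) , _) → a≢a refl)

𝟙-monochromatic : ∀ x y z →
  (𝟙 (x ≟C red) ℕ.* 𝟙 (z ≟C red) ℕ.+ (𝟙 (x ≟C red) ℕ.* 𝟙 (y ≟C red) ℕ.+ 𝟙 (z ≟C red) ℕ.* 𝟙 (y ≟C red))) ℕ.+
  (𝟙 (x ≟C blue) ℕ.* 𝟙 (z ≟C blue) ℕ.+ (𝟙 (x ≟C blue) ℕ.* 𝟙 (y ≟C blue) ℕ.+ 𝟙 (z ≟C blue) ℕ.* 𝟙 (y ≟C blue)))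
  ≡ 1 ℕ.+ 2 ℕ.* 𝟙 ((x ≟C y) ×-dec (y ≟C z))
𝟙-monochromatic red red red = refl
𝟙-monochromatic red red blue = refl
𝟙-monochromatic red blue red = refl
𝟙-monochromatic red blue blue = refl
𝟙-monochromatic blue red red = refl
𝟙-monochromatic blue red blue = refl
𝟙-monochromatic blue blue red = refl
𝟙-monochromatic blue blue blue = refl

module Colouring (F : FiniteField) (q : ℕ) (Δ : Geometry.Triple F q → Geometry.Triple F q → Color)
  (Δ-sym : ∀ ℓ m → Δ ℓ m ≡ Δ m ℓ) where

  open Geometry F q
  open Colored Δ
  open PlaneGeometry F q using (secants-unique)

  private
    both : Color → Triple → Triple → Triple → ℕ
    both κ v w u = 𝟙 (Δ v w ≟C κ) ℕ.* 𝟙 (Δ v u ≟C κ)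

  vertices-bothAt : ∀ κ {a b c} → a ∈ secants → b ∈ secants → c ∈ secants → a ≢ b → b ≢ c → a ≢ c →
    ∑[ v ∈ secants ] 𝟙 (bothAt? κ v (a , b , c)) ≡ both κ a b c ℕ.+ (both κ b a c ℕ.+ both κ c a b)
  vertices-bothAt κ {a} {b} {c} a∈ b∈ c∈ a≢b b≢c a≢c = begin
    ∑[ v ∈ secants ] 𝟙 (bothAt? κ v (a , b , c))
      ≡⟨ ∑-cong secants (λ v _ → expand v) ⟩
    ∑[ v ∈ secants ] (at a b c v ℕ.+ (at b a c v ℕ.+ at c a b v))
      ≡⟨ trans (∑-+ secants (at a b c) _) (cong (∑ secants (at a b c) ℕ.+_) (∑-+ secants (at b a c) (at c a b))) ⟩
    ∑ secants (at a b c) ℕ.+ (∑ secants (at b a c) ℕ.+ ∑ secants (at c a b))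
      ≡⟨ cong₂ ℕ._+_ (pick a∈) (cong₂ ℕ._+_ (pick b∈) (pick c∈)) ⟩
    both κ a b c ℕ.+ (both κ b a c ℕ.+ both κ c a b) ∎
    where
    open ≡-Reasoning
    at : Triple → Triple → Triple → Triple → ℕ
    at x y z v = 𝟙 (x ≟T v) ℕ.* both κ x y z
    pick : ∀ {x y z} → x ∈ secants → ∑ secants (at x y z) ≡ both κ x y z
    pick {x} {y} {z} x∈ = ∑-𝟙≟ _≟T_ secants (λ _ → both κ x y z) secants-unique x∈
    corner : ∀ v x y z → Dec (v ≡ x × Δ x y ≡ κ × Δ x z ≡ κ)
    corner v x y z = (v ≟T x) ×-dec (Δ x y ≟C κ) ×-dec (Δ x z ≟C κ)
    𝟙-corner : ∀ v x y z → 𝟙 (corner v x y z) ≡ at x y z v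
    𝟙-corner v x y z = trans (𝟙-× (v ≟T x) ((Δ x y ≟C κ) ×-dec (Δ x z ≟C κ)))
      (cong₂ ℕ._*_ (𝟙≟-sym _≟T_ v x) (𝟙-× (Δ x y ≟C κ) (Δ x z ≟C κ)))
    expand : ∀ v → 𝟙 (bothAt? κ v (a , b , c)) ≡ at a b c v ℕ.+ (at b a c v ℕ.+ at c a b v)
    expand v = trans (𝟙-⊎ (corner v a b c) (corner v b a c ⊎-dec corner v c a b)
                        (λ { ((v≡a , _) , inj₁ (v≡b , _)) → a≢b (trans (sym v≡a) v≡b)
                           ; ((v≡a , _) , inj₂ (v≡c , _)) → a≢c (trans (sym v≡a) v≡c) }))
      (cong₂ ℕ._+_ (𝟙-corner v a b c)
        (trans (𝟙-⊎ (corner v b a c) (corner v c a b) (λ ((v≡b , _) , (v≡c , _)) → b≢c (trans (sym v≡b) v≡c)))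
          (cong₂ ℕ._+_ (𝟙-corner v b a c) (𝟙-corner v c a b))))

  private
    per-triangle : ∀ {a b c} → (a , b , c) ∈ triangles →
      ∑[ v ∈ secants ] (𝟙 (bothAt? red v (a , b , c)) ℕ.+ 𝟙 (bothAt? blue v (a , b , c))) ≡ 1 ℕ.+ 2 ℕ.* 𝟙 (mono? (a , b , c))
    per-triangle {a} {b} {c} t∈ = begin
      ∑[ v ∈ secants ] (𝟙 (bothAt? red v (a , b , c)) ℕ.+ 𝟙 (bothAt? blue v (a , b , c)))
        ≡⟨ ∑-+ secants _ _ ⟩
      ∑[ v ∈ secants ] 𝟙 (bothAt? red v (a , b , c)) ℕ.+ ∑[ v ∈ secants ] 𝟙 (bothAt? blue v (a , b , c))
        ≡⟨ cong₂ ℕ._+_ (corners red) (corners blue) ⟩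
      (both red a b c ℕ.+ (both red b a c ℕ.+ both red c a b)) ℕ.+ (both blue a b c ℕ.+ (both blue b a c ℕ.+ both blue c a b))
        ≡⟨ cong₂ (λ u v → (both red a b c ℕ.+ u) ℕ.+ (both blue a b c ℕ.+ v)) (relabel red) (relabel blue) ⟩
      (both red a b c ℕ.+ (𝟙 (Δ a b ≟C red) ℕ.* 𝟙 (Δ b c ≟C red) ℕ.+ 𝟙 (Δ a c ≟C red) ℕ.* 𝟙 (Δ b c ≟C red))) ℕ.+
      (both blue a b c ℕ.+ (𝟙 (Δ a b ≟C blue) ℕ.* 𝟙 (Δ b c ≟C blue) ℕ.+ 𝟙 (Δ a c ≟C blue) ℕ.* 𝟙 (Δ b c ≟C blue)))
        ≡⟨ 𝟙-monochromatic (Δ a b) (Δ b c) (Δ a c) ⟩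
      1 ℕ.+ 2 ℕ.* 𝟙 (mono? (a , b , c)) ∎
      where
      open ≡-Reasoning
      members = ∈-combos3⁻ secants (proj₁ (∈-filter⁻ isTriangle? {xs = combos3 secants} t∈))
      triangle = proj₂ (∈-filter⁻ isTriangle? {xs = combos3 secants} t∈)
      corners : ∀ κ → ∑[ v ∈ secants ] 𝟙 (bothAt? κ v (a , b , c)) ≡ both κ a b c ℕ.+ (both κ b a c ℕ.+ both κ c a b)
      corners κ = vertices-bothAt κ (proj₁ members) (proj₁ (proj₂ members)) (proj₂ (proj₂ members))
        (proj₁ (proj₁ triangle)) (proj₁ (proj₁ (proj₂ triangle))) (proj₁ (proj₁ (proj₂ (proj₂ triangle))))
      relabel : ∀ κ → both κ b a c ℕ.+ both κ c a b ≡
        𝟙 (Δ a b ≟C κ) ℕ.* 𝟙 (Δ b c ≟C κ) ℕ.+ 𝟙 (Δ a c ≟C κ) ℕ.* 𝟙 (Δ b c ≟C κ)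
      relabel κ = cong₂ ℕ._+_ (cong (λ x → 𝟙 (x ≟C κ) ℕ.* 𝟙 (Δ b c ≟C κ)) (Δ-sym b a))
        (cong₂ (λ x y → 𝟙 (x ≟C κ) ℕ.* 𝟙 (y ≟C κ)) (Δ-sym c a) (Δ-sym c b))

  sumRB≡|triangles|+2*monoCount : sumRB ≡ length triangles ℕ.+ 2 ℕ.* monoCount
  sumRB≡|triangles|+2*monoCount = begin
    ∑[ v ∈ secants ] (R[ v ] ℕ.+ B[ v ])
      ≡⟨ ∑-cong secants (λ v _ → trans (cong₂ ℕ._+_ (length-filter≡∑𝟙 (bothAt? red v) triangles)
                                                      (length-filter≡∑𝟙 (bothAt? blue v) triangles))
                                          (sym (∑-+ triangles _ _))) ⟩
    ∑[ v ∈ secants ] ∑[ t ∈ triangles ] (𝟙 (bothAt? red v t) ℕ.+ 𝟙 (bothAt? blue v t))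
      ≡⟨ ∑-swap secants triangles _ ⟩
    ∑[ t ∈ triangles ] ∑[ v ∈ secants ] (𝟙 (bothAt? red v t) ℕ.+ 𝟙 (bothAt? blue v t))
      ≡⟨ ∑-cong triangles (λ _ t∈ → per-triangle t∈) ⟩
    ∑[ t ∈ triangles ] (1 ℕ.+ 2 ℕ.* 𝟙 (mono? t))
      ≡⟨ ∑-+ triangles _ _ ⟩
    ∑[ _ ∈ triangles ] 1 ℕ.+ ∑[ t ∈ triangles ] (2 ℕ.* 𝟙 (mono? t))
      ≡⟨ cong₂ ℕ._+_ (trans (∑-const triangles 1) (ℕ.*-identityʳ (length triangles)))
                      (trans (∑-*ˡ triangles 2 (λ t → 𝟙 (mono? t))) (cong (2 ℕ.*_) (sym (length-filter≡∑𝟙 mono? triangles)))) ⟩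
    length triangles ℕ.+ 2 ℕ.* monoCount ∎
    where open ≡-Reasoning

open import Data.Nat.Base using (_+_; _*_; _∸_; _^_)
open import Data.Nat.Properties using (m+n∸m≡n; *-identityʳ)

|triangles|-formula : ∀ q → ((q ^ 4 ∸ q ^ 3) + q ^ 2) * (q ^ 3 ∸ q) * (q + 1) * q
  ≡ suc (q * (q * q)) * ((q * (q * q) ∸ q) * (q * (q * q)))
|triangles|-formula zero = refl
|triangles|-formula (suc r) = begin
  ((q ^ 4 ∸ q ^ 3) + q ^ 2) * (q ^ 3 ∸ q) * (q + 1) * q
    ≡⟨ cong (λ n → (n + q ^ 2) * (q ^ 3 ∸ q) * (q + 1) * q) (m+n∸m≡n (q ^ 3) (r * q ^ 3)) ⟩
  (r * q ^ 3 + q ^ 2) * (q ^ 3 ∸ q) * (q + 1) * q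
    ≡⟨ cong (λ n → (r * q ^ 3 + q ^ 2) * (n ∸ q) * (q + 1) * q) (cong (λ n → q * (q * n)) (*-identityʳ q)) ⟩
  (r * q ^ 3 + q ^ 2) * (q * (q * q) ∸ q) * (q + 1) * q
    ≡⟨ polynomial r (q * (q * q) ∸ q) ⟩
  suc (q * (q * q)) * ((q * (q * q) ∸ q) * (q * (q * q))) ∎
  where
  open ≡-Reasoning
  q = suc r
  -- Powers are unfolded because solve-∀ does not recognise _^_.
  polynomial : ∀ x c → (x * (suc x * (suc x * (suc x * 1))) + suc x * (suc x * 1)) * c * (suc x + 1) * suc x
                     ≡ suc (suc x * (suc x * suc x)) * (c * (suc x * (suc x * suc x)))
  polynomial = solve-∀

mainTheorem6 : (q : ℕ) → IsPrimePower q →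
    (F : FiniteField) → length (FiniteField.elements F) ≡ q ^ 2 →
    (Δ : Geometry.Triple F q → Geometry.Triple F q → Color) →
    (∀ ℓ m → Δ ℓ m ≡ Δ m ℓ) →
    12 * Geometry.Colored.monoCount F q Δ
      + ((q ^ 4 ∸ q ^ 3) + q ^ 2) * (q ^ 3 ∸ q) * (q + 1) * q
      ≡ 6 * Geometry.Colored.sumRB F q Δ
mainTheorem6 q (p , k , p-prime , 1≤k , q≡pᵏ) F |F|≡q² Δ Δ-sym = begin
  12 * M + ((q ^ 4 ∸ q ^ 3) + q ^ 2) * (q ^ 3 ∸ q) * (q + 1) * q
    ≡⟨ cong (12 * M +_) (trans (|triangles|-formula q) (sym 6*|triangles|)) ⟩
  12 * M + 6 * T
    ≡⟨ regroup M T ⟩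
  6 * (T + 2 * M)
    ≡⟨ cong (6 *_) (sym (Colouring.sumRB≡|triangles|+2*monoCount F q Δ Δ-sym)) ⟩
  6 * Geometry.Colored.sumRB F q Δ ∎
  where
  open ≡-Reasoning
  open HermitianUnital F p-prime 1≤k q≡pᵏ |F|≡q²
  M = Geometry.Colored.monoCount F q Δ
  T = length (Geometry.triangles F q)
  6*|triangles| : 6 * T ≡ suc (q * (q * q)) * ((q * (q * q) ∸ q) * (q * (q * q)))
  6*|triangles| = trans (sym |orderedTriangles|≡6*|triangles|) (trans (sym |noncollinear|≡|orderedTriangles|) noncollinear-count)
  regroup : ∀ m t → 12 * m + 6 * t ≡ 6 * (t + 2 * m)
  regroup = solve-∀
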